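{- Let $C$ and $D$ be cycles that share exactly one edge (i.e. $V(C)\cap V(D)$ consists of the two endpoints of one edge common to both), and let $G=C\oplus D$. (i) If $C=C_{2k+1}$ and $D=C_{2l+1}$ with $l\geq k\geq 1$, then $P_{DP}(G,m)=P(G,m)$ for every $m\in\mathbb{N}$. (ii) If $C=C_{2k+2}$ and $D=C_{2l+2}$ with $l\geq k\geq 1$, then for every integer $m\geq 3$, $$P_{DP}(G,m)=\frac{1}{m}\left[(m-1)^{2k+2l+3}-(m-1)^{2l+1}-(m-1)^{2k+1}-m-1\right].$$ (iii) If $C=C_{2k+1}$ and $D=C_{2l+2}$ with $l,k\geq 1$, then for every integer $m\geq 2$, $$P_{DP}(G,m)=\frac{1}{m}\left[(m-1)^{2k+2l+2}-(m-1)^{2k}-(m-1)^{2l+2}+1\right].$$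
   Context: All graphs are finite and simple; $C_r$ denotes the cycle on $r$ vertices. If $V(G_1)\cap V(G_2)$ is nonempty and induces a clique in both $G_1$ and $G_2$, the clique-sum $G_1\oplus G_2$ is the graph with vertex set $V(G_1)\cup V(G_2)$ and edge set $E(G_1)\cup E(G_2)$. For $m\in\mathbb{N}$, $P(G,m)$ denotes the number of proper $m$-colorings of $G$. A cover of a graph $G$ is a pair $\mathcal{H}=(L,H)$ where $H$ is a graph and $L:V(G)\to\mathcal{P}(V(H))$ satisfies: (1) the sets $L(u)$, $u\in V(G)$, partition $V(H)$; (2) each $H[L(u)]$ is complete; (3) if $E_H(L(u),L(v))$ is nonempty then $u=v$ or $uv\in E(G)$; (4) if $uv\in E(G)$ then $E_H(L(u),L(v))$ is a matching (possibly empty). Here $E_H(S,U)$ is the set of edges of $H$ with one endpoint in $S$ and one in $U$. The cover is $m$-fold if $|L(u)|=m$ for all $u$. An $\mathcal{H}$-coloring of $G$ is an independent set of $H$ of size $|V(G)|$. $P_{DP}(G,\mathcal{H})$ is the number of $\mathcal{H}$-colorings, and $P_{DP}(G,m)$ is the minimum of $P_{DP}(G,\mathcal{H})$ over all $m$-fold covers $\mathcal{H}$ of $G$. -}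

module Defs where

open import Data.Nat using (ℕ; zero; suc; _+_; _*_; _∸_; _≡ᵇ_; _<ᵇ_; _≤_)
open import Data.Bool using (Bool; true; false; _∧_; _∨_; not; if_then_else_)
open import Data.Fin using (Fin; toℕ)
open import Data.Fin.Subset using (Subset; _∈_; ∣_∣; inside; outside)
open import Data.Vec using (Vec; []; _∷_; lookup)
open import Data.List using (List; []; _∷_; map; concatMap; allFin; upTo; zip; length; filterᵇ; _++_)
open import Data.Bool.ListAction using (all; any)
open import Data.Product using (Σ; _×_; _,_; ∃)
open import Data.Sum using (_⊎_)
open import Relation.Binary.PropositionalEquality using (_≡_; _≢_)
open import Relation.Nullary using (¬_)

record Graph : Set where
  field
    n   : ℕ
    adj : Fin n → Fin n → Bool
open Graph public

-- Cycles given by a list of (distinct) natural-number vertex labels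
-- v₀ v₁ … v_{k-1}: edges v_i v_{i+1} and v_{k-1} v₀ (undirected).

cycleEdges : List ℕ → List (ℕ × ℕ)
cycleEdges []       = []
cycleEdges (v ∷ vs) = zip (v ∷ vs) (vs ++ (v ∷ []))

cycleAdjℕ : List ℕ → ℕ → ℕ → Bool
cycleAdjℕ vs a b =
  not (a ≡ᵇ b) ∧
  any (λ { (x , y) → ((x ≡ᵇ a) ∧ (y ≡ᵇ b)) ∨ ((x ≡ᵇ b) ∧ (y ≡ᵇ a)) }) (cycleEdges vs)

cycleC : ℕ → List ℕ
cycleC r = upTo r

-- The cycle D (with s vertices): vertices 0,1,r,r+1,…,r+s-3 (in this
-- cyclic order).  It shares with C exactly the vertices 0 and 1, i.e.
-- exactly the common edge 01.
cycleD : ℕ → ℕ → List ℕ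
cycleD r s = 0 ∷ 1 ∷ map (r +_) (upTo (s ∸ 2))

-- The clique-sum G = C ⊕ D of a cycle C = C_r and a cycle D = C_s
-- sharing exactly one edge: vertex set {0,…,r+s-3}, edge set E(C) ∪ E(D).
cycleSum : ℕ → ℕ → Graph
cycleSum r s = record
  { n   = r + s ∸ 2
  ; adj = λ a b → cycleAdjℕ (cycleC r) (toℕ a) (toℕ b)
                ∨ cycleAdjℕ (cycleD r s) (toℕ a) (toℕ b) }

allVecs : {A : Set} → List A → (k : ℕ) → List (Vec A k)
allVecs xs zero    = [] ∷ []
allVecs xs (suc k) = concatMap (λ x → map (x ∷_) (allVecs xs k)) xs

allSubsets : (N : ℕ) → List (Subset N)
allSubsets N = allVecs (outside ∷ inside ∷ []) N

memᵇ : {N : ℕ} → Fin N → Subset N → Bool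
memᵇ x S with lookup S x
... | inside  = true
... | outside = false

isProperᵇ : (G : Graph) {m : ℕ} → Vec (Fin m) (n G) → Bool
isProperᵇ G c =
  all (λ u → all (λ v → not (adj G u v ∧ (toℕ (lookup c u) ≡ᵇ toℕ (lookup c v))))
                 (allFin (n G)))
      (allFin (n G))

P : Graph → ℕ → ℕ
P G m = length (filterᵇ (isProperᵇ G) (allVecs (allFin m) (n G)))

-- Covers (DP-colouring), following the definition literally:
-- H is a graph on vertex set Fin N (adjacency hAdj, simple: symmetric and
-- irreflexive), L : V(G) → 𝒫(V(H)).

record Cover (G : Graph) (N : ℕ) : Set where
  field
    hAdj  : Fin N → Fin N → Bool
    hSym  : ∀ x y → hAdj x y ≡ hAdj y x
    hIrr  : ∀ x → hAdj x x ≡ false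
    L     : Fin (n G) → Subset N
    cov   : ∀ x → ∃ λ u → x ∈ L u
    disj  : ∀ x u v → x ∈ L u → x ∈ L v → u ≡ v
    cliq  : ∀ u x y → x ∈ L u → y ∈ L u → x ≢ y → hAdj x y ≡ true
    resp  : ∀ u v x y → x ∈ L u → y ∈ L v → hAdj x y ≡ true
              → u ≡ v ⊎ adj G u v ≡ true
    -- (4) for uv ∈ E(G), E_H(L(u),L(v)) is a matching
    --     (stated for all ordered pairs, so both sides are covered)
    match : ∀ u v → adj G u v ≡ true → ∀ x y z → x ∈ L u → y ∈ L v → z ∈ L v
              → hAdj x y ≡ true → hAdj x z ≡ true → y ≡ z
open Cover public

IsFold : {G : Graph} {N : ℕ} → ℕ → Cover G N → Set
IsFold {G} m H = ∀ u → ∣ L H u ∣ ≡ m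

independentᵇ : {G : Graph} {N : ℕ} → Cover G N → Subset N → Bool
independentᵇ {N = N} H S =
  all (λ x → all (λ y → not (memᵇ x S ∧ memᵇ y S ∧ hAdj H x y)) (allFin N)) (allFin N)

P-DP-cover : (G : Graph) {N : ℕ} → Cover G N → ℕ
P-DP-cover G {N} H =
  length (filterᵇ (λ S → independentᵇ H S ∧ (∣ S ∣ ≡ᵇ n G)) (allSubsets N))

IsP-DP : Graph → ℕ → ℕ → Set
IsP-DP G m v =
  (∀ (N : ℕ) (H : Cover G N) → IsFold m H → v ≤ P-DP-cover G H)
  × Σ ℕ (λ N → Σ (Cover G N) (λ H → IsFold m H × P-DP-cover G H ≡ v))

-- G = cycleSum r s is C ⊕ D glued along the edge 01; removing that edge
-- leaves the C-path 1, 2, …, r-1, 0 and the D-path from 1 to 0.  For a list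
-- system on G (the lists and conflicts of a cover H, or m colours with
-- equality as conflict) fixing the colours a at 0 and b at 1 gives
--
--   #colourings = Σ_{a, b compatible} W_C(b,a) · W_D(b,a),              (⋆)
--
-- where W_P(b,a) counts the colourings of the path P starting with b and
-- ending compatibly with a (Walks.PC, Factorisation.count).  The
-- H-colourings are exactly such list colourings (CoverColourings).
--
-- In an m-fold cover,
-- m = M + 1, whose edge sets are matchings, a path with t inner vertices has
-- W ≥ oddBound M j when t = 2j + 1, and W ≥ evenBound M j with at most one
-- exception, where W = evenBound M j - 1, when t = 2j.  Inserted into (⋆)
-- this bounds P_DP(G,H) from below in each parity case.
--
-- Twisting the identity
-- cover on the two edges at 0 by permutations σC, σD turns W_P(b,a) into a
-- count ω of proper path colourings (ProperPaths); with σ ∈ {id, rot, rot²}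
-- the lower bound is attained.  For two odd cycles and σ = id the count is
-- P(G,m) itself (Chromatic).

module Submission where

module Sums where

  open import Data.Nat using (ℕ; zero; suc; _+_; _*_; _≤_; z≤n)
  open import Data.Nat.Properties
  open import Data.Nat.Tactic.RingSolver using (solve-∀)
  open import Data.Bool using (Bool; true; false)
  open import Data.Fin using (Fin; combine; _↑ˡ_; _↑ʳ_) renaming (zero to fz; suc to fs)
  open import Data.Vec using (Vec; []; _∷_)
  open import Data.List using (List; []; _∷_; map; concatMap; allFin; length; filterᵇ; _++_; tabulate)
  open import Relation.Binary.PropositionalEquality
  open import Defs using (allVecs)

  ⟦_⟧ : Bool → ℕ
  ⟦ true ⟧ = 1
  ⟦ false ⟧ = 0

  ΣL : ∀ {A : Set} → List A → (A → ℕ) → ℕ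
  ΣL [] f = 0
  ΣL (x ∷ xs) f = f x + ΣL xs f

  ΣF : (K : ℕ) → (Fin K → ℕ) → ℕ
  ΣF zero f = 0
  ΣF (suc K) f = f fz + ΣF K (λ i → f (fs i))

  ΣV : (K n : ℕ) → (Vec (Fin K) n → ℕ) → ℕ
  ΣV K n F = ΣL (allVecs (allFin K) n) F

  len-filter : ∀ {A : Set} (p : A → Bool) (xs : List A) → length (filterᵇ p xs) ≡ ΣL xs (λ x → ⟦ p x ⟧)
  len-filter p [] = refl
  len-filter p (x ∷ xs) with p x
  ... | true = cong suc (len-filter p xs)
  ... | false = len-filter p xs

  ΣL-cong : ∀ {A : Set} (xs : List A) {f g : A → ℕ} → (∀ x → f x ≡ g x) → ΣL xs f ≡ ΣL xs g
  ΣL-cong [] e = refl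
  ΣL-cong (x ∷ xs) e = cong₂ _+_ (e x) (ΣL-cong xs e)

  ΣL-++ : ∀ {A : Set} (xs ys : List A) f → ΣL (xs ++ ys) f ≡ ΣL xs f + ΣL ys f
  ΣL-++ [] ys f = refl
  ΣL-++ (x ∷ xs) ys f = trans (cong (f x +_) (ΣL-++ xs ys f)) (sym (+-assoc (f x) _ _))

  ΣL-map : ∀ {A B : Set} (g : A → B) (xs : List A) f → ΣL (map g xs) f ≡ ΣL xs (λ x → f (g x))
  ΣL-map g [] f = refl
  ΣL-map g (x ∷ xs) f = cong (f (g x) +_) (ΣL-map g xs f)

  ΣL-concatMap : ∀ {A B : Set} (g : A → List B) (xs : List A) f → ΣL (concatMap g xs) f ≡ ΣL xs (λ x → ΣL (g x) f)
  ΣL-concatMap g [] f = refl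
  ΣL-concatMap g (x ∷ xs) f = trans (ΣL-++ (g x) (concatMap g xs) f) (cong (ΣL (g x) f +_) (ΣL-concatMap g xs f))

  ΣL-*ˡ : ∀ {A : Set} (xs : List A) c f → ΣL xs (λ x → c * f x) ≡ c * ΣL xs f
  ΣL-*ˡ [] c f = sym (*-zeroʳ c)
  ΣL-*ˡ (x ∷ xs) c f = trans (cong (c * f x +_) (ΣL-*ˡ xs c f)) (sym (*-distribˡ-+ c (f x) _))

  ΣL-tabulate : ∀ (K : ℕ) {A : Set} (g : Fin K → A) f → ΣL (tabulate g) f ≡ ΣF K (λ i → f (g i))
  ΣL-tabulate zero g f = refl
  ΣL-tabulate (suc K) g f = cong (f (g fz) +_) (ΣL-tabulate K (λ i → g (fs i)) f)

  ΣL-allFin : ∀ K f → ΣL (allFin K) f ≡ ΣF K f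
  ΣL-allFin K f = ΣL-tabulate K (λ i → i) f

  ΣF-cong : ∀ K {f g : Fin K → ℕ} → (∀ x → f x ≡ g x) → ΣF K f ≡ ΣF K g
  ΣF-cong zero e = refl
  ΣF-cong (suc K) e = cong₂ _+_ (e fz) (ΣF-cong K (λ i → e (fs i)))

  ΣF-+ : ∀ K f g → ΣF K (λ x → f x + g x) ≡ ΣF K f + ΣF K g
  ΣF-+ zero f g = refl
  ΣF-+ (suc K) f g rewrite ΣF-+ K (λ i → f (fs i)) (λ i → g (fs i)) =
    interchange (f fz) (g fz) (ΣF K (λ i → f (fs i))) (ΣF K (λ i → g (fs i)))
    where
    interchange : ∀ a b c d → a + b + (c + d) ≡ a + c + (b + d)
    interchange = solve-∀

  ΣF-*ˡ : ∀ K c f → ΣF K (λ x → c * f x) ≡ c * ΣF K f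
  ΣF-*ˡ zero c f = sym (*-zeroʳ c)
  ΣF-*ˡ (suc K) c f = trans (cong (c * f fz +_) (ΣF-*ˡ K c (λ i → f (fs i)))) (sym (*-distribˡ-+ c (f fz) _))

  ΣF-*ʳ : ∀ K c f → ΣF K (λ x → f x * c) ≡ ΣF K f * c
  ΣF-*ʳ K c f = trans (ΣF-cong K (λ x → *-comm (f x) c)) (trans (ΣF-*ˡ K c f) (*-comm c _))

  ΣF-const : ∀ K c → ΣF K (λ _ → c) ≡ K * c
  ΣF-const zero c = refl
  ΣF-const (suc K) c = cong (c +_) (ΣF-const K c)

  ΣF-zero : ∀ K {f : Fin K → ℕ} → (∀ x → f x ≡ 0) → ΣF K f ≡ 0
  ΣF-zero K {f} e = trans (ΣF-cong K e) (trans (ΣF-const K 0) (*-zeroʳ K))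

  ΣF-swap : ∀ K L (f : Fin K → Fin L → ℕ) → ΣF K (λ x → ΣF L (λ y → f x y)) ≡ ΣF L (λ y → ΣF K (λ x → f x y))
  ΣF-swap zero L f = sym (ΣF-zero L (λ _ → refl))
  ΣF-swap (suc K) L f = trans (cong (ΣF L (f fz) +_) (ΣF-swap K L (λ x → f (fs x)))) (sym (ΣF-+ L (f fz) (λ y → ΣF K (λ x → f (fs x) y))))

  ΣF-mono : ∀ K {f g : Fin K → ℕ} → (∀ x → f x ≤ g x) → ΣF K f ≤ ΣF K g
  ΣF-mono zero e = z≤n
  ΣF-mono (suc K) e = +-mono-≤ (e fz) (ΣF-mono K (λ i → e (fs i)))

  ΣF-++ : ∀ a b (f : Fin (a + b) → ℕ) → ΣF (a + b) f ≡ ΣF a (λ i → f (i ↑ˡ b)) + ΣF b (λ j → f (a ↑ʳ j))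
  ΣF-++ zero b f = refl
  ΣF-++ (suc a) b f = trans (cong (f fz +_) (ΣF-++ a b (λ i → f (fs i)))) (sym (+-assoc (f fz) _ _))

  ΣF-comb : ∀ n k (f : Fin (n * k) → ℕ) → ΣF (n * k) f ≡ ΣF n (λ u → ΣF k (λ i → f (combine u i)))
  ΣF-comb zero k f = refl
  ΣF-comb (suc n) k f = trans (ΣF-++ k (n * k) f) (cong (ΣF k (λ i → f (i ↑ˡ (n * k))) +_) (ΣF-comb n k (λ x → f (k ↑ʳ x))))

  ΣV-zero : ∀ K F → ΣV K 0 F ≡ F []
  ΣV-zero K F = +-identityʳ _

  ΣV-suc : ∀ K n F → ΣV K (suc n) F ≡ ΣF K (λ x → ΣV K n (λ v → F (x ∷ v)))
  ΣV-suc K n F = trans (ΣL-concatMap (λ x → map (x ∷_) (allVecs (allFin K) n)) (allFin K) F)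
    (trans (ΣL-cong (allFin K) (λ x → ΣL-map (x ∷_) (allVecs (allFin K) n) F))
           (ΣL-allFin K _))

  ΣV-cong : ∀ K n {F G : Vec (Fin K) n → ℕ} → (∀ v → F v ≡ G v) → ΣV K n F ≡ ΣV K n G
  ΣV-cong K n e = ΣL-cong (allVecs (allFin K) n) e

  ΣV-*ˡ : ∀ K n c F → ΣV K n (λ v → c * F v) ≡ c * ΣV K n F
  ΣV-*ˡ K n = ΣL-*ˡ (allVecs (allFin K) n)

-- Boolean reflection: the definitions in Defs are Boolean-valued, so we move
-- between b ≡ true and propositions, and between ⟦ b ⟧ and counts.
module Booleans where

  open import Data.Nat using (zero; suc; _+_; _*_; _≡ᵇ_; _<ᵇ_; _≤_; _<_; z≤n; s≤s)
  open import Data.Nat.Properties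
  open import Data.Bool using (Bool; true; false; _∧_; _∨_; not; T)
  open import Data.Fin using (Fin; toℕ) renaming (zero to fz; suc to fs)
  open import Data.Fin.Properties using (toℕ-injective) renaming (suc-injective to fs-injective)
  open import Data.List using ([]; _∷_; allFin)
  open import Data.List.Membership.Propositional using (_∈_)
  open import Data.List.Membership.Propositional.Properties using (∈-allFin)
  open import Data.List.Relation.Unary.Any using (here; there)
  open import Data.Bool.ListAction using (all; any)
  open import Data.Product using (Σ; _×_; _,_; proj₁; proj₂)
  open import Data.Sum using (_⊎_; inj₁; inj₂)
  open import Data.Empty using (⊥; ⊥-elim)
  open import Relation.Nullary using (¬_)
  open import Relation.Binary.PropositionalEquality
  open Sums

  false≢true : false ≡ true → ⊥
  false≢true ()

  ∧-true : ∀ {a b} → (a ∧ b) ≡ true → a ≡ true × b ≡ true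
  ∧-true {true} {true} e = refl , refl

  true-∧ : ∀ {a b} → a ≡ true → b ≡ true → (a ∧ b) ≡ true
  true-∧ refl refl = refl

  ∨-true : ∀ {a b} → (a ∨ b) ≡ true → a ≡ true ⊎ b ≡ true
  ∨-true {true} e = inj₁ refl
  ∨-true {false} e = inj₂ e

  true-∨ˡ : ∀ {a} b → a ≡ true → (a ∨ b) ≡ true
  true-∨ˡ b refl = refl

  true-∨ʳ : ∀ a {b} → b ≡ true → (a ∨ b) ≡ true
  true-∨ʳ true e = refl
  true-∨ʳ false e = e

  not-true : ∀ {b} → not b ≡ true → b ≡ false
  not-true {false} _ = refl

  not-false : ∀ {b} → b ≡ false → not b ≡ true
  not-false refl = refl

  bool-ext : ∀ {a b} → (a ≡ true → b ≡ true) → (b ≡ true → a ≡ true) → a ≡ b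
  bool-ext {true} {true} f g = refl
  bool-ext {true} {false} f g with () ← f refl
  bool-ext {false} {true} f g with () ← g refl
  bool-ext {false} {false} f g = refl

  ≡ᵇ-refl : ∀ a → (a ≡ᵇ a) ≡ true
  ≡ᵇ-refl zero = refl
  ≡ᵇ-refl (suc a) = ≡ᵇ-refl a

  ≡ᵇ-comm : ∀ a b → (a ≡ᵇ b) ≡ (b ≡ᵇ a)
  ≡ᵇ-comm zero zero = refl
  ≡ᵇ-comm zero (suc b) = refl
  ≡ᵇ-comm (suc a) zero = refl
  ≡ᵇ-comm (suc a) (suc b) = ≡ᵇ-comm a b

  ≡ᵇ-sound : ∀ a b → (a ≡ᵇ b) ≡ true → a ≡ b
  ≡ᵇ-sound a b e = ≡ᵇ⇒≡ a b (subst T (sym e) _)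

  ≡ᵇ-false : ∀ a b → ¬ (a ≡ b) → (a ≡ᵇ b) ≡ false
  ≡ᵇ-false a b ne with a ≡ᵇ b in e
  ... | true = ⊥-elim (ne (≡ᵇ-sound a b e))
  ... | false = refl

  <ᵇ-true : ∀ u v → (u <ᵇ v) ≡ true → u < v
  <ᵇ-true u v e = <ᵇ⇒< u v (subst T (sym e) _)

  <ᵇ-false : ∀ u v → (u <ᵇ v) ≡ false → v ≤ u
  <ᵇ-false u v e = ≮⇒≥ (λ lt → subst T e (<⇒<ᵇ lt))

  eqF : ∀ {K} → Fin K → Fin K → Bool
  eqF x y = toℕ x ≡ᵇ toℕ y

  eqF-refl : ∀ {K} (x : Fin K) → eqF x x ≡ true
  eqF-refl x = ≡ᵇ-refl (toℕ x)

  eqF-sound : ∀ {K} (x y : Fin K) → eqF x y ≡ true → x ≡ y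
  eqF-sound x y e = toℕ-injective (≡ᵇ-sound (toℕ x) (toℕ y) e)

  eqF-comm : ∀ {K} (x y : Fin K) → eqF x y ≡ eqF y x
  eqF-comm x y = ≡ᵇ-comm (toℕ x) (toℕ y)

  eqF-false : ∀ {K} (x y : Fin K) → ¬ (x ≡ y) → eqF x y ≡ false
  eqF-false x y ne = ≡ᵇ-false (toℕ x) (toℕ y) (λ e → ne (toℕ-injective e))

  all-sound : ∀ {A : Set} (p : A → Bool) xs → all p xs ≡ true → ∀ x → x ∈ xs → p x ≡ true
  all-sound p (y ∷ xs) e x (here refl) = proj₁ (∧-true e)
  all-sound p (y ∷ xs) e x (there m) = all-sound p xs (proj₂ (∧-true {p y} e)) x m

  all-complete : ∀ {A : Set} (p : A → Bool) xs → (∀ x → x ∈ xs → p x ≡ true) → all p xs ≡ true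
  all-complete p [] h = refl
  all-complete p (y ∷ xs) h = true-∧ (h y (here refl)) (all-complete p xs (λ x m → h x (there m)))

  allFin-sound : ∀ {n} (p : Fin n → Bool) → all p (allFin n) ≡ true → ∀ u → p u ≡ true
  allFin-sound {n} p e u = all-sound p (allFin n) e u (∈-allFin u)

  allFin-complete : ∀ {n} (p : Fin n → Bool) → (∀ u → p u ≡ true) → all p (allFin n) ≡ true
  allFin-complete {n} p h = all-complete p (allFin n) (λ x _ → h x)

  any-sound : ∀ {A : Set} (p : A → Bool) xs → any p xs ≡ true → Σ A λ x → x ∈ xs × p x ≡ true
  any-sound p (x ∷ xs) e with p x in ep
  ... | true = x , here refl , ep
  ... | false with any-sound p xs e
  ... | y , m , py = y , there m , py

  any-complete : ∀ {A : Set} (p : A → Bool) xs x → x ∈ xs → p x ≡ true → any p xs ≡ true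
  any-complete p (y ∷ xs) x (here refl) px rewrite px = refl
  any-complete p (y ∷ xs) x (there m) px with p y
  ... | true = refl
  ... | false = any-complete p xs x m px

  ⟦∧⟧ : ∀ a b → ⟦ a ∧ b ⟧ ≡ ⟦ a ⟧ * ⟦ b ⟧
  ⟦∧⟧ true b = sym (+-identityʳ ⟦ b ⟧)
  ⟦∧⟧ false b = refl

  ⟦not⟧ : ∀ a → ⟦ not a ⟧ + ⟦ a ⟧ ≡ 1
  ⟦not⟧ true = refl
  ⟦not⟧ false = refl

  ⟦not⟧<1 : ∀ b → ⟦ not b ⟧ < 1 → b ≡ true
  ⟦not⟧<1 true _ = refl
  ⟦not⟧<1 false (s≤s ())

  ⟦split⟧ : ∀ a b → ⟦ a ∧ not b ⟧ + ⟦ a ∧ b ⟧ ≡ ⟦ a ⟧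
  ⟦split⟧ true true = refl
  ⟦split⟧ true false = refl
  ⟦split⟧ false b = refl

  ΣF-delta : ∀ K (z : Fin K) f → ΣF K (λ x → ⟦ eqF x z ⟧ * f x) ≡ f z
  ΣF-delta (suc K) fz f = trans (cong₂ _+_ (+-identityʳ (f fz)) (ΣF-zero K (λ i → refl))) (+-identityʳ (f fz))
  ΣF-delta (suc K) (fs z) f = ΣF-delta K z (λ i → f (fs i))

  ΣF-split : ∀ K (z : Fin K) f → ΣF K f ≡ f z + ΣF K (λ x → ⟦ not (eqF x z) ⟧ * f x)
  ΣF-split K z f = trans (ΣF-cong K pw) (trans (ΣF-+ K _ _) (cong (_+ ΣF K (λ x → ⟦ not (eqF x z) ⟧ * f x)) (ΣF-delta K z f)))
    where
    pw : ∀ x → f x ≡ ⟦ eqF x z ⟧ * f x + ⟦ not (eqF x z) ⟧ * f x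
    pw x with eqF x z
    ... | true = trans (sym (+-identityʳ (f x))) (cong (_+ 0) (sym (+-identityʳ (f x))))
    ... | false = sym (+-identityʳ (f x))

  atmost1 : ∀ K (P : Fin K → Bool) → (∀ x y → P x ≡ true → P y ≡ true → x ≡ y) → ΣF K (λ x → ⟦ P x ⟧) ≤ 1
  atmost1 zero P u = z≤n
  atmost1 (suc K) P u with P fz in e
  ... | true = ≤-reflexive (cong suc (ΣF-zero K pz))
    where
    pz : ∀ i → ⟦ P (fs i) ⟧ ≡ 0
    pz i with P (fs i) in e2
    ... | true with () ← u (fs i) fz e2 e
    pz i | false = refl
  ... | false = atmost1 K (λ i → P (fs i)) (λ x y px py → fs-injective (u (fs x) (fs y) px py))

-- The cover is given by the lists
-- ℓ v (colours available at the vertex labelled v) and a conflict relation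
-- κ u v x y (colour x at u clashes with colour y at v).  A path is the
-- sequence of labels seq 0, seq 1, …, seq t, closed up by the vertex 0 on
-- which the colour a is fixed; PC seq t x a counts its colourings that use x
-- at seq 0 (the t inner vertices seq 1 … seq t are free).
module Walks where

  open import Data.Nat using (ℕ; zero; suc; _+_; _*_; _∸_; _<ᵇ_; _≤_; _<_; z≤n; s≤s)
  open import Data.Nat.Properties
  open import Data.Nat.Tactic.RingSolver using (solve-∀)
  open import Data.Bool using (Bool; true; false; _∧_; not)
  open import Data.Fin using (Fin) renaming (_≟_ to _≟ᶠ_)
  open import Data.Vec using (Vec; []; _∷_)
  open import Data.Product using (_×_; _,_; proj₁; proj₂)
  open import Data.Empty using (⊥-elim)
  open import Relation.Nullary using (¬_; yes; no)
  open import Relation.Binary.PropositionalEquality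
  open Sums
  open Booleans

  -- double j = 2 * j, by a recursion that peels off two path vertices at a time.
  double : ℕ → ℕ
  double zero = zero
  double (suc j) = suc (suc (double j))

  -- Minimal colouring counts of paths with 2j resp. 2j+1 inner vertices, for
  -- m = M + 1 colours.
  evenBound : ℕ → ℕ → ℕ
  evenBound M zero = 1
  evenBound M (suc j) = M * (M * evenBound M j ∸ 1) + 1

  oddBound : ℕ → ℕ → ℕ
  oddBound M j = M * evenBound M j ∸ 1

  evenBound≥1 : ∀ M j → 1 ≤ evenBound M j
  evenBound≥1 M zero = s≤s z≤n
  evenBound≥1 M (suc j) = m≤n+m 1 _

  oddBound+1 : ∀ M → 1 ≤ M → ∀ j → M * evenBound M j ≡ oddBound M j + 1
  oddBound+1 M hM j = sym (m∸n+n≡m (*-mono-≤ hM (evenBound≥1 M j)))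

  module InCover (K : ℕ) (ℓ : ℕ → Fin K → Bool) (κ : ℕ → ℕ → Fin K → Fin K → Bool) where

    chainOK : (seq : ℕ → ℕ) → Fin K → ∀ {t} → Vec (Fin K) t → Fin K → Bool
    chainOK seq x [] a = not (κ (seq 0) 0 x a)
    chainOK seq x (y ∷ v) a = (ℓ (seq 1) y ∧ not (κ (seq 0) (seq 1) x y)) ∧ chainOK (λ i → seq (suc i)) y v a

    PC : (seq : ℕ → ℕ) (t : ℕ) → Fin K → Fin K → ℕ
    PC seq t x a = ΣV K t (λ v → ⟦ chainOK seq x v a ⟧)

    PC-zero : ∀ seq x a → PC seq 0 x a ≡ ⟦ not (κ (seq 0) 0 x a) ⟧
    PC-zero seq x a = ΣV-zero K (λ v → ⟦ chainOK seq x v a ⟧)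

    PC-suc : ∀ seq t x a → PC seq (suc t) x a ≡
             ΣF K (λ y → ⟦ ℓ (seq 1) y ∧ not (κ (seq 0) (seq 1) x y) ⟧ * PC (λ i → seq (suc i)) t y a)
    PC-suc seq t x a = trans (ΣV-suc K t _) (ΣF-cong K λ y →
       trans (ΣV-cong K t (λ v → ⟦∧⟧ (ℓ (seq 1) y ∧ not (κ (seq 0) (seq 1) x y)) _))
             (ΣV-*ˡ K t ⟦ ℓ (seq 1) y ∧ not (κ (seq 0) (seq 1) x y) ⟧ (λ v → ⟦ chainOK (λ i → seq (suc i)) y v a ⟧)))

    module Inv (M : ℕ) (hM : 1 ≤ M) (a : Fin K) where

      oo ee : ℕ → ℕ
      oo = evenBound M
      ee = oddBound M

      Size : ℕ → Set
      Size i = ΣF K (λ x → ⟦ ℓ i x ⟧) ≡ suc M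

      Fwd : ℕ → ℕ → Set
      Fwd i j = ∀ x y z → ℓ i x ≡ true → ℓ j y ≡ true → ℓ j z ≡ true → κ i j x y ≡ true → κ i j x z ≡ true → y ≡ z

      Bwd : ℕ → ℕ → Set
      Bwd i j = ∀ y x z → ℓ j y ≡ true → ℓ i x ≡ true → ℓ i z ≡ true → κ i j x y ≡ true → κ i j z y ≡ true → x ≡ z

      record Hyp (seq : ℕ → ℕ) (t : ℕ) : Set where
        field
          sz : ∀ i → i ≤ t → Size (seq i)
          fw : ∀ i → i < t → Fwd (seq i) (seq (suc i))
          bw : ∀ i → i < t → Bwd (seq i) (seq (suc i))
          en : ∀ x z → ℓ (seq t) x ≡ true → ℓ (seq t) z ≡ true → κ (seq t) 0 x a ≡ true → κ (seq t) 0 z a ≡ true → x ≡ z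

      shift : ∀ {seq t} → Hyp seq (suc t) → Hyp (λ i → seq (suc i)) t
      shift h = record { sz = λ i le → Hyp.sz h (suc i) (s≤s le) ; fw = λ i le → Hyp.fw h (suc i) (s≤s le)
                       ; bw = λ i le → Hyp.bw h (suc i) (s≤s le) ; en = Hyp.en h }

      -- In a list of M+1 colours at most one clashes with a given colour, so
      -- at least M avoid it.
      unmatched+1 : (P Q : Fin K → Bool) → ΣF K (λ x → ⟦ P x ⟧) ≡ suc M →
                    (∀ x y → (P x ∧ Q x) ≡ true → (P y ∧ Q y) ≡ true → x ≡ y) →
                    suc M ≤ ΣF K (λ x → ⟦ P x ∧ not (Q x) ⟧) + 1
      unmatched+1 P Q sz u = begin
        suc M ≡⟨ sym sz ⟩
        ΣF K (λ x → ⟦ P x ⟧) ≡⟨ ΣF-cong K (λ x → sym (⟦split⟧ (P x) (Q x))) ⟩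
        ΣF K (λ x → ⟦ P x ∧ not (Q x) ⟧ + ⟦ P x ∧ Q x ⟧) ≡⟨ ΣF-+ K _ _ ⟩
        ΣF K (λ x → ⟦ P x ∧ not (Q x) ⟧) + ΣF K (λ x → ⟦ P x ∧ Q x ⟧)
          ≤⟨ +-monoʳ-≤ (ΣF K (λ x → ⟦ P x ∧ not (Q x) ⟧)) (atmost1 K (λ x → P x ∧ Q x) u) ⟩
        ΣF K (λ x → ⟦ P x ∧ not (Q x) ⟧) + 1 ∎
        where open ≤-Reasoning

      unmatched : (P Q : Fin K → Bool) → ΣF K (λ x → ⟦ P x ⟧) ≡ suc M →
                  (∀ x y → (P x ∧ Q x) ≡ true → (P y ∧ Q y) ≡ true → x ≡ y) →
                  M ≤ ΣF K (λ x → ⟦ P x ∧ not (Q x) ⟧)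
      unmatched P Q sz u = m<1+n⇒m≤n (≤-trans (unmatched+1 P Q sz u) (≤-reflexive (+-comm _ 1)))

      weighted≥ : (g : Fin K → Bool) (w : Fin K → ℕ) (c : ℕ) → (∀ y → g y ≡ true → c ≤ w y) →
                  c * ΣF K (λ y → ⟦ g y ⟧) ≤ ΣF K (λ y → ⟦ g y ⟧ * w y)
      weighted≥ g w c h = ≤-trans (≤-reflexive (sym (ΣF-*ˡ K c _))) (ΣF-mono K pw)
        where
        pw : ∀ y → c * ⟦ g y ⟧ ≤ ⟦ g y ⟧ * w y
        pw y with g y in e
        ... | false = ≤-reflexive (*-zeroʳ c)
        ... | true = ≤-trans (≤-reflexive (*-identityʳ c)) (≤-trans (h y e) (≤-reflexive (sym (+-identityʳ (w y)))))

      EvenInv : (seq : ℕ → ℕ) (t j : ℕ) → Set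
      EvenInv seq t j = (∀ x → ℓ (seq 0) x ≡ true → oo j ≤ PC seq t x a + 1)
                      × (∀ x x' → ℓ (seq 0) x ≡ true → ℓ (seq 0) x' ≡ true → PC seq t x a < oo j → PC seq t x' a < oo j → x ≡ x')
                      × (suc M * oo j ≤ ΣF K (λ x → ⟦ ℓ (seq 0) x ⟧ * PC seq t x a) + 1)

      OddInv : (seq : ℕ → ℕ) (t j : ℕ) → Set
      OddInv seq t j = (∀ x → ℓ (seq 0) x ≡ true → ee j ≤ PC seq t x a)
                     × (suc M * ee j + 1 ≤ ΣF K (λ x → ⟦ ℓ (seq 0) x ⟧ * PC seq t x a))

      even-base : ∀ seq → Hyp seq 0 → EvenInv seq 0 0
      even-base seq h = (λ x _ → m≤n+m 1 _) , unique , total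
        where
        unique : ∀ x x' → ℓ (seq 0) x ≡ true → ℓ (seq 0) x' ≡ true → PC seq 0 x a < 1 → PC seq 0 x' a < 1 → x ≡ x'
        unique x x' hx hx' l1 l2 = Hyp.en h x x' hx hx'
              (⟦not⟧<1 _ (subst (_< 1) (PC-zero seq x a) l1)) (⟦not⟧<1 _ (subst (_< 1) (PC-zero seq x' a) l2))
        total : suc M * 1 ≤ ΣF K (λ x → ⟦ ℓ (seq 0) x ⟧ * PC seq 0 x a) + 1
        total = begin
          suc M * 1 ≡⟨ *-identityʳ (suc M) ⟩
          suc M ≤⟨ unmatched+1 (ℓ (seq 0)) (λ x → κ (seq 0) 0 x a) (Hyp.sz h 0 z≤n)
                     (λ x y px py → Hyp.en h x y (proj₁ (∧-true px)) (proj₁ (∧-true py)) (proj₂ (∧-true px)) (proj₂ (∧-true py))) ⟩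
          ΣF K (λ x → ⟦ ℓ (seq 0) x ∧ not (κ (seq 0) 0 x a) ⟧) + 1
            ≡⟨ cong (_+ 1) (ΣF-cong K (λ x → trans (⟦∧⟧ (ℓ (seq 0) x) _) (cong (⟦ ℓ (seq 0) x ⟧ *_) (sym (PC-zero seq x a))))) ⟩
          ΣF K (λ x → ⟦ ℓ (seq 0) x ⟧ * PC seq 0 x a) + 1 ∎
          where open ≤-Reasoning

      ⟦⟧-rearrange : ∀ a b c (w : ℕ) → ⟦ a ⟧ * (⟦ b ∧ not c ⟧ * w) ≡ ⟦ a ∧ not c ⟧ * (⟦ b ⟧ * w)
      ⟦⟧-rearrange false b c w = refl
      ⟦⟧-rearrange true true true w = refl
      ⟦⟧-rearrange true true false w = refl
      ⟦⟧-rearrange true false true w = refl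
      ⟦⟧-rearrange true false false w = refl

      module Step (seq : ℕ → ℕ) (t : ℕ) (h : Hyp seq (suc t)) where

        ℓ0 ℓ1 : Fin K → Bool
        ℓ0 = ℓ (seq 0)
        ℓ1 = ℓ (seq 1)

        conflict free : Fin K → Fin K → Bool
        conflict x y = κ (seq 0) (seq 1) x y
        free x y = ℓ1 y ∧ not (conflict x y)

        w : Fin K → ℕ
        w y = PC (λ i → seq (suc i)) t y a

        Free Blocked : Fin K → ℕ
        Free x = ΣF K (λ y → ⟦ free x y ⟧ * w y)
        Blocked x = ΣF K (λ y → ⟦ ℓ1 y ∧ conflict x y ⟧ * w y)

        U Total : ℕ
        U = ΣF K (λ y → ⟦ ℓ1 y ⟧ * w y)
        Total = ΣF K (λ x → ⟦ ℓ0 x ⟧ * PC seq (suc t) x a)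

        U-split : ∀ x → U ≡ Free x + Blocked x
        U-split x = trans (ΣF-cong K (λ y → trans (cong (_* w y) (sym (⟦split⟧ (ℓ1 y) (conflict x y))))
                                                  (*-distribʳ-+ (w y) ⟦ free x y ⟧ _)))
                          (ΣF-+ K _ _)

        blocked≤1 : ∀ x → ℓ0 x ≡ true → ΣF K (λ y → ⟦ ℓ1 y ∧ conflict x y ⟧) ≤ 1
        blocked≤1 x hx = atmost1 K (λ y → ℓ1 y ∧ conflict x y) (λ y y' py py' →
          Hyp.fw h 0 (s≤s z≤n) x y y' hx (proj₁ (∧-true py)) (proj₁ (∧-true py')) (proj₂ (∧-true py)) (proj₂ (∧-true py')))

        free≥M : ∀ x → ℓ0 x ≡ true → M ≤ ΣF K (λ y → ⟦ free x y ⟧)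
        free≥M x hx = unmatched ℓ1 (conflict x) (Hyp.sz h 1 (s≤s z≤n))
          (λ y z py pz → Hyp.fw h 0 (s≤s z≤n) x y z hx (proj₁ (∧-true py)) (proj₁ (∧-true pz)) (proj₂ (∧-true py)) (proj₂ (∧-true pz)))

        -- Every colour at seq 1 is free for at least M colours at seq 0, so
        -- the total count grows by a factor M.
        total-step : M * U ≤ Total
        total-step = begin
          M * ΣF K (λ y → ⟦ ℓ1 y ⟧ * w y) ≡⟨ sym (ΣF-*ˡ K M _) ⟩
          ΣF K (λ y → M * (⟦ ℓ1 y ⟧ * w y)) ≤⟨ ΣF-mono K pw ⟩
          ΣF K (λ y → ΣF K (λ x → ⟦ ℓ0 x ∧ not (conflict x y) ⟧) * (⟦ ℓ1 y ⟧ * w y))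
             ≡⟨ ΣF-cong K (λ y → sym (ΣF-*ʳ K _ _)) ⟩
          ΣF K (λ y → ΣF K (λ x → ⟦ ℓ0 x ∧ not (conflict x y) ⟧ * (⟦ ℓ1 y ⟧ * w y)))
             ≡⟨ sym (ΣF-swap K K _) ⟩
          ΣF K (λ x → ΣF K (λ y → ⟦ ℓ0 x ∧ not (conflict x y) ⟧ * (⟦ ℓ1 y ⟧ * w y)))
             ≡⟨ ΣF-cong K (λ x → ΣF-cong K (λ y → sym (⟦⟧-rearrange (ℓ0 x) (ℓ1 y) (conflict x y) (w y)))) ⟩
          ΣF K (λ x → ΣF K (λ y → ⟦ ℓ0 x ⟧ * (⟦ free x y ⟧ * w y)))
             ≡⟨ ΣF-cong K (λ x → trans (ΣF-*ˡ K ⟦ ℓ0 x ⟧ (λ y → ⟦ free x y ⟧ * w y)) (cong (⟦ ℓ0 x ⟧ *_) (sym (PC-suc seq t x a)))) ⟩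
          Total ∎
          where
          open ≤-Reasoning
          pw : ∀ y → M * (⟦ ℓ1 y ⟧ * w y) ≤ ΣF K (λ x → ⟦ ℓ0 x ∧ not (conflict x y) ⟧) * (⟦ ℓ1 y ⟧ * w y)
          pw y with ℓ1 y in e
          ... | false = ≤-reflexive (trans (*-zeroʳ M) (sym (*-zeroʳ (ΣF K (λ x → ⟦ ℓ0 x ∧ not (conflict x y) ⟧)))))
          ... | true = *-monoˡ-≤ _ (unmatched ℓ0 (λ x → conflict x y) (Hyp.sz h 0 z≤n)
                          (λ x z px pz → Hyp.bw h 0 (s≤s z≤n) y x z e (proj₁ (∧-true px)) (proj₁ (∧-true pz)) (proj₂ (∧-true px)) (proj₂ (∧-true pz))))

        free-large : ∀ c → (∀ y → ℓ1 y ≡ true → c ≤ w y) → ∀ x → ℓ0 x ≡ true → M * c ≤ Free x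
        free-large c large x hx = begin
          M * c ≤⟨ *-monoˡ-≤ c (free≥M x hx) ⟩
          ΣF K (λ y → ⟦ free x y ⟧) * c ≡⟨ *-comm _ c ⟩
          c * ΣF K (λ y → ⟦ free x y ⟧) ≤⟨ weighted≥ (free x) w c (λ y fy → large y (proj₁ (∧-true fy))) ⟩
          Free x ∎
          where open ≤-Reasoning

        free-almost-large : ∀ c → (∀ y → ℓ1 y ≡ true → c ≤ w y + 1) →
          (∀ y y' → ℓ1 y ≡ true → ℓ1 y' ≡ true → w y < c → w y' < c → y ≡ y') →
          ∀ x → ℓ0 x ≡ true → M * c ≤ Free x + 1
        free-almost-large c almost unique x hx = begin
          M * c ≤⟨ *-monoˡ-≤ c (free≥M x hx) ⟩
          ΣF K (λ y → ⟦ free x y ⟧) * c ≡⟨ *-comm _ c ⟩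
          c * ΣF K (λ y → ⟦ free x y ⟧) ≡⟨ sym (ΣF-*ˡ K c _) ⟩
          ΣF K (λ y → c * ⟦ free x y ⟧) ≤⟨ ΣF-mono K pw ⟩
          ΣF K (λ y → ⟦ free x y ⟧ * w y + ⟦ small y ⟧) ≡⟨ ΣF-+ K _ _ ⟩
          Free x + ΣF K (λ y → ⟦ small y ⟧) ≤⟨ +-monoʳ-≤ (Free x) small≤1 ⟩
          Free x + 1 ∎
          where
          open ≤-Reasoning
          small : Fin K → Bool
          small y = ℓ1 y ∧ (w y <ᵇ c)
          small≤1 : ΣF K (λ y → ⟦ small y ⟧) ≤ 1
          small≤1 = atmost1 K small (λ y z sy sz → unique y z (proj₁ (∧-true sy)) (proj₁ (∧-true sz))
                                       (<ᵇ-true _ _ (proj₂ (∧-true sy))) (<ᵇ-true _ _ (proj₂ (∧-true sz))))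
          pw : ∀ y → c * ⟦ free x y ⟧ ≤ ⟦ free x y ⟧ * w y + ⟦ small y ⟧
          pw y with free x y in ef
          ... | false = ≤-trans (≤-reflexive (*-zeroʳ c)) z≤n
          ... | true with ℓ1 y in el | w y <ᵇ c in ew
          ...   | true | true = ≤-trans (≤-reflexive (*-identityʳ c)) (≤-trans (almost y el) (≤-reflexive (cong (_+ 1) (sym (+-identityʳ (w y))))))
          ...   | true | false = ≤-trans (≤-reflexive (*-identityʳ c)) (≤-trans (<ᵇ-false (w y) c ew) (≤-trans (≤-reflexive (sym (+-identityʳ (w y)))) (m≤m+n _ 0)))
          ...   | false | _ = ⊥-elim (false≢true ef)

        -- For distinct x, x', a colour blocked by x' is free for x (matching).
        blocked-free : ∀ x x' → ℓ0 x ≡ true → ℓ0 x' ≡ true → ¬ x ≡ x' →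
                       ∀ y → ⟦ free x y ∧ conflict x' y ⟧ ≡ ⟦ ℓ1 y ∧ conflict x' y ⟧
        blocked-free x x' hx hx' ne y with ℓ1 y in e1 | conflict x' y in e2 | conflict x y in e3
        ... | true | true | true = ⊥-elim (ne (Hyp.bw h 0 (s≤s z≤n) y x x' e1 hx hx' e3 e2))
        ... | true | true | false = refl
        ... | true | false | true = refl
        ... | true | false | false = refl
        ... | false | _ | _ = refl

        free-for-both : ∀ x x' → ℓ0 x ≡ true → ℓ0 x' ≡ true → ¬ x ≡ x' →
                        suc M ≤ ΣF K (λ y → ⟦ free x y ∧ not (conflict x' y) ⟧) + 2
        free-for-both x x' hx hx' ne = begin
          suc M ≡⟨ sym (Hyp.sz h 1 (s≤s z≤n)) ⟩
          ΣF K (λ y → ⟦ ℓ1 y ⟧) ≡⟨ ΣF-cong K (λ y → trans (sym (⟦split⟧ (ℓ1 y) (conflict x y))) (cong (_+ ⟦ ℓ1 y ∧ conflict x y ⟧) (sym (⟦split⟧ (free x y) (conflict x' y))))) ⟩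
          ΣF K (λ y → ⟦ both y ⟧ + ⟦ free x y ∧ conflict x' y ⟧ + ⟦ ℓ1 y ∧ conflict x y ⟧) ≡⟨ ΣF-+ K _ _ ⟩
          ΣF K (λ y → ⟦ both y ⟧ + ⟦ free x y ∧ conflict x' y ⟧) + ΣF K (λ y → ⟦ ℓ1 y ∧ conflict x y ⟧) ≡⟨ cong (_+ ΣF K (λ y → ⟦ ℓ1 y ∧ conflict x y ⟧)) (ΣF-+ K _ _) ⟩
          c + ΣF K (λ y → ⟦ free x y ∧ conflict x' y ⟧) + ΣF K (λ y → ⟦ ℓ1 y ∧ conflict x y ⟧)
            ≤⟨ +-mono-≤ (+-monoʳ-≤ c (≤-trans (≤-reflexive (ΣF-cong K (blocked-free x x' hx hx' ne))) (blocked≤1 x' hx'))) (blocked≤1 x hx) ⟩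
          c + 1 + 1 ≡⟨ +-assoc c 1 1 ⟩
          c + 2 ∎
          where
          open ≤-Reasoning
          both : Fin K → Bool
          both y = free x y ∧ not (conflict x' y)
          c : ℕ
          c = ΣF K (λ y → ⟦ both y ⟧)

        small-unique : ∀ e → (∀ y → ℓ1 y ≡ true → e ≤ w y) → suc M * e + 1 ≤ U →
                       ∀ x x' → ℓ0 x ≡ true → ℓ0 x' ≡ true → Free x ≤ M * e → Free x' ≤ M * e → x ≡ x'
        small-unique e large big x x' hx hx' small small' with x ≟ᶠ x'
        ... | yes eq = eq
        ... | no ne = ⊥-elim (<⇒≱ (s≤s small) (≤-trans (≤-reflexive (+-comm 1 (M * e))) Free≥))
          where
          open ≤-Reasoning
          both : Fin K → Bool
          both y = free x y ∧ not (conflict x' y)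
          c : ℕ
          c = ΣF K (λ y → ⟦ both y ⟧)
          blocked'≥ : e + 1 ≤ Blocked x'
          blocked'≥ = +-cancelˡ-≤ (M * e) _ _ (begin
            M * e + (e + 1) ≡⟨ rearrange M e ⟩
            suc M * e + 1 ≤⟨ big ⟩
            U ≡⟨ U-split x' ⟩
            Free x' + Blocked x' ≤⟨ +-monoˡ-≤ (Blocked x') small' ⟩
            M * e + Blocked x' ∎)
            where
            rearrange : ∀ M e → M * e + (e + 1) ≡ suc M * e + 1
            rearrange = solve-∀
          Free≥ : M * e + 1 ≤ Free x
          Free≥ = begin
            M * e + 1 ≤⟨ +-monoˡ-≤ 1 (*-monoˡ-≤ e (≤-pred (≤-trans (free-for-both x x' hx hx' ne) (≤-reflexive (+-comm c 2))))) ⟩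
            suc c * e + 1 ≡⟨ rearrange c e ⟩
            e * c + (e + 1) ≤⟨ +-mono-≤ (weighted≥ both w e (λ y py → large y (proj₁ (∧-true (proj₁ (∧-true py)))))) blocked'≥ ⟩
            ΣF K (λ y → ⟦ both y ⟧ * w y) + Blocked x'
              ≡⟨ cong (ΣF K (λ y → ⟦ both y ⟧ * w y) +_) (sym (ΣF-cong K (λ y → cong (_* w y) (blocked-free x x' hx hx' ne y)))) ⟩
            ΣF K (λ y → ⟦ both y ⟧ * w y) + ΣF K (λ y → ⟦ free x y ∧ conflict x' y ⟧ * w y) ≡⟨ sym (ΣF-+ K _ _) ⟩
            ΣF K (λ y → ⟦ both y ⟧ * w y + ⟦ free x y ∧ conflict x' y ⟧ * w y)
              ≡⟨ ΣF-cong K (λ y → trans (sym (*-distribʳ-+ (w y) ⟦ both y ⟧ _)) (cong (_* w y) (⟦split⟧ (free x y) (conflict x' y)))) ⟩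
            Free x ∎
            where
            rearrange : ∀ c e → suc c * e + 1 ≡ e * c + (e + 1)
            rearrange = solve-∀

      odd-step : ∀ seq t j → Hyp seq (suc t) → EvenInv (λ i → seq (suc i)) t j → OddInv seq (suc t) j
      odd-step seq t j h (almost , unique , total) = pointwise , ≤-trans total' total-step
        where
        open Step seq t h
        pointwise : ∀ x → ℓ0 x ≡ true → ee j ≤ PC seq (suc t) x a
        pointwise x hx = subst (ee j ≤_) (sym (PC-suc seq t x a))
          (≤-trans (∸-monoˡ-≤ 1 (free-almost-large (oo j) almost unique x hx)) (≤-reflexive (m+n∸n≡m (Free x) 1)))
        -- (M+1)(e+1) = M (M+1) o ≤ M (U + 1), with e + 1 = M o.
        total' : suc M * ee j + 1 ≤ M * U
        total' = +-cancelʳ-≤ M _ _ (begin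
          suc M * ee j + 1 + M ≡⟨ rearrange M (ee j) ⟩
          suc M * (ee j + 1) ≡⟨ cong (suc M *_) (sym (oddBound+1 M hM j)) ⟩
          suc M * (M * oo j) ≡⟨ rearrange′ M (oo j) ⟩
          M * (suc M * oo j) ≤⟨ *-monoʳ-≤ M total ⟩
          M * (U + 1) ≡⟨ *-distribˡ-+ M U 1 ⟩
          M * U + M * 1 ≡⟨ cong (M * U +_) (*-identityʳ M) ⟩
          M * U + M ∎)
          where
          open ≤-Reasoning
          rearrange : ∀ M e → suc M * e + 1 + M ≡ suc M * (e + 1)
          rearrange = solve-∀
          rearrange′ : ∀ M o → suc M * (M * o) ≡ M * (suc M * o)
          rearrange′ = solve-∀

      even-step : ∀ seq t j → Hyp seq (suc t) → OddInv (λ i → seq (suc i)) t j → EvenInv seq (suc t) (suc j)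
      even-step seq t j h (large , big) = pointwise , unique , total
        where
        open Step seq t h
        pointwise : ∀ x → ℓ0 x ≡ true → M * ee j + 1 ≤ PC seq (suc t) x a + 1
        pointwise x hx = +-monoˡ-≤ 1 (subst (M * ee j ≤_) (sym (PC-suc seq t x a)) (free-large (ee j) large x hx))
        unique : ∀ x x' → ℓ0 x ≡ true → ℓ0 x' ≡ true → PC seq (suc t) x a < M * ee j + 1 → PC seq (suc t) x' a < M * ee j + 1 → x ≡ x'
        unique x x' hx hx' lx lx' = small-unique (ee j) large big x x' hx hx' (below x lx) (below x' lx')
          where
          below : ∀ z → PC seq (suc t) z a < M * ee j + 1 → Free z ≤ M * ee j
          below z lt = m<1+n⇒m≤n (subst (Free z <_) (+-comm (M * ee j) 1) (subst (_< M * ee j + 1) (PC-suc seq t z a) lt))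
        -- (M+1)(M e + 1) = M ((M+1) e + 1) + 1 ≤ M U + 1 ≤ Total + 1.
        total : suc M * (M * ee j + 1) ≤ Total + 1
        total = begin
          suc M * (M * ee j + 1) ≡⟨ rearrange M (ee j) ⟩
          M * (suc M * ee j + 1) + 1 ≤⟨ +-monoˡ-≤ 1 (*-monoʳ-≤ M big) ⟩
          M * U + 1 ≤⟨ +-monoˡ-≤ 1 total-step ⟩
          Total + 1 ∎
          where
          open ≤-Reasoning
          rearrange : ∀ M e → suc M * (M * e + 1) ≡ M * (suc M * e + 1) + 1
          rearrange = solve-∀

      even-inv : ∀ j seq → Hyp seq (double j) → EvenInv seq (double j) j
      odd-inv : ∀ j seq → Hyp seq (suc (double j)) → OddInv seq (suc (double j)) j
      even-inv zero seq h = even-base seq h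
      even-inv (suc j) seq h = even-step seq (suc (double j)) j h (odd-inv j (λ i → seq (suc i)) (shift h))
      odd-inv j seq h = odd-step seq (double j) j h (even-inv j (λ i → seq (suc i)) (shift h))

-- The graph G = C ⊕ D of Defs.cycleSum: its adjacency relation is described
-- by an explicit inductive list of edges Ed.
module CycleSum where

  open import Data.Nat using (ℕ; zero; suc; _+_; _≡ᵇ_; _≤_; _<_; z≤n; s≤s)
  open import Data.Nat.Properties
  open import Data.Bool using (Bool; true; false; _∧_; _∨_)
  open import Data.List using (List; []; _∷_; map; zip; _++_; applyUpTo)
  open import Data.List.Membership.Propositional using (_∈_)
  open import Data.List.Relation.Unary.Any using (here; there)
  open import Data.Product using (Σ; _×_; _,_; proj₁; proj₂)
  open import Data.Sum using (_⊎_; inj₁; inj₂)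
  open import Data.Empty using (⊥-elim)
  open import Relation.Nullary using (¬_)
  open import Relation.Binary.PropositionalEquality
  open import Defs using (cycleEdges; cycleAdjℕ; cycleC; cycleD)
  open Booleans

  Hit : ℕ → ℕ → ℕ × ℕ → Set
  Hit a b (x , y) = (x ≡ a × y ≡ b) ⊎ (x ≡ b × y ≡ a)

  cyc-sound : ∀ vs a b → cycleAdjℕ vs a b ≡ true → Σ (ℕ × ℕ) λ e → e ∈ cycleEdges vs × Hit a b e
  cyc-sound vs a b e with a ≡ᵇ b
  ... | true with () ← e
  ... | false with any-sound _ (cycleEdges vs) e
  ... | (x , y) , m , h = (x , y) , m , hit (∨-true h)
    where
    hit : ((x ≡ᵇ a) ∧ (y ≡ᵇ b)) ≡ true ⊎ ((x ≡ᵇ b) ∧ (y ≡ᵇ a)) ≡ true → Hit a b (x , y)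
    hit (inj₁ h) = inj₁ (≡ᵇ-sound x a (proj₁ (∧-true h)) , ≡ᵇ-sound y b (proj₂ (∧-true h)))
    hit (inj₂ h) = inj₂ (≡ᵇ-sound x b (proj₁ (∧-true h)) , ≡ᵇ-sound y a (proj₂ (∧-true h)))

  cyc-complete : ∀ vs a b x y → (x , y) ∈ cycleEdges vs → ¬ (a ≡ b) → Hit a b (x , y) → cycleAdjℕ vs a b ≡ true
  cyc-complete vs a b x y m ne h rewrite ≡ᵇ-false a b ne = any-complete _ (cycleEdges vs) (x , y) m (pf h)
    where
    pf : Hit a b (x , y) → (((x ≡ᵇ a) ∧ (y ≡ᵇ b)) ∨ ((x ≡ᵇ b) ∧ (y ≡ᵇ a))) ≡ true
    pf (inj₁ (refl , refl)) = true-∨ˡ _ (true-∧ (≡ᵇ-refl x) (≡ᵇ-refl y))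
    pf (inj₂ (refl , refl)) = true-∨ʳ _ (true-∧ (≡ᵇ-refl x) (≡ᵇ-refl y))

  -- The edge list of the closed walk f 0, f 1, …, f t, z (then back to f 0),
  -- in the form produced by cycleEdges.
  ZL : (ℕ → ℕ) → ℕ → ℕ → List (ℕ × ℕ)
  ZL f t z = zip (f 0 ∷ applyUpTo (λ i → f (suc i)) t) (applyUpTo (λ i → f (suc i)) t ++ z ∷ [])

  ZL-sound : ∀ f t z x y → (x , y) ∈ ZL f t z →
             (Σ ℕ λ i → i < t × x ≡ f i × y ≡ f (suc i)) ⊎ (x ≡ f t × y ≡ z)
  ZL-sound f zero z x y (here refl) = inj₂ (refl , refl)
  ZL-sound f (suc t) z x y (here refl) = inj₁ (0 , s≤s z≤n , refl , refl)
  ZL-sound f (suc t) z x y (there m) with ZL-sound (λ i → f (suc i)) t z x y m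
  ... | inj₁ (i , lt , e1 , e2) = inj₁ (suc i , s≤s lt , e1 , e2)
  ... | inj₂ (e1 , e2) = inj₂ (e1 , e2)

  ZL-edge : ∀ f t z i → i < t → (f i , f (suc i)) ∈ ZL f t z
  ZL-edge f (suc t) z zero lt = here refl
  ZL-edge f (suc t) z (suc i) (s≤s lt) = there (ZL-edge (λ j → f (suc j)) t z i lt)

  ZL-last : ∀ f t z → (f t , z) ∈ ZL f t z
  ZL-last f zero z = here refl
  ZL-last f (suc t) z = there (ZL-last (λ j → f (suc j)) t z)

  map-applyUpTo : ∀ (g : ℕ → ℕ) (f : ℕ → ℕ) n → map g (applyUpTo f n) ≡ applyUpTo (λ i → g (f i)) n
  map-applyUpTo g f zero = refl
  map-applyUpTo g f (suc n) = cong (g (f 0) ∷_) (map-applyUpTo g (λ i → f (suc i)) n)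

  -- G = cycleSum (p+2) (q+2).  Its vertices are 0 … p+q+1; the C-path is
  -- 1, 2, …, p+1 and the D-path is seqD 0 = 1, seqD 1, …, seqD q, both
  -- closing up at 0.  Ed lists its edges, each in one orientation.
  module _ (p q : ℕ) where
    r s : ℕ
    r = suc (suc p)
    s = suc (suc q)

    gD : ℕ → ℕ
    gD zero = 0
    gD (suc zero) = 1
    gD (suc (suc i)) = r + i

    edgesD : cycleEdges (cycleD r s) ≡ ZL gD (suc q) 0
    edgesD = cong (λ L → zip (0 ∷ 1 ∷ L) ((1 ∷ L) ++ 0 ∷ [])) (map-applyUpTo (r +_) (λ i → i) q)

    seqD : ℕ → ℕ
    seqD zero = 1
    seqD (suc i) = suc (suc (p + i))

    gD-seqD : ∀ i → gD (suc i) ≡ seqD i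
    gD-seqD zero = refl
    gD-seqD (suc i) = refl

    E : ℕ → ℕ → Bool
    E a b = cycleAdjℕ (cycleC r) a b ∨ cycleAdjℕ (cycleD r s) a b

    data Ed : ℕ → ℕ → Set where
      e01 : Ed 0 1
      eC : ∀ i → i < p → Ed (suc i) (suc (suc i))
      eC0 : Ed (suc p) 0
      eD : ∀ i → i < q → Ed (seqD i) (seqD (suc i))
      eD0 : Ed (seqD q) 0

    edC : ∀ x y → (Σ ℕ λ i → i < suc p × x ≡ i × y ≡ suc i) ⊎ (x ≡ suc p × y ≡ 0) → Ed x y
    edC x y (inj₁ (zero , lt , refl , refl)) = e01
    edC x y (inj₁ (suc i , s≤s lt , refl , refl)) = eC i lt
    edC x y (inj₂ (refl , refl)) = eC0

    edD : ∀ x y → (Σ ℕ λ i → i < suc q × x ≡ gD i × y ≡ gD (suc i)) ⊎ (x ≡ gD (suc q) × y ≡ 0) → Ed x y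
    edD x y (inj₁ (zero , lt , refl , refl)) = e01
    edD x y (inj₁ (suc i , s≤s lt , refl , refl)) rewrite gD-seqD i | gD-seqD (suc i) = eD i lt
    edD x y (inj₂ (refl , refl)) rewrite gD-seqD q = eD0

    hitEd : ∀ a b x y → Hit a b (x , y) → Ed x y → Ed a b ⊎ Ed b a
    hitEd a b x y (inj₁ (refl , refl)) ed = inj₁ ed
    hitEd a b x y (inj₂ (refl , refl)) ed = inj₂ ed

    E→Ed : ∀ a b → E a b ≡ true → Ed a b ⊎ Ed b a
    E→Ed a b e with ∨-true {cycleAdjℕ (cycleC r) a b} e
    ... | inj₁ ec with cyc-sound (cycleC r) a b ec
    ... | (x , y) , m , h = hitEd a b x y h (edC x y (ZL-sound (λ i → i) (suc p) 0 x y m))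
    E→Ed a b e | inj₂ ed with cyc-sound (cycleD r s) a b ed
    ... | (x , y) , m , h = hitEd a b x y h (edD x y (ZL-sound gD (suc q) 0 x y (subst ((x , y) ∈_) edgesD m)))

    Ed-ne : ∀ {a b} → Ed a b → ¬ (a ≡ b)
    Ed-ne e01 ()
    Ed-ne (eC i x) e = ⊥-elim (1+n≢n (sym (suc-injective e)))
    Ed-ne eC0 ()
    Ed-ne (eD zero x) ()
    Ed-ne (eD (suc i) x) e = ⊥-elim (1+n≢n (sym (trans (suc-injective (suc-injective e)) (+-suc p i))))
    Ed-ne eD0 = sd q
      where
      sd : ∀ j → ¬ (seqD j ≡ 0)
      sd zero ()
      sd (suc j) ()

    Ed-mem : ∀ {a b} → Ed a b → ((a , b) ∈ cycleEdges (cycleC r)) ⊎ ((a , b) ∈ cycleEdges (cycleD r s))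
    Ed-mem e01 = inj₁ (ZL-edge (λ i → i) (suc p) 0 0 (s≤s z≤n))
    Ed-mem (eC i lt) = inj₁ (ZL-edge (λ i → i) (suc p) 0 (suc i) (s≤s lt))
    Ed-mem eC0 = inj₁ (ZL-last (λ i → i) (suc p) 0)
    Ed-mem (eD i lt) = inj₂ (subst ((seqD i , seqD (suc i)) ∈_) (sym edgesD)
                          (subst₂ (λ u v → (u , v) ∈ ZL gD (suc q) 0) (gD-seqD i) (gD-seqD (suc i)) (ZL-edge gD (suc q) 0 (suc i) (s≤s lt))))
    Ed-mem eD0 = inj₂ (subst ((seqD q , 0) ∈_) (sym edgesD) (subst (λ u → (u , 0) ∈ ZL gD (suc q) 0) (gD-seqD q) (ZL-last gD (suc q) 0)))

    Ed→E : ∀ {a b} → Ed a b → E a b ≡ true × E b a ≡ true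
    Ed→E {a} {b} ed with Ed-mem ed
    ... | inj₁ m = true-∨ˡ _ (cyc-complete (cycleC r) a b a b m (Ed-ne ed) (inj₁ (refl , refl)))
                 , true-∨ˡ _ (cyc-complete (cycleC r) b a a b m (λ e → Ed-ne ed (sym e)) (inj₂ (refl , refl)))
    ... | inj₂ m = true-∨ʳ _ (cyc-complete (cycleD r s) a b a b m (Ed-ne ed) (inj₁ (refl , refl)))
                 , true-∨ʳ _ (cyc-complete (cycleD r s) b a a b m (λ e → Ed-ne ed (sym e)) (inj₂ (refl , refl)))

    E-sym : ∀ a b → E a b ≡ E b a
    E-sym a b = bool-ext (reverse a b) (reverse b a)
      where
      reverse : ∀ a b → E a b ≡ true → E b a ≡ true
      reverse a b e with E→Ed a b e
      ... | inj₁ ed = proj₂ (Ed→E ed)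
      ... | inj₂ ed = proj₁ (Ed→E ed)

    E-irr : ∀ a → E a a ≡ false
    E-irr a with E a a in e
    ... | false = refl
    ... | true with E→Ed a a e
    ... | inj₁ ed = ⊥-elim (Ed-ne ed refl)
    ... | inj₂ ed = ⊥-elim (Ed-ne ed refl)

    n : ℕ
    n = suc (suc (p + q))

    Ed-bd : ∀ {a b} → Ed a b → a < n × b < n
    Ed-bd e01 = s≤s z≤n , s≤s (s≤s z≤n)
    Ed-bd (eC i lt) = s≤s (s≤s (≤-trans (<⇒≤ lt) (m≤m+n p q))) , s≤s (s≤s (≤-trans lt (m≤m+n p q)))
    Ed-bd eC0 = s≤s (s≤s (m≤m+n p q)) , s≤s z≤n
    Ed-bd (eD zero lt) = s≤s (s≤s z≤n) , s≤s (s≤s (+-monoʳ-< p lt))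
    Ed-bd (eD (suc i) lt) = s≤s (s≤s (+-monoʳ-< p (<-trans (n<1+n i) lt))) , s≤s (s≤s (+-monoʳ-< p lt))
    Ed-bd eD0 = bd q ≤-refl , s≤s z≤n
      where
      bd : ∀ q' → q' ≤ q → seqD q' < n
      bd zero _ = s≤s (s≤s z≤n)
      bd (suc q') le = s≤s (s≤s (+-monoʳ-< p le))


module Vectors where

  open import Data.Nat using (ℕ; zero; suc; _+_; _*_; _<_; s≤s)
  open import Data.Nat.Properties using (+-identityʳ)
  open import Data.Fin using (Fin; toℕ) renaming (zero to fz; suc to fs)
  open import Data.Vec using (Vec; []; _∷_; lookup)
  open import Data.Product using (_×_; _,_; proj₁; proj₂)
  open import Relation.Binary.PropositionalEquality
  open Sums

  at : ∀ {A : Set} {n} → Vec A n → A → ℕ → A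
  at [] d j = d
  at (x ∷ v) d zero = x
  at (x ∷ v) d (suc j) = at v d j

  at-lookup : ∀ {A : Set} {n} (c : Vec A n) d (u : Fin n) → at c d (toℕ u) ≡ lookup c u
  at-lookup (x ∷ c) d fz = refl
  at-lookup (x ∷ c) d (fs u) = at-lookup c d u

  split : ∀ {A : Set} p {q} → Vec A (p + q) → Vec A p × Vec A q
  split zero v = [] , v
  split (suc p) (x ∷ v) = (x ∷ proj₁ (split p v)) , proj₂ (split p v)

  at-split₁ : ∀ {A : Set} p {q} (v : Vec A (p + q)) d j → j < p → at v d j ≡ at (proj₁ (split p v)) d j
  at-split₁ (suc p) (x ∷ v) d zero lt = refl
  at-split₁ (suc p) (x ∷ v) d (suc j) (s≤s lt) = at-split₁ p v d j lt

  at-split₂ : ∀ {A : Set} p {q} (v : Vec A (p + q)) d j → at v d (p + j) ≡ at (proj₂ (split p v)) d j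
  at-split₂ zero v d j = refl
  at-split₂ (suc p) (x ∷ v) d j = at-split₂ p v d j

  ΣV-split : ∀ K p q (F : Vec (Fin K) p → ℕ) (G : Vec (Fin K) q → ℕ) →
    ΣV K (p + q) (λ v → F (proj₁ (split p v)) * G (proj₂ (split p v))) ≡ ΣV K p F * ΣV K q G
  ΣV-split K zero q F G = trans (ΣV-*ˡ K q (F []) G) (cong (_* ΣV K q G) (sym (+-identityʳ (F []))))
  ΣV-split K (suc p) q F G = trans (ΣV-suc K (p + q) _)
    (trans (ΣF-cong K (λ x → ΣV-split K p q (λ v → F (x ∷ v)) G))
    (trans (ΣF-*ʳ K (ΣV K q G) (λ x → ΣV K p (λ v → F (x ∷ v))))
           (cong (_* ΣV K q G) (sym (ΣV-suc K p F)))))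

  ΣV-cast : ∀ K {n n'} (eq : n ≡ n') (F : Vec (Fin K) n' → ℕ) →
    ΣV K n (λ c → F (subst (Vec (Fin K)) eq c)) ≡ ΣV K n' F
  ΣV-cast K refl F = refl

  at-cast : ∀ {A : Set} {n n'} (eq : n ≡ n') (c : Vec A n) d j → at (subst (Vec A) eq c) d j ≡ at c d j
  at-cast refl c d j = refl

  at-default : ∀ {A : Set} {t} (v : Vec A t) d d' j → j < t → at v d j ≡ at v d' j
  at-default (x ∷ v) d d' zero lt = refl
  at-default (x ∷ v) d d' (suc j) (s≤s lt) = at-default v d d' j lt


module Factorisation where

  open import Data.Nat using (ℕ; zero; suc; _+_; _*_; _∸_; _≤_; _<_; z≤n; s≤s; _<?_)
  open import Data.Nat.Properties
  open import Data.Bool using (Bool; true; false; _∧_; not)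
  open import Data.Fin using (Fin; toℕ; fromℕ<) renaming (zero to fz)
  open import Data.Fin.Properties using (toℕ<n; toℕ-fromℕ<)
  open import Data.Vec using (Vec; []; _∷_; lookup)
  open import Data.List using (allFin)
  open import Data.Bool.ListAction using (all)
  open import Data.Product using (_×_; _,_; proj₁; proj₂)
  open import Data.Sum using (_⊎_; inj₁; inj₂)
  open import Relation.Nullary using (yes; no)
  open import Relation.Binary.PropositionalEquality
  open import Defs
  open Sums
  open Booleans
  open Vectors

  module Edges = CycleSum

  seqC : ℕ → ℕ
  seqC i = suc i

  module Colourings (p q K : ℕ) (ℓ : ℕ → Fin K → Bool) (κ : ℕ → ℕ → Fin K → Fin K → Bool)
           (κsym : ∀ a b x y → κ a b x y ≡ κ b a y x) where

    open Walks.InCover K ℓ κ public using (chainOK; PC)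

    r s nn : ℕ
    r = suc (suc p)
    s = suc (suc q)
    nn = suc (suc (p + q))

    G : Graph
    G = cycleSum r s

    nG : ℕ
    nG = Graph.n G

    nE : nG ≡ nn
    nE = trans (+-suc p (suc q)) (cong suc (+-suc p q))

    sD : ℕ → ℕ
    sD = Edges.seqD p q

    Ed : ℕ → ℕ → Set
    Ed = Edges.Ed p q

    validG : Vec (Fin K) nG → Bool
    validG c = all (λ u → ℓ (toℕ u) (lookup c u)) (allFin nG) ∧
               all (λ u → all (λ w → not (adj G u w ∧ κ (toℕ u) (toℕ w) (lookup c u) (lookup c w))) (allFin nG)) (allFin nG)

    Valid : (ℕ → Fin K) → Set
    Valid f = (∀ a → a < nn → ℓ a (f a) ≡ true) × (∀ a b → Ed a b → κ a b (f a) (f b) ≡ false)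

    Valid-cong : ∀ f g → (∀ j → f j ≡ g j) → Valid f → Valid g
    Valid-cong f g e (h1 , h2) = (λ a lt → subst (λ z → ℓ a z ≡ true) (e a) (h1 a lt)) ,
                              (λ a b ed → subst₂ (λ z z' → κ a b z z' ≡ false) (e a) (e b) (h2 a b ed))

    lt-n : ∀ {a} → a < nG → a < nn
    lt-n {a} lt = subst (a <_) nE lt
    lt-nG : ∀ {a} → a < nn → a < nG
    lt-nG {a} lt = subst (a <_) (sym nE) lt

    module _ (c : Vec (Fin K) nG) (d : Fin K) where
      lift1 : (P : ℕ → Fin K → Set) → (∀ u → P (toℕ u) (lookup c u)) → ∀ a → a < nG → P a (at c d a)
      lift1 P h a la = subst (λ a' → P a' (at c d a')) (toℕ-fromℕ< la)
                         (subst (P (toℕ (fromℕ< la))) (sym (at-lookup c d (fromℕ< la))) (h (fromℕ< la)))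
      lift2 : (P : ℕ → ℕ → Fin K → Fin K → Set) → (∀ u w → P (toℕ u) (toℕ w) (lookup c u) (lookup c w)) →
              ∀ a b → a < nG → b < nG → P a b (at c d a) (at c d b)
      lift2 P h a b la lb = subst₂ (λ a' b' → P a' b' (at c d a') (at c d b')) (toℕ-fromℕ< la) (toℕ-fromℕ< lb)
            (subst₂ (P (toℕ (fromℕ< la)) (toℕ (fromℕ< lb))) (sym (at-lookup c d (fromℕ< la))) (sym (at-lookup c d (fromℕ< lb))) (h (fromℕ< la) (fromℕ< lb)))

      validG⇒Valid : validG c ≡ true → Valid (at c d)
      validG⇒Valid e = (λ a la → lift1 (λ a' z → ℓ a' z ≡ true) (allFin-sound _ (proj₁ (∧-true e))) a (lt-nG la)) ,
             (λ a b ed → lift2 (λ a' b' z z' → Edges.E p q a' b' ≡ true → κ a' b' z z' ≡ false)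
                      (λ u w ew → fin u w ew) a b (lt-nG (proj₁ (Edges.Ed-bd p q ed))) (lt-nG (proj₂ (Edges.Ed-bd p q ed))) (proj₁ (Edges.Ed→E p q ed)))
        where
        fin : ∀ u w → Edges.E p q (toℕ u) (toℕ w) ≡ true → κ (toℕ u) (toℕ w) (lookup c u) (lookup c w) ≡ false
        fin u w ew = aux (allFin-sound _ (allFin-sound _ (proj₂ (∧-true {all (λ u → ℓ (toℕ u) (lookup c u)) (allFin nG)} e)) u) w)
          where
          aux : not (adj G u w ∧ κ (toℕ u) (toℕ w) (lookup c u) (lookup c w)) ≡ true → κ (toℕ u) (toℕ w) (lookup c u) (lookup c w) ≡ false
          aux h rewrite ew = not-true h

      Valid⇒validG : Valid (at c d) → validG c ≡ true
      Valid⇒validG (h1 , h2) = true-∧ (allFin-complete _ part1) (allFin-complete _ (λ u → allFin-complete _ (λ w → part2 u w)))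
        where
        part1 : ∀ u → ℓ (toℕ u) (lookup c u) ≡ true
        part1 u = subst (λ z → ℓ (toℕ u) z ≡ true) (at-lookup c d u) (h1 (toℕ u) (lt-n (toℕ<n u)))
        kf : ∀ u w → Ed (toℕ u) (toℕ w) ⊎ Ed (toℕ w) (toℕ u) → κ (toℕ u) (toℕ w) (lookup c u) (lookup c w) ≡ false
        kf u w (inj₁ ed) = subst₂ (λ z z' → κ (toℕ u) (toℕ w) z z' ≡ false) (at-lookup c d u) (at-lookup c d w) (h2 _ _ ed)
        kf u w (inj₂ ed) = subst₂ (λ z z' → κ (toℕ u) (toℕ w) z z' ≡ false) (at-lookup c d u) (at-lookup c d w)
                             (trans (κsym (toℕ u) (toℕ w) _ _) (h2 _ _ ed))
        part2 : ∀ u w → not (adj G u w ∧ κ (toℕ u) (toℕ w) (lookup c u) (lookup c w)) ≡ true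
        part2 u w with Edges.E p q (toℕ u) (toℕ w) in ew
        ... | false = refl
        ... | true = not-false (kf u w (Edges.E→Ed p q _ _ ew))

    Chain : (seq : ℕ → ℕ) (t : ℕ) (h : ℕ → Fin K) (a : Fin K) → Set
    Chain seq t h a = (∀ j → j < t → ℓ (seq (suc j)) (h (suc j)) ≡ true × κ (seq j) (seq (suc j)) (h j) (h (suc j)) ≡ false)
                 × κ (seq t) 0 (h t) a ≡ false

    Chain-cong : ∀ seq t h h' a → (∀ j → j ≤ t → h j ≡ h' j) → Chain seq t h a → Chain seq t h' a
    Chain-cong seq t h h' a e (c1 , c2) =
      (λ j lt → subst (λ z → ℓ (seq (suc j)) z ≡ true) (e (suc j) lt) (proj₁ (c1 j lt)) ,
                subst₂ (λ z z' → κ (seq j) (seq (suc j)) z z' ≡ false) (e j (<⇒≤ lt)) (e (suc j) lt) (proj₂ (c1 j lt))) ,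
      subst (λ z → κ (seq t) 0 z a ≡ false) (e t ≤-refl) c2

    Chain-cons : ∀ seq t h a → ℓ (seq 1) (h 1) ≡ true → κ (seq 0) (seq 1) (h 0) (h 1) ≡ false →
              Chain (λ i → seq (suc i)) t (λ i → h (suc i)) a → Chain seq (suc t) h a
    Chain-cons seq t h a l k (c1 , c2) = f , c2
      where
      f : ∀ j → j < suc t → ℓ (seq (suc j)) (h (suc j)) ≡ true × κ (seq j) (seq (suc j)) (h j) (h (suc j)) ≡ false
      f zero _ = l , k
      f (suc j) (s≤s lt) = c1 j lt

    Chain-head : ∀ seq t h a → Chain seq (suc t) h a → ℓ (seq 1) (h 1) ≡ true × κ (seq 0) (seq 1) (h 0) (h 1) ≡ false
    Chain-head seq t h a (c1 , c2) = c1 0 (s≤s z≤n)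

    Chain-tail : ∀ seq t h a → Chain seq (suc t) h a → Chain (λ i → seq (suc i)) t (λ i → h (suc i)) a
    Chain-tail seq t h a (c1 , c2) = (λ j lt → c1 (suc j) (s≤s lt)) , c2

    walkAt : ∀ {t} → Fin K → Vec (Fin K) t → ℕ → Fin K
    walkAt x v zero = x
    walkAt x v (suc j) = at v x j

    walkAt-shift : ∀ {t} x y (v : Vec (Fin K) t) j → j ≤ t → walkAt x (y ∷ v) (suc j) ≡ walkAt y v j
    walkAt-shift x y v zero _ = refl
    walkAt-shift x y v (suc j) lt = at-default v x y j lt

    chainOK⇒Chain : ∀ seq {t} x (v : Vec (Fin K) t) a → chainOK seq x v a ≡ true → Chain seq t (walkAt x v) a
    chainOK⇒Chain seq x [] a e = (λ j ()) , not-true e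
    chainOK⇒Chain seq {suc t} x (y ∷ v) a e =
      Chain-cons seq t (walkAt x (y ∷ v)) a (proj₁ (∧-true (proj₁ (∧-true e)))) (not-true (proj₂ (∧-true {ℓ (seq 1) y} (proj₁ (∧-true e)))))
        (Chain-cong (λ i → seq (suc i)) t (walkAt y v) (λ i → walkAt x (y ∷ v) (suc i)) a (λ j lt → sym (walkAt-shift x y v j lt))
          (chainOK⇒Chain (λ i → seq (suc i)) y v a (proj₂ (∧-true {ℓ (seq 1) y ∧ not (κ (seq 0) (seq 1) x y)} e))))

    Chain⇒chainOK : ∀ seq {t} x (v : Vec (Fin K) t) a → Chain seq t (walkAt x v) a → chainOK seq x v a ≡ true
    Chain⇒chainOK seq x [] a (c1 , c2) = not-false c2
    Chain⇒chainOK seq {suc t} x (y ∷ v) a ch =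
      true-∧ (true-∧ (proj₁ (Chain-head seq t _ a ch)) (not-false (proj₂ (Chain-head seq t _ a ch))))
          (Chain⇒chainOK (λ i → seq (suc i)) y v a
            (Chain-cong (λ i → seq (suc i)) t (λ i → walkAt x (y ∷ v) (suc i)) (walkAt y v) a (λ j lt → walkAt-shift x y v j lt)
               (Chain-tail seq t (walkAt x (y ∷ v)) a ch)))

    Split : (ℕ → Fin K) → Set
    Split f = ℓ 0 (f 0) ≡ true × ℓ 1 (f 1) ≡ true × κ 0 1 (f 0) (f 1) ≡ false
          × Chain seqC p (λ j → f (seqC j)) (f 0) × Chain sD q (λ j → f (sD j)) (f 0)

    Valid⇒Split : ∀ f → Valid f → Split f
    Valid⇒Split f (h1 , h2) = h1 0 (s≤s z≤n) , h1 1 (s≤s (s≤s z≤n)) , h2 0 1 Edges.e01 ,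
        ((λ j lt → h1 (suc (suc j)) (proj₂ (Edges.Ed-bd p q (Edges.eC j lt))) , h2 _ _ (Edges.eC j lt)) , h2 _ _ Edges.eC0) ,
        ((λ j lt → h1 (sD (suc j)) (proj₂ (Edges.Ed-bd p q (Edges.eD j lt))) , h2 _ _ (Edges.eD j lt)) , h2 _ _ Edges.eD0)

    Split⇒Valid : ∀ f → Split f → Valid f
    Split⇒Valid f (l0 , l1 , k01 , (cc , cc0) , (dd , dd0)) = vl , ve
      where
      vl : ∀ a → a < nn → ℓ a (f a) ≡ true
      vl zero _ = l0
      vl (suc zero) _ = l1
      vl (suc (suc a)) (s≤s (s≤s lt)) with a <? p
      ... | yes ap = proj₁ (cc a ap)
      ... | no ¬ap = subst (λ z → ℓ (suc (suc z)) (f (suc (suc z))) ≡ true) eqa (proj₁ (dd (a ∸ p) jq))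
        where
        pa : p ≤ a
        pa = ≮⇒≥ ¬ap
        eqa : p + (a ∸ p) ≡ a
        eqa = m+[n∸m]≡n pa
        jq : a ∸ p < q
        jq = +-cancelˡ-< p (a ∸ p) q (subst (_< p + q) (sym eqa) lt)
      ve : ∀ a b → Ed a b → κ a b (f a) (f b) ≡ false
      ve .0 .1 Edges.e01 = k01
      ve .(suc i) .(suc (suc i)) (Edges.eC i lt) = proj₂ (cc i lt)
      ve .(suc p) .0 Edges.eC0 = cc0
      ve .(sD i) .(sD (suc i)) (Edges.eD i lt) = proj₂ (dd i lt)
      ve .(sD q) .0 Edges.eD0 = dd0

    validSplit : Vec (Fin K) nn → Bool
    validSplit (a ∷ b ∷ w) = (ℓ 0 a ∧ (ℓ 1 b ∧ not (κ 0 1 a b))) ∧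
                         (chainOK seqC b (proj₁ (split p w)) a ∧ chainOK sD b (proj₂ (split p w)) a)

    module _ (a b : Fin K) (w : Vec (Fin K) (p + q)) (d : Fin K) where
      private
        c' : Vec (Fin K) nn
        c' = a ∷ b ∷ w
        f : ℕ → Fin K
        f = at c' d
        vC = proj₁ (split p w)
        vD = proj₂ (split p w)
        eqC : ∀ j → j ≤ p → walkAt b vC j ≡ f (seqC j)
        eqC zero _ = refl
        eqC (suc j) lt = trans (at-default vC b d j lt) (sym (at-split₁ p w d j lt))
        eqD : ∀ j → j ≤ q → walkAt b vD j ≡ f (sD j)
        eqD zero _ = refl
        eqD (suc j) lt = trans (at-default vD b d j lt) (sym (at-split₂ p w d j))

      validSplit⇒Split : validSplit c' ≡ true → Split f
      validSplit⇒Split e = proj₁ (∧-true g) , proj₁ (∧-true g2) , not-true (proj₂ (∧-true {ℓ 1 b} g2)) ,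
             Chain-cong seqC p (walkAt b vC) (λ j → f (seqC j)) a eqC (chainOK⇒Chain seqC b vC a (proj₁ (∧-true ch))) ,
             Chain-cong sD q (walkAt b vD) (λ j → f (sD j)) a eqD (chainOK⇒Chain sD b vD a (proj₂ (∧-true {chainOK seqC b vC a} ch)))
        where
        g = proj₁ (∧-true e)
        g2 = proj₂ (∧-true {ℓ 0 a} g)
        ch = proj₂ (∧-true {ℓ 0 a ∧ (ℓ 1 b ∧ not (κ 0 1 a b))} e)

      Split⇒validSplit : Split f → validSplit c' ≡ true
      Split⇒validSplit (l0 , l1 , k , cc , dd) = true-∧ (true-∧ l0 (true-∧ l1 (not-false k)))
         (true-∧ (Chain⇒chainOK seqC b vC a (Chain-cong seqC p (λ j → f (seqC j)) (walkAt b vC) a (λ j lt → sym (eqC j lt)) cc))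
              (Chain⇒chainOK sD b vD a (Chain-cong sD q (λ j → f (sD j)) (walkAt b vD) a (λ j lt → sym (eqD j lt)) dd)))

    -- The vertex count of cycleSum is nn only propositionally.
    cast : Vec (Fin K) nG → Vec (Fin K) nn
    cast c = subst (Vec (Fin K)) nE c

    validSplit⇔Split : ∀ (c : Vec (Fin K) nn) d → (validSplit c ≡ true → Split (at c d)) × (Split (at c d) → validSplit c ≡ true)
    validSplit⇔Split (a ∷ b ∷ w) d = validSplit⇒Split a b w d , Split⇒validSplit a b w d

    pointwise : ∀ c → validG c ≡ validSplit (cast c)
    pointwise c = bool-ext
       (λ e → proj₂ (validSplit⇔Split (cast c) d) (Valid⇒Split _ (Valid-cong (at c d) (at (cast c) d) (λ j → sym (at-cast nE c d j)) (validG⇒Valid c d e))))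
       (λ e → Valid⇒validG c d (Valid-cong (at (cast c) d) (at c d) (λ j → at-cast nE c d j) (Split⇒Valid _ (proj₁ (validSplit⇔Split (cast c) d) e))))
      where
      d : Fin K
      d = lookup (cast c) fz

    count : ΣV K nG (λ c → ⟦ validG c ⟧) ≡
            ΣF K (λ a → ΣF K (λ b → ⟦ ℓ 0 a ∧ (ℓ 1 b ∧ not (κ 0 1 a b)) ⟧ * (PC seqC p b a * PC sD q b a)))
    count = begin
      ΣV K nG (λ c → ⟦ validG c ⟧) ≡⟨ ΣV-cong K nG (λ c → cong ⟦_⟧ (pointwise c)) ⟩
      ΣV K nG (λ c → ⟦ validSplit (cast c) ⟧) ≡⟨ ΣV-cast K nE (λ c → ⟦ validSplit c ⟧) ⟩
      ΣV K nn (λ c → ⟦ validSplit c ⟧) ≡⟨ ΣV-suc K (suc (p + q)) _ ⟩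
      ΣF K (λ a → ΣV K (suc (p + q)) (λ v → ⟦ validSplit (a ∷ v) ⟧)) ≡⟨ ΣF-cong K (λ a → ΣV-suc K (p + q) _) ⟩
      ΣF K (λ a → ΣF K (λ b → ΣV K (p + q) (λ w → ⟦ validSplit (a ∷ b ∷ w) ⟧))) ≡⟨ ΣF-cong K (λ a → ΣF-cong K (λ b → inner a b)) ⟩
      ΣF K (λ a → ΣF K (λ b → ⟦ ℓ 0 a ∧ (ℓ 1 b ∧ not (κ 0 1 a b)) ⟧ * (PC seqC p b a * PC sD q b a))) ∎
      where
      open ≡-Reasoning
      inner : ∀ a b → ΣV K (p + q) (λ w → ⟦ validSplit (a ∷ b ∷ w) ⟧) ≡ ⟦ ℓ 0 a ∧ (ℓ 1 b ∧ not (κ 0 1 a b)) ⟧ * (PC seqC p b a * PC sD q b a)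
      inner a b = trans (ΣV-cong K (p + q) (λ w → trans (⟦∧⟧ g _) (cong (⟦ g ⟧ *_) (⟦∧⟧ (chainOK seqC b (proj₁ (split p w)) a) _))))
                  (trans (ΣL-*ˡ (allVecs (allFin K) (p + q)) ⟦ g ⟧ _)
                    (cong (⟦ g ⟧ *_) (ΣV-split K p q (λ v → ⟦ chainOK seqC b v a ⟧) (λ v → ⟦ chainOK sD b v a ⟧))))
        where g = ℓ 0 a ∧ (ℓ 1 b ∧ not (κ 0 1 a b))



module Subsets where

  open import Data.Nat using (ℕ; zero; suc; _+_; _*_; _≤_; s≤s)
  open import Data.Nat.Properties
  open import Data.Bool using (Bool; true; false; not)
  open import Data.Fin using (Fin) renaming (zero to fz; suc to fs)
  open import Data.Fin.Subset using (Subset; ∣_∣)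
  import Data.Fin.Subset as SS
  open import Data.Vec using (Vec; []; _∷_; lookup; tabulate)
  open import Data.Vec.Properties using (tabulate∘lookup; tabulate-cong; []=⇒lookup; lookup⇒[]=)
  open import Data.List using (allFin)
  open import Data.List.Membership.Propositional.Properties using (∈-allFin)
  open import Data.Bool.ListAction using (any)
  open import Data.Product using (Σ; _,_)
  open import Data.Sum using (_⊎_; inj₁; inj₂)
  open import Data.Empty using (⊥-elim)
  open import Relation.Binary.PropositionalEquality
  open import Defs using (memᵇ)
  open Sums
  open Booleans

  mem-lookup : ∀ {N} (x : Fin N) S → memᵇ x S ≡ lookup S x
  mem-lookup x S with lookup S x
  ... | true = refl
  ... | false = refl

  toIn : ∀ {N} {x : Fin N} {S} → memᵇ x S ≡ true → x SS.∈ S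
  toIn {x = x} {S} e = lookup⇒[]= x S (trans (sym (mem-lookup x S)) e)

  fromIn : ∀ {N} {x : Fin N} {S} → x SS.∈ S → memᵇ x S ≡ true
  fromIn {x = x} {S} m = trans (mem-lookup x S) ([]=⇒lookup m)

  card : ∀ {N} (S : Subset N) → ∣ S ∣ ≡ ΣF N (λ x → ⟦ memᵇ x S ⟧)
  card [] = refl
  card (true ∷ S) = cong suc (trans (card S) (ΣF-cong _ (λ x → cong ⟦_⟧ (trans (mem-lookup x S) (sym (mem-lookup (fs x) (true ∷ S)))))))
  card (false ∷ S) = trans (card S) (ΣF-cong _ (λ x → cong ⟦_⟧ (trans (mem-lookup x S) (sym (mem-lookup (fs x) (false ∷ S))))))

  find : ∀ {N} (P : Fin N → Bool) → (Σ (Fin N) λ x → P x ≡ true) ⊎ (∀ x → P x ≡ false)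
  find {zero} P = inj₂ (λ ())
  find {suc N} P with P fz in e
  ... | true = inj₁ (fz , e)
  ... | false with find (λ i → P (fs i))
  ... | inj₁ (x , ex) = inj₁ (fs x , ex)
  ... | inj₂ h = inj₂ (λ { fz → e ; (fs x) → h x })

  elemOf : ∀ {N} (d : Fin N) (P : Fin N → Bool) → Fin N
  elemOf d P with find P
  ... | inj₁ (x , _) = x
  ... | inj₂ _ = d

  elemOf-ok : ∀ {N} (d : Fin N) (P : Fin N → Bool) → (Σ (Fin N) λ x → P x ≡ true) → P (elemOf d P) ≡ true
  elemOf-ok d P (y , ey) with find P
  ... | inj₁ (x , ex) = ex
  ... | inj₂ h with () ← trans (sym ey) (h y)

  any-sum : ∀ n (P : Fin n → Bool) → (∀ u w → P u ≡ true → P w ≡ true → u ≡ w) → ⟦ any P (allFin n) ⟧ ≡ ΣF n (λ u → ⟦ P u ⟧)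
  any-sum n P uq with any P (allFin n) in e
  ... | true with any-sound P (allFin n) e
  ... | u0 , _ , pu0 = sym (trans (ΣF-cong n pw) (trans (ΣF-delta n u0 (λ _ → 1)) refl))
    where
    pw : ∀ u → ⟦ P u ⟧ ≡ ⟦ eqF u u0 ⟧ * 1
    pw u with P u in epu | eqF u u0 in eq
    ... | true | true = refl
    ... | true | false with () ← trans (sym (eqF-refl u)) (subst (λ z → eqF u z ≡ false) (sym (uq u u0 epu pu0)) eq)
    ... | false | true with () ← trans (sym pu0) (subst (λ z → P z ≡ false) (eqF-sound u u0 eq) epu)
    ... | false | false = refl
  any-sum n P uq | false = sym (ΣF-zero n pz)
    where
    pz : ∀ u → ⟦ P u ⟧ ≡ 0
    pz u with P u in epu
    ... | false = refl
    ... | true with () ← trans (sym (any-complete P (allFin n) u (∈-allFin u) epu)) e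

  all-one : ∀ n (t : Fin n → ℕ) → ΣF n t ≡ n → (∀ u → t u ≤ 1) → ∀ u → t u ≡ 1
  all-one n t sm le u with t u in etu
  ... | suc zero = refl
  ... | suc (suc k) with s≤s () ← subst (_≤ 1) etu (le u)
  ... | zero = ⊥-elim (<-irrefl refl (≤-trans (≤-reflexive (cong suc (sym sm))) bound))
    where
    rest : ℕ
    rest = ΣF n (λ w → ⟦ not (eqF w u) ⟧ * 1)
    hn : n ≡ 1 + rest
    hn = trans (sym (trans (ΣF-const n 1) (*-identityʳ n))) (ΣF-split n u (λ _ → 1))
    bound : suc (ΣF n t) ≤ n
    bound = begin
      suc (ΣF n t) ≡⟨ cong suc (ΣF-split n u t) ⟩
      suc (t u + ΣF n (λ w → ⟦ not (eqF w u) ⟧ * t w)) ≡⟨ cong (λ z → suc (z + ΣF n (λ w → ⟦ not (eqF w u) ⟧ * t w))) etu ⟩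
      suc (ΣF n (λ w → ⟦ not (eqF w u) ⟧ * t w)) ≤⟨ s≤s (ΣF-mono n (λ w → *-monoʳ-≤ ⟦ not (eqF w u) ⟧ (le w))) ⟩
      suc rest ≡⟨ sym hn ⟩
      n ∎
      where open ≤-Reasoning

  vec-ext : ∀ {A : Set} {k} (a b : Vec A k) → (∀ i → lookup a i ≡ lookup b i) → a ≡ b
  vec-ext a b h = trans (sym (tabulate∘lookup a)) (trans (tabulate-cong h) (tabulate∘lookup b))

module Injections where

  open import Data.Nat using (zero; suc; _≤_)
  open import Data.Bool using (Bool; true; T)
  open import Data.Fin using (Fin) renaming (zero to fz; suc to fs)
  open import Data.Fin.Properties using (injective⇒≤)
  open import Data.Vec using (Vec; []; _∷_; lookup; head)
  open import Data.Vec.Properties using (∷-injectiveʳ)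
  open import Data.List using (List; []; _∷_; map; concatMap; length; filterᵇ)
  import Data.List as L
  open import Data.List.Membership.Propositional using (_∈_)
  open import Data.List.Membership.Propositional.Properties using (∈-lookup; ∈-map⁺; ∈-map⁻; ∈-++⁺ˡ; ∈-++⁺ʳ; ∈-++⁻; ∈-filter⁺; ∈-filter⁻)
  open import Data.List.Relation.Unary.Any using (here; there; index)
  open import Data.List.Relation.Unary.Any.Properties using (lookup-index)
  open import Data.List.Relation.Unary.Unique.Propositional using (Unique)
  import Data.List.Relation.Unary.Unique.Propositional.Properties as UP
  open import Data.List.Relation.Unary.AllPairs using ([]; _∷_)
  import Data.List.Relation.Unary.All as All
  open import Data.Product using (_×_; _,_; proj₁; proj₂)
  open import Data.Sum using (inj₁; inj₂)
  open import Data.Empty using (⊥-elim)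
  open import Relation.Nullary using (¬_)
  open import Relation.Nullary.Decidable using (T?)
  open import Relation.Binary.PropositionalEquality
  open import Defs using (allVecs)

  uniq-lookup : ∀ {A : Set} {xs : List A} → Unique xs → ∀ i j → L.lookup xs i ≡ L.lookup xs j → i ≡ j
  uniq-lookup {xs = x ∷ xs} (px ∷ u) fz fz e = refl
  uniq-lookup {xs = x ∷ xs} (px ∷ u) fz (fs j) e = ⊥-elim (All.lookup px (∈-lookup j) e)
  uniq-lookup {xs = x ∷ xs} (px ∷ u) (fs i) fz e = ⊥-elim (All.lookup px (∈-lookup i) (sym e))
  uniq-lookup {xs = x ∷ xs} (px ∷ u) (fs i) (fs j) e = cong fs (uniq-lookup u i j e)

  inj≤ : ∀ {A B : Set} (zs : List A) (ws : List B) (f : A → B) → Unique zs →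
         (∀ {x y} → x ∈ zs → y ∈ zs → f x ≡ f y → x ≡ y) → (∀ {x} → x ∈ zs → f x ∈ ws) → length zs ≤ length ws
  inj≤ zs ws f u inj mem = injective⇒≤ {f = g} ginj
    where
    g : Fin (length zs) → Fin (length ws)
    g i = index (mem (∈-lookup i))
    ginj : ∀ {i j} → g i ≡ g j → i ≡ j
    ginj {i} {j} e = uniq-lookup u i j (inj (∈-lookup i) (∈-lookup j)
       (trans (lookup-index (mem (∈-lookup i))) (trans (cong (L.lookup ws) e) (sym (lookup-index (mem (∈-lookup j)))))))

  head-mem : ∀ {A : Set} {k} (V : List (Vec A k)) (xs : List A) {v : Vec A (suc k)} →
             v ∈ concatMap (λ x → map (x ∷_) V) xs → head v ∈ xs
  head-mem V (x ∷ xs) {v} m with ∈-++⁻ (map (x ∷_) V) m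
  ... | inj₁ m1 with ∈-map⁻ (x ∷_) m1
  ... | w , _ , refl = here refl
  head-mem V (x ∷ xs) m | inj₂ m2 = there (head-mem V xs m2)

  uniq-cm : ∀ {A : Set} {k} (V : List (Vec A k)) (xs : List A) → Unique xs → Unique V →
            Unique (concatMap (λ x → map (x ∷_) V) xs)
  uniq-cm V [] u U = []
  uniq-cm V (x ∷ xs) (px ∷ u) U = UP.++⁺ (UP.map⁺ ∷-injectiveʳ U) (uniq-cm V xs u U) disj
    where
    disj : ∀ {v} → ¬ (v ∈ map (x ∷_) V × v ∈ concatMap (λ x → map (x ∷_) V) xs)
    disj (m1 , m2) with ∈-map⁻ (x ∷_) m1
    ... | w , _ , refl = All.lookup px (head-mem V xs m2) refl

  uniq-allVecs : ∀ {A : Set} (xs : List A) → Unique xs → ∀ k → Unique (allVecs xs k)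
  uniq-allVecs xs u zero = All.[] ∷ []
  uniq-allVecs xs u (suc k) = uniq-cm (allVecs xs k) xs u (uniq-allVecs xs u k)

  cm-mem : ∀ {A : Set} {k} (V : List (Vec A k)) (xs : List A) {y w} → y ∈ xs → w ∈ V →
           (y ∷ w) ∈ concatMap (λ x → map (x ∷_) V) xs
  cm-mem V (x ∷ xs) (here refl) mw = ∈-++⁺ˡ (∈-map⁺ (x ∷_) mw)
  cm-mem V (x ∷ xs) (there my) mw = ∈-++⁺ʳ (map (x ∷_) V) (cm-mem V xs my mw)

  allVecs-complete : ∀ {A : Set} (xs : List A) k (v : Vec A k) → (∀ i → lookup v i ∈ xs) → v ∈ allVecs xs k
  allVecs-complete xs zero [] h = here refl
  allVecs-complete xs (suc k) (y ∷ w) h = cm-mem (allVecs xs k) xs (h fz) (allVecs-complete xs k w (λ i → h (fs i)))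

  filt⁻ : ∀ {A : Set} (p : A → Bool) (xs : List A) {x} → x ∈ filterᵇ p xs → x ∈ xs × p x ≡ true
  filt⁻ p xs m with ∈-filter⁻ (λ x → T? (p x)) {xs = xs} m
  ... | m' , t = m' , tt' t
    where
    tt' : ∀ {b} → T b → b ≡ true
    tt' {true} _ = refl

  filt⁺ : ∀ {A : Set} (p : A → Bool) (xs : List A) {x} → x ∈ xs → p x ≡ true → x ∈ filterᵇ p xs
  filt⁺ p xs m e = ∈-filter⁺ (λ x → T? (p x)) m (subst T (sym e) _)

  count≤ : ∀ {A B : Set} (xs : List A) (ys : List B) (p : A → Bool) (q : B → Bool) (f : A → B) → Unique xs →
     (∀ x → x ∈ xs → p x ≡ true → f x ∈ ys × q (f x) ≡ true) →
     (∀ x y → x ∈ xs → y ∈ xs → p x ≡ true → p y ≡ true → f x ≡ f y → x ≡ y) →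
     length (filterᵇ p xs) ≤ length (filterᵇ q ys)
  count≤ xs ys p q f u h inj = inj≤ (filterᵇ p xs) (filterᵇ q ys) f (UP.filter⁺ (λ x → T? (p x)) u)
    (λ mx my e → inj _ _ (proj₁ (filt⁻ p xs mx)) (proj₁ (filt⁻ p xs my)) (proj₂ (filt⁻ p xs mx)) (proj₂ (filt⁻ p xs my)) e)
    (λ {x} mx → let (m , e) = filt⁻ p xs mx in filt⁺ q ys (proj₁ (h x m e)) (proj₂ (h x m e)))


-- For a cover H of G, the H-colourings (independent sets of size |V(G)|) are
-- in bijection with choice vectors c : Vec (Fin N) (n G) with c u ∈ L(u) and
-- no H-edges between chosen vertices; so P-DP-cover counts the valid
-- colourings of the list system (ℓc, κc) of H, to which (⋆) applies.
module CoverColourings where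

  open import Data.Nat using (ℕ; zero; _*_; _≡ᵇ_; _≤_; _<?_)
  open import Data.Nat.Properties
  open import Data.Bool using (Bool; true; false; _∧_; not)
  open import Data.Fin using (Fin; toℕ; fromℕ<)
  open import Data.Fin.Properties using (toℕ<n; fromℕ<-toℕ)
  open import Data.Fin.Subset using (Subset; inside; outside; ∣_∣)
  import Data.Fin.Subset as SS
  open import Data.Vec using (Vec; []; _∷_; lookup; tabulate)
  open import Data.Vec.Properties using (lookup∘tabulate)
  open import Data.List using (List; []; _∷_; allFin; length; filterᵇ)
  open import Data.List.Membership.Propositional using (_∈_)
  open import Data.List.Membership.Propositional.Properties using (∈-allFin)
  open import Data.List.Relation.Unary.Any using (here; there)
  import Data.List.Relation.Unary.Unique.Propositional.Properties as UP
  import Data.List.Relation.Unary.Unique.Propositional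
  import Data.Fin
  open import Data.List.Relation.Unary.AllPairs using ([]; _∷_)
  import Data.List.Relation.Unary.All as All
  open import Data.Bool.ListAction using (all; any)
  open import Data.Product using (Σ; _,_; proj₁; proj₂)
  open import Data.Sum using (inj₁; inj₂)
  open import Data.Empty using (⊥-elim)
  open import Relation.Nullary using (yes; no)
  open import Relation.Binary.PropositionalEquality hiding (resp)
  open import Defs
  open Sums
  open Booleans
  open Injections
  open Subsets

  module Cov (G : Graph) (N : ℕ) (H : Cover G N) where
    nV : ℕ
    nV = n G

    ℓc : ℕ → Fin N → Bool
    ℓc a x with a <? nV
    ... | yes lt = memᵇ x (L H (fromℕ< lt))
    ... | no _ = false

    ℓc-toℕ : ∀ u x → ℓc (toℕ u) x ≡ memᵇ x (L H u)
    ℓc-toℕ u x with toℕ u <? nV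
    ... | yes lt = cong (λ z → memᵇ x (L H z)) (fromℕ<-toℕ u lt)
    ... | no ¬lt = ⊥-elim (¬lt (toℕ<n u))

    κc : ℕ → ℕ → Fin N → Fin N → Bool
    κc _ _ x y = hAdj H x y

    validChoice : Vec (Fin N) nV → Bool
    validChoice c = all (λ u → ℓc (toℕ u) (lookup c u)) (allFin nV) ∧
               all (λ u → all (λ w → not (adj G u w ∧ κc (toℕ u) (toℕ w) (lookup c u) (lookup c w))) (allFin nV)) (allFin nV)

    isColouring : Subset N → Bool
    isColouring S = independentᵇ H S ∧ (∣ S ∣ ≡ᵇ nV)

    module ValidChoice (c : Vec (Fin N) nV) (v : validChoice c ≡ true) where
      in-list : ∀ u → memᵇ (lookup c u) (L H u) ≡ true
      in-list u = trans (sym (ℓc-toℕ u (lookup c u))) (allFin-sound _ (proj₁ (∧-true v)) u)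
      non-adjacent : ∀ u w → hAdj H (lookup c u) (lookup c w) ≡ false
      non-adjacent u w with hAdj H (lookup c u) (lookup c w) in e
      ... | false = refl
      ... | true with resp H u w (lookup c u) (lookup c w) (toIn (in-list u)) (toIn (in-list w)) e
      ... | inj₁ refl = trans (sym e) (hIrr H (lookup c u))
      ... | inj₂ a with () ← subst₂ (λ z z' → not (z ∧ z') ≡ true) a e
                       (allFin-sound _ (allFin-sound _ (proj₂ (∧-true {all (λ u → ℓc (toℕ u) (lookup c u)) (allFin nV)} v)) u) w)
      injective : ∀ u w → lookup c u ≡ lookup c w → u ≡ w
      injective u w e = disj H (lookup c u) u w (toIn (in-list u)) (subst (SS._∈ L H w) (sym e) (toIn (in-list w)))

    img : Vec (Fin N) nV → Subset N
    img c = tabulate (λ x → any (λ u → eqF (lookup c u) x) (allFin nV))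

    mem-img : ∀ c x → memᵇ x (img c) ≡ any (λ u → eqF (lookup c u) x) (allFin nV)
    mem-img c x = trans (mem-lookup x (img c)) (lookup∘tabulate _ x)

    img-sound : ∀ c x → memᵇ x (img c) ≡ true → Σ (Fin nV) λ u → lookup c u ≡ x
    img-sound c x e with any-sound _ (allFin nV) (trans (sym (mem-img c x)) e)
    ... | u , _ , eu = u , eqF-sound _ _ eu

    img-complete : ∀ c u → memᵇ (lookup c u) (img c) ≡ true
    img-complete c u = trans (mem-img c (lookup c u)) (any-complete _ (allFin nV) u (∈-allFin u) (eqF-refl (lookup c u)))

    img-colouring : ∀ c → validChoice c ≡ true → isColouring (img c) ≡ true
    img-colouring c v = true-∧ indep size
      where
      open ValidChoice c v
      indep : independentᵇ H (img c) ≡ true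
      indep = allFin-complete _ (λ x → allFin-complete _ (λ y → pw x y))
        where
        pw : ∀ x y → not (memᵇ x (img c) ∧ memᵇ y (img c) ∧ hAdj H x y) ≡ true
        pw x y with memᵇ x (img c) in ex | memᵇ y (img c) in ey
        ... | false | _ = refl
        ... | true | false = refl
        ... | true | true with img-sound c x ex | img-sound c y ey
        ... | u , refl | w , refl rewrite non-adjacent u w = refl
      size : (∣ img c ∣ ≡ᵇ nV) ≡ true
      size = subst (λ z → (z ≡ᵇ nV) ≡ true) (sym sz) (≡ᵇ-refl nV)
        where
        sz : ∣ img c ∣ ≡ nV
        sz = begin
          ∣ img c ∣ ≡⟨ card (img c) ⟩
          ΣF N (λ x → ⟦ memᵇ x (img c) ⟧) ≡⟨ ΣF-cong N (λ x → trans (cong ⟦_⟧ (mem-img c x))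
                  (any-sum nV (λ u → eqF (lookup c u) x) (λ u w eu ew → injective u w (trans (eqF-sound _ _ eu) (sym (eqF-sound _ _ ew)))))) ⟩
          ΣF N (λ x → ΣF nV (λ u → ⟦ eqF (lookup c u) x ⟧)) ≡⟨ ΣF-swap N nV _ ⟩
          ΣF nV (λ u → ΣF N (λ x → ⟦ eqF (lookup c u) x ⟧)) ≡⟨ ΣF-cong nV (λ u → trans (ΣF-cong N (λ x → trans (cong ⟦_⟧ (eqF-comm (lookup c u) x)) (sym (*-identityʳ _)))) (ΣF-delta N (lookup c u) (λ _ → 1))) ⟩
          ΣF nV (λ _ → 1) ≡⟨ trans (ΣF-const nV 1) (*-identityʳ nV) ⟩
          nV ∎
          where open ≡-Reasoning

    -- An H-colouring meets each L(u) at most once (L(u) is a clique), hence,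
    -- by counting, exactly once.
    module IsColouring (S : Subset N) (v : isColouring S ≡ true) where
      independent : ∀ x y → memᵇ x S ≡ true → memᵇ y S ≡ true → hAdj H x y ≡ false
      independent x y ex ey = not-true (subst₂ (λ z z' → not (z ∧ z' ∧ hAdj H x y) ≡ true) ex ey
                         (allFin-sound _ (allFin-sound _ (proj₁ (∧-true v)) x) y))
      size-nV : ∣ S ∣ ≡ nV
      size-nV = ≡ᵇ-sound _ _ (proj₂ (∧-true {independentᵇ H S} v))
      hit-unique : ∀ u x y → (memᵇ x S ∧ memᵇ x (L H u)) ≡ true → (memᵇ y S ∧ memᵇ y (L H u)) ≡ true → x ≡ y
      hit-unique u x y px py with x Data.Fin.≟ y
      ... | yes e = e
      ... | no ne with () ← trans (sym (cliq H u x y (toIn (proj₂ (∧-true px))) (toIn (proj₂ (∧-true py))) ne))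
                                   (independent x y (proj₁ (∧-true px)) (proj₁ (∧-true py)))
      hits : Fin nV → ℕ
      hits u = ΣF N (λ x → ⟦ memᵇ x S ∧ memᵇ x (L H u) ⟧)
      hits≤1 : ∀ u → hits u ≤ 1
      hits≤1 u = atmost1 N _ (hit-unique u)
      in-one-list : ∀ x → ΣF nV (λ u → ⟦ memᵇ x (L H u) ⟧) ≡ 1
      in-one-list x with cov H x
      ... | u0 , m0 = trans (ΣF-cong nV pw) (ΣF-delta nV u0 (λ _ → 1))
        where
        pw : ∀ u → ⟦ memᵇ x (L H u) ⟧ ≡ ⟦ eqF u u0 ⟧ * 1
        pw u with memᵇ x (L H u) in em | eqF u u0 in eq
        ... | true | true = refl
        ... | false | false = refl
        ... | true | false with () ← trans (sym (eqF-refl u)) (subst (λ z → eqF u z ≡ false) (sym (disj H x u u0 (toIn em) m0)) eq)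
        ... | false | true with () ← trans (sym (fromIn m0)) (subst (λ z → memᵇ x (L H z) ≡ false) (eqF-sound _ _ eq) em)
      Σhits : ΣF nV hits ≡ nV
      Σhits = begin
        ΣF nV hits ≡⟨ ΣF-swap nV N _ ⟩
        ΣF N (λ x → ΣF nV (λ u → ⟦ memᵇ x S ∧ memᵇ x (L H u) ⟧)) ≡⟨ ΣF-cong N (λ x →
              trans (ΣF-cong nV (λ u → ⟦∧⟧ (memᵇ x S) _)) (trans (ΣF-*ˡ nV ⟦ memᵇ x S ⟧ _) (cong (⟦ memᵇ x S ⟧ *_) (in-one-list x)))) ⟩
        ΣF N (λ x → ⟦ memᵇ x S ⟧ * 1) ≡⟨ ΣF-cong N (λ x → *-identityʳ _) ⟩
        ΣF N (λ x → ⟦ memᵇ x S ⟧) ≡⟨ sym (card S) ⟩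
        ∣ S ∣ ≡⟨ size-nV ⟩
        nV ∎
        where open ≡-Reasoning
      hit : ∀ u → Σ (Fin N) λ x → (memᵇ x S ∧ memᵇ x (L H u)) ≡ true
      hit u with find (λ x → memᵇ x S ∧ memᵇ x (L H u))
      ... | inj₁ r = r
      ... | inj₂ h with () ← trans (sym (all-one nV hits Σhits hits≤1 u)) (ΣF-zero N (λ x → cong ⟦_⟧ (h x)))

    pickAt : Fin N → Subset N → Fin nV → Fin N
    pickAt d S u = elemOf d (λ x → memᵇ x S ∧ memᵇ x (L H u))

    pick : Fin N → Subset N → Vec (Fin N) nV
    pick d S = tabulate (pickAt d S)

    pick-ok : ∀ d S → isColouring S ≡ true → ∀ u → (memᵇ (lookup (pick d S) u) S ∧ memᵇ (lookup (pick d S) u) (L H u)) ≡ true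
    pick-ok d S v u rewrite lookup∘tabulate (pickAt d S) u = elemOf-ok d _ (IsColouring.hit S v u)

    ∧false : ∀ a → not (a ∧ false) ≡ true
    ∧false true = refl
    ∧false false = refl

    pick-valid : ∀ d S → isColouring S ≡ true → validChoice (pick d S) ≡ true
    pick-valid d S v = true-∧ (allFin-complete _ (λ u → trans (ℓc-toℕ u _) (proj₂ (∧-true (pick-ok d S v u)))))
                   (allFin-complete _ (λ u → allFin-complete _ (λ w →
                      subst (λ z → not (adj G u w ∧ z) ≡ true)
                        (sym (IsColouring.independent S v _ _ (proj₁ (∧-true (pick-ok d S v u))) (proj₁ (∧-true (pick-ok d S v w)))))
                        (∧false (adj G u w)))))

    pick∘img : ∀ d c → validChoice c ≡ true → pick d (img c) ≡ c
    pick∘img d c v = vec-ext _ _ (λ u → trans (lookup∘tabulate (pickAt d (img c)) u) (pw u))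
      where
      open ValidChoice c v
      pw : ∀ u → pickAt d (img c) u ≡ lookup c u
      pw u with img-sound c _ (proj₁ (∧-true ok))
        where ok = elemOf-ok d (λ x → memᵇ x (img c) ∧ memᵇ x (L H u)) (lookup c u , true-∧ (img-complete c u) (in-list u))
      ... | w , ew = trans (sym ew) (cong (lookup c) (sym uw))
        where
        ok = elemOf-ok d (λ x → memᵇ x (img c) ∧ memᵇ x (L H u)) (lookup c u , true-∧ (img-complete c u) (in-list u))
        uw : u ≡ w
        uw = disj H (pickAt d (img c) u) u w (toIn (proj₂ (∧-true ok))) (subst (SS._∈ L H w) ew (toIn (in-list w)))

    img∘pick : ∀ d S → isColouring S ≡ true → img (pick d S) ≡ S
    img∘pick d S v = vec-ext _ _ (λ x → trans (sym (mem-lookup x (img (pick d S)))) (trans (mem-img (pick d S) x) (trans (pw x) (mem-lookup x S))))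
      where
      pw : ∀ x → any (λ u → eqF (lookup (pick d S) u) x) (allFin nV) ≡ memᵇ x S
      pw x with memᵇ x S in ex
      ... | true with cov H x
      ... | u , mu = any-complete _ (allFin nV) u (∈-allFin u)
                       (subst (λ z → eqF (lookup (pick d S) u) z ≡ true)
                          (IsColouring.hit-unique S v u _ _ (pick-ok d S v u) (true-∧ ex (fromIn mu)))
                          (eqF-refl (lookup (pick d S) u)))
      pw x | false with any (λ u → eqF (lookup (pick d S) u) x) (allFin nV) in e
      ... | false = refl
      ... | true with any-sound _ (allFin nV) e
      ... | u , _ , eu with () ← trans (sym ex) (subst (λ z → memᵇ z S ≡ true) (eqF-sound _ _ eu) (proj₁ (∧-true (pick-ok d S v u))))

    uniqBool : Data.List.Relation.Unary.Unique.Propositional.Unique (outside ∷ inside ∷ [])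
    uniqBool = ((λ ()) All.∷ All.[]) ∷ (All.[] ∷ [])

    countCover : Fin N → P-DP-cover G H ≡ ΣV N nV (λ c → ⟦ validChoice c ⟧)
    countCover d = trans (≤-antisym le1 le2) (len-filter validChoice (allVecs (allFin N) nV))
      where
      le1 : length (filterᵇ isColouring (allSubsets N)) ≤ length (filterᵇ validChoice (allVecs (allFin N) nV))
      le1 = count≤ (allSubsets N) (allVecs (allFin N) nV) isColouring validChoice (pick d)
              (uniq-allVecs _ uniqBool N)
              (λ S _ vS → allVecs-complete (allFin N) nV _ (λ i → ∈-allFin _) , pick-valid d S vS)
              (λ S S' _ _ vS vS' e → trans (sym (img∘pick d S vS)) (trans (cong img e) (img∘pick d S' vS')))
      le2 : length (filterᵇ validChoice (allVecs (allFin N) nV)) ≤ length (filterᵇ isColouring (allSubsets N))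
      le2 = count≤ (allVecs (allFin N) nV) (allSubsets N) validChoice isColouring img
              (uniq-allVecs _ (UP.allFin⁺ N) nV)
              (λ c _ vc → allVecs-complete (outside ∷ inside ∷ []) N _ (λ i → bmem (lookup (img c) i)) , img-colouring c vc)
              (λ c c' _ _ vc vc' e → trans (sym (pick∘img d c vc)) (trans (cong (pick d) e) (pick∘img d c' vc')))
        where
        bmem : ∀ b → b ∈ (outside ∷ inside ∷ [])
        bmem false = here refl
        bmem true = there (here refl)


module ProductBounds where

  open import Data.Nat using (ℕ; suc; _+_; _*_; _<ᵇ_; _≤_; _<_; z≤n)
  open import Data.Nat.Properties
  open import Data.Nat.Tactic.RingSolver using (solve-∀)
  open import Data.Bool using (Bool; true; false; _∧_)
  open import Data.Fin using (Fin)
  open import Data.Product using (proj₁; proj₂)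
  open import Relation.Binary.PropositionalEquality
  open Sums
  open Booleans

  pinned : ∀ A x → A ≤ x + 1 → (x <ᵇ A) ≡ true → A ≡ x + 1
  pinned A x le lt = ≤-antisym le (≤-trans (≤-reflexive (+-comm x 1)) (<ᵇ-true x A lt))

  product-bound₂ : ∀ A B x y → (A ≤ x + 1) → (B ≤ y + 1) →
        A * B ≤ x * y + B * ⟦ x <ᵇ A ⟧ + A * ⟦ y <ᵇ B ⟧
  product-bound₂ A B x y hx hy with x <ᵇ A in ex | y <ᵇ B in ey
  ... | false | false = ≤-trans (*-mono-≤ (<ᵇ-false x A ex) (<ᵇ-false y B ey)) (≤-reflexive (rearrange (x * y) B A))
    where rearrange : ∀ z B A → z ≡ z + B * 0 + A * 0
          rearrange = solve-∀
  ... | true | false rewrite pinned A x hx ex =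
    ≤-trans (≤-reflexive (expand x B)) (≤-trans (+-monoˡ-≤ B (*-monoʳ-≤ x (<ᵇ-false y B ey))) (≤-reflexive (rearrange x y B)))
    where expand : ∀ x B → (x + 1) * B ≡ x * B + B
          expand = solve-∀
          rearrange : ∀ x y B → x * y + B ≡ x * y + B * 1 + (x + 1) * 0
          rearrange = solve-∀
  ... | false | true rewrite pinned B y hy ey =
    ≤-trans (≤-reflexive (expand A y)) (≤-trans (+-monoˡ-≤ A (*-monoˡ-≤ y (<ᵇ-false x A ex))) (≤-reflexive (rearrange x y A)))
    where expand : ∀ A y → A * (y + 1) ≡ A * y + A
          expand = solve-∀
          rearrange : ∀ x y A → x * y + A ≡ x * y + (y + 1) * 0 + A * 1
          rearrange = solve-∀
  ... | true | true rewrite pinned A x hx ex | pinned B y hy ey = ≤-trans (m≤m+n _ 1) (≤-reflexive (expand x y))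
    where expand : ∀ x y → (x + 1) * (y + 1) + 1 ≡ x * y + (y + 1) * 1 + (x + 1) * 1
          expand = solve-∀

  product-bound₁ : ∀ A B x y → A ≤ x → (B ≤ y + 1) → A * B ≤ x * y + A * ⟦ y <ᵇ B ⟧
  product-bound₁ A B x y hx hy with y <ᵇ B in ey
  ... | false = ≤-trans (*-mono-≤ hx (<ᵇ-false y B ey)) (m≤m+n _ _)
  ... | true rewrite pinned B y hy ey =
    ≤-trans (≤-reflexive (expand A y)) (+-monoˡ-≤ (A * 1) (*-monoˡ-≤ y hx))
    where expand : ∀ A y → A * (y + 1) ≡ A * y + A * 1
          expand = solve-∀

  module _ (K : ℕ) (g ℓ1 : Fin K → Bool) (WC WD : Fin K → ℕ) (A B M : ℕ)
           (gℓ : ∀ b → g b ≡ true → ℓ1 b ≡ true) (cg : M ≤ ΣF K (λ b → ⟦ g b ⟧)) where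

    private
      base : M * (A * B) ≤ ΣF K (λ b → ⟦ g b ⟧ * (A * B))
      base = ≤-trans (*-monoˡ-≤ (A * B) cg) (≤-reflexive (sym (ΣF-*ʳ K (A * B) _)))

    sum-odd-odd : (∀ b → ℓ1 b ≡ true → A ≤ WC b) → (∀ b → ℓ1 b ≡ true → B ≤ WD b) →
           M * (A * B) ≤ ΣF K (λ b → ⟦ g b ⟧ * (WC b * WD b))
    sum-odd-odd hC hD = ≤-trans base (ΣF-mono K pw)
      where
      pw : ∀ b → ⟦ g b ⟧ * (A * B) ≤ ⟦ g b ⟧ * (WC b * WD b)
      pw b with g b in e
      ... | false = z≤n
      ... | true = +-monoʳ-≤ 0 (+-monoˡ-≤ 0 (*-mono-≤ (hC b (gℓ b e)) (hD b (gℓ b e))))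

    sum-odd-even : (∀ b → ℓ1 b ≡ true → A ≤ WC b) →
             (∀ b → ℓ1 b ≡ true → B ≤ WD b + 1) → (∀ b b' → ℓ1 b ≡ true → ℓ1 b' ≡ true → WD b < B → WD b' < B → b ≡ b') →
             M * (A * B) ≤ ΣF K (λ b → ⟦ g b ⟧ * (WC b * WD b)) + A
    sum-odd-even hC hD1 hD2 = begin
      M * (A * B) ≤⟨ base ⟩
      ΣF K (λ b → ⟦ g b ⟧ * (A * B)) ≤⟨ ΣF-mono K pw ⟩
      ΣF K (λ b → ⟦ g b ⟧ * (WC b * WD b) + A * ⟦ dD b ⟧) ≡⟨ ΣF-+ K _ _ ⟩
      ΣF K (λ b → ⟦ g b ⟧ * (WC b * WD b)) + ΣF K (λ b → A * ⟦ dD b ⟧) ≡⟨ cong (ΣF K (λ b → ⟦ g b ⟧ * (WC b * WD b)) +_) (ΣF-*ˡ K A _) ⟩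
      ΣF K (λ b → ⟦ g b ⟧ * (WC b * WD b)) + A * ΣF K (λ b → ⟦ dD b ⟧) ≤⟨ +-monoʳ-≤ (ΣF K (λ b → ⟦ g b ⟧ * (WC b * WD b))) (≤-trans (*-monoʳ-≤ A dD≤1) (≤-reflexive (*-identityʳ A))) ⟩
      ΣF K (λ b → ⟦ g b ⟧ * (WC b * WD b)) + A ∎
      where
      open ≤-Reasoning
      dD : Fin K → Bool
      dD b = ℓ1 b ∧ (WD b <ᵇ B)
      dD≤1 : ΣF K (λ b → ⟦ dD b ⟧) ≤ 1
      dD≤1 = atmost1 K dD (λ b b' eb eb' → hD2 b b' (proj₁ (∧-true eb)) (proj₁ (∧-true eb')) (<ᵇ-true _ _ (proj₂ (∧-true eb))) (<ᵇ-true _ _ (proj₂ (∧-true eb'))))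
      pw : ∀ b → ⟦ g b ⟧ * (A * B) ≤ ⟦ g b ⟧ * (WC b * WD b) + A * ⟦ dD b ⟧
      pw b with g b in e
      ... | false = z≤n
      ... | true rewrite gℓ b e = ≤-trans (≤-reflexive (+-identityʳ (A * B))) (≤-trans (product-bound₁ A B (WC b) (WD b) (hC b (gℓ b e)) (hD1 b (gℓ b e)))
                                     (≤-reflexive (cong (_+ A * ⟦ WD b <ᵇ B ⟧) (sym (+-identityʳ _)))))

    sum-even-even : (∀ b → ℓ1 b ≡ true → A ≤ WC b + 1) → (∀ b b' → ℓ1 b ≡ true → ℓ1 b' ≡ true → WC b < A → WC b' < A → b ≡ b') →
            (∀ b → ℓ1 b ≡ true → B ≤ WD b + 1) → (∀ b b' → ℓ1 b ≡ true → ℓ1 b' ≡ true → WD b < B → WD b' < B → b ≡ b') →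
            M * (A * B) ≤ ΣF K (λ b → ⟦ g b ⟧ * (WC b * WD b)) + (A + B)
    sum-even-even hC1 hC2 hD1 hD2 = begin
      M * (A * B) ≤⟨ base ⟩
      ΣF K (λ b → ⟦ g b ⟧ * (A * B)) ≤⟨ ΣF-mono K pw ⟩
      ΣF K (λ b → ⟦ g b ⟧ * (WC b * WD b) + B * ⟦ dC b ⟧ + A * ⟦ dD b ⟧) ≡⟨ ΣF-+ K _ _ ⟩
      ΣF K (λ b → ⟦ g b ⟧ * (WC b * WD b) + B * ⟦ dC b ⟧) + ΣF K (λ b → A * ⟦ dD b ⟧) ≡⟨ cong₂ _+_ (ΣF-+ K _ _) (ΣF-*ˡ K A _) ⟩
      ΣF K (λ b → ⟦ g b ⟧ * (WC b * WD b)) + ΣF K (λ b → B * ⟦ dC b ⟧) + A * ΣF K (λ b → ⟦ dD b ⟧) ≡⟨ cong (λ z → ΣF K (λ b → ⟦ g b ⟧ * (WC b * WD b)) + z + A * ΣF K (λ b → ⟦ dD b ⟧)) (ΣF-*ˡ K B _) ⟩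
      S + B * ΣF K (λ b → ⟦ dC b ⟧) + A * ΣF K (λ b → ⟦ dD b ⟧) ≤⟨ +-mono-≤ (+-monoʳ-≤ S (≤-trans (*-monoʳ-≤ B dC≤1) (≤-reflexive (*-identityʳ B)))) (≤-trans (*-monoʳ-≤ A dD≤1) (≤-reflexive (*-identityʳ A))) ⟩
      S + B + A ≡⟨ trans (+-assoc S B A) (cong (S +_) (+-comm B A)) ⟩
      S + (A + B) ∎
      where
      open ≤-Reasoning
      S = ΣF K (λ b → ⟦ g b ⟧ * (WC b * WD b))
      dC : Fin K → Bool
      dC b = ℓ1 b ∧ (WC b <ᵇ A)
      dD : Fin K → Bool
      dD b = ℓ1 b ∧ (WD b <ᵇ B)
      dC≤1 : ΣF K (λ b → ⟦ dC b ⟧) ≤ 1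
      dC≤1 = atmost1 K dC (λ b b' eb eb' → hC2 b b' (proj₁ (∧-true eb)) (proj₁ (∧-true eb')) (<ᵇ-true _ _ (proj₂ (∧-true eb))) (<ᵇ-true _ _ (proj₂ (∧-true eb'))))
      dD≤1 : ΣF K (λ b → ⟦ dD b ⟧) ≤ 1
      dD≤1 = atmost1 K dD (λ b b' eb eb' → hD2 b b' (proj₁ (∧-true eb)) (proj₁ (∧-true eb')) (<ᵇ-true _ _ (proj₂ (∧-true eb))) (<ᵇ-true _ _ (proj₂ (∧-true eb'))))
      pw : ∀ b → ⟦ g b ⟧ * (A * B) ≤ ⟦ g b ⟧ * (WC b * WD b) + B * ⟦ dC b ⟧ + A * ⟦ dD b ⟧
      pw b with g b in e
      ... | false = z≤n
      ... | true rewrite gℓ b e = ≤-trans (≤-reflexive (+-identityʳ (A * B))) (≤-trans (product-bound₂ A B (WC b) (WD b) (hC1 b (gℓ b e)) (hD1 b (gℓ b e)))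
                                     (≤-reflexive (cong (λ z → z + B * ⟦ WC b <ᵇ A ⟧ + A * ⟦ WD b <ᵇ B ⟧) (sym (+-identityʳ _)))))

  outer-sum : ∀ K (ℓ0 : Fin K → Bool) (g : Fin K → Fin K → Bool) (X : Fin K → Fin K → ℕ) (V c M : ℕ) →
          ΣF K (λ a → ⟦ ℓ0 a ⟧) ≡ suc M →
          (∀ a → ℓ0 a ≡ true → V ≤ ΣF K (λ b → ⟦ g a b ⟧ * X a b) + c) →
          suc M * V ≤ ΣF K (λ a → ΣF K (λ b → ⟦ ℓ0 a ∧ g a b ⟧ * X a b)) + suc M * c
  outer-sum K ℓ0 g X V c M sz h = begin
    suc M * V ≡⟨ cong (_* V) (sym sz) ⟩
    ΣF K (λ a → ⟦ ℓ0 a ⟧) * V ≡⟨ sym (ΣF-*ʳ K V _) ⟩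
    ΣF K (λ a → ⟦ ℓ0 a ⟧ * V) ≤⟨ ΣF-mono K pw ⟩
    ΣF K (λ a → ΣF K (λ b → ⟦ ℓ0 a ∧ g a b ⟧ * X a b) + ⟦ ℓ0 a ⟧ * c) ≡⟨ ΣF-+ K _ _ ⟩
    ΣF K (λ a → ΣF K (λ b → ⟦ ℓ0 a ∧ g a b ⟧ * X a b)) + ΣF K (λ a → ⟦ ℓ0 a ⟧ * c) ≡⟨ cong (ΣF K (λ a → ΣF K (λ b → ⟦ ℓ0 a ∧ g a b ⟧ * X a b)) +_) (trans (ΣF-*ʳ K c _) (cong (_* c) sz)) ⟩
    ΣF K (λ a → ΣF K (λ b → ⟦ ℓ0 a ∧ g a b ⟧ * X a b)) + suc M * c ∎
    where
    open ≤-Reasoning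
    pw : ∀ a → ⟦ ℓ0 a ⟧ * V ≤ ΣF K (λ b → ⟦ ℓ0 a ∧ g a b ⟧ * X a b) + ⟦ ℓ0 a ⟧ * c
    pw a with ℓ0 a in e
    ... | false = z≤n
    ... | true = ≤-trans (≤-reflexive (+-identityʳ V)) (≤-trans (h a e) (≤-reflexive (cong (ΣF K (λ b → ⟦ g a b ⟧ * X a b) +_) (sym (+-identityʳ c)))))


module LowerBound where

  open import Data.Nat using (ℕ; suc; _+_; _*_; _≤_; _<_; s≤s; _<?_)
  open import Data.Nat.Properties
  open import Data.Bool using (Bool; true; _∧_; not)
  open import Data.Fin using (Fin; fromℕ<) renaming (zero to fz)
  open import Data.Fin.Properties using (toℕ-fromℕ<)
  open import Data.Fin.Subset using (Subset; ∣_∣)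
  open import Data.Vec using (_∷_)
  open import Data.Product using (_×_; _,_; proj₁; proj₂)
  open import Data.Sum using (inj₁; inj₂)
  open import Data.Empty using (⊥-elim)
  open import Relation.Nullary using (yes; no)
  open import Relation.Binary.PropositionalEquality hiding (resp)
  open import Defs
  open Sums
  open Booleans
  module Edges = CycleSum
  open Factorisation using (seqC)
  open CoverColourings
  open Subsets
  open Walks using (double; evenBound; oddBound)
  open ProductBounds

  module Bound (p q M : ℕ) (hM : 1 ≤ M) (N : ℕ) (H : Cover (cycleSum (suc (suc p)) (suc (suc q))) N)
             (fold : IsFold (suc M) H) where

    G : Graph
    G = cycleSum (suc (suc p)) (suc (suc q))

    open Cov G N H
    module Factor = Factorisation.Colourings p q N ℓc κc (λ a b x y → hSym H x y)
    open Factor using (PC; sD; lt-nG)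
    module Paths = Walks.InCover N ℓc κc

    ℓc-lt : ∀ a (lt : a < nV) x → ℓc a x ≡ memᵇ x (L H (fromℕ< lt))
    ℓc-lt a lt x with a <? nV
    ... | yes _ = refl
    ... | no ¬lt = ⊥-elim (¬lt lt)

    list-size : ∀ a → a < nV → ΣF N (λ x → ⟦ ℓc a x ⟧) ≡ suc M
    list-size a lt = trans (ΣF-cong N (λ x → cong ⟦_⟧ (ℓc-lt a lt x))) (trans (sym (card (L H (fromℕ< lt)))) (fold (fromℕ< lt)))

    edge-bound : ∀ {a b} → Edges.Ed p q a b → a < nV × b < nV
    edge-bound ed = lt-nG (proj₁ (Edges.Ed-bd p q ed)) , lt-nG (proj₂ (Edges.Ed-bd p q ed))

    edge-adj : ∀ {a b} (ed : Edges.Ed p q a b) → adj G (fromℕ< (proj₁ (edge-bound ed))) (fromℕ< (proj₂ (edge-bound ed))) ≡ true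
    edge-adj {a} {b} ed = subst₂ (λ u v → Edges.E p q u v ≡ true) (sym (toℕ-fromℕ< (proj₁ (edge-bound ed)))) (sym (toℕ-fromℕ< (proj₂ (edge-bound ed)))) (proj₁ (Edges.Ed→E p q ed))

    edge-adj′ : ∀ {a b} (ed : Edges.Ed p q a b) → adj G (fromℕ< (proj₂ (edge-bound ed))) (fromℕ< (proj₁ (edge-bound ed))) ≡ true
    edge-adj′ {a} {b} ed = subst₂ (λ u v → Edges.E p q u v ≡ true) (sym (toℕ-fromℕ< (proj₂ (edge-bound ed)))) (sym (toℕ-fromℕ< (proj₁ (edge-bound ed)))) (proj₂ (Edges.Ed→E p q ed))

    edge-fwd : ∀ {a b} → Edges.Ed p q a b → ∀ x y z → ℓc a x ≡ true → ℓc b y ≡ true → ℓc b z ≡ true → hAdj H x y ≡ true → hAdj H x z ≡ true → y ≡ z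
    edge-fwd {a} {b} ed x y z hx hy hz kxy kxz =
      match H _ _ (edge-adj ed) x y z (toIn (trans (sym (ℓc-lt a la x)) hx)) (toIn (trans (sym (ℓc-lt b lb y)) hy)) (toIn (trans (sym (ℓc-lt b lb z)) hz)) kxy kxz
      where la = proj₁ (edge-bound ed)
            lb = proj₂ (edge-bound ed)

    edge-bwd : ∀ {a b} → Edges.Ed p q a b → ∀ y x z → ℓc b y ≡ true → ℓc a x ≡ true → ℓc a z ≡ true → hAdj H x y ≡ true → hAdj H z y ≡ true → x ≡ z
    edge-bwd {a} {b} ed y x z hy hx hz kxy kzy =
      match H _ _ (edge-adj′ ed) y x z (toIn (trans (sym (ℓc-lt b lb y)) hy)) (toIn (trans (sym (ℓc-lt a la x)) hx)) (toIn (trans (sym (ℓc-lt a la z)) hz))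
            (trans (hSym H y x) kxy) (trans (hSym H y z) kzy)
      where la = proj₁ (edge-bound ed)
            lb = proj₂ (edge-bound ed)

    module _ (a : Fin N) (ha : ℓc 0 a ≡ true) where
      open Paths.Inv M hM a

      hypC : Hyp seqC p
      hypC = record
        { sz = λ i le → list-size (suc i) (lt-nG (s≤s (s≤s (≤-trans le (m≤m+n p q)))))
        ; fw = λ i lt → edge-fwd (Edges.eC i lt)
        ; bw = λ i lt → edge-bwd (Edges.eC i lt)
        ; en = λ x z hx hz kx kz → edge-bwd Edges.eC0 a x z ha hx hz kx kz }

      hypD : Hyp sD q
      hypD = record
        { sz = sz
        ; fw = λ i lt → edge-fwd (Edges.eD i lt)
        ; bw = λ i lt → edge-bwd (Edges.eD i lt)
        ; en = λ x z hx hz kx kz → edge-bwd Edges.eD0 a x z ha hx hz kx kz }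
        where
        sz : ∀ i → i ≤ q → Size (sD i)
        sz i le with m≤n⇒m<n∨m≡n le
        ... | inj₁ lt = list-size (sD i) (proj₁ (edge-bound (Edges.eD i lt)))
        ... | inj₂ refl = list-size (sD q) (proj₁ (edge-bound Edges.eD0))

      free-at-1 : M ≤ ΣF N (λ b → ⟦ ℓc 1 b ∧ not (hAdj H a b) ⟧)
      free-at-1 = unmatched (ℓc 1) (hAdj H a) (list-size 1 (proj₂ (edge-bound Edges.e01)))
                (λ y z py pz → edge-fwd Edges.e01 a y z ha (proj₁ (∧-true py)) (proj₁ (∧-true pz)) (proj₂ (∧-true py)) (proj₂ (∧-true pz)))

    -- H has a vertex (needed as a default value for choice vectors).
    someColour : Fin N
    someColour = elemFin (L H u0) (fold u0)
      where
      u0 : Fin nV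
      u0 = fromℕ< (proj₁ (edge-bound Edges.e01))
      elemFin : ∀ {K} (S : Subset K) {k} → ∣ S ∣ ≡ suc k → Fin K
      elemFin (b ∷ S) _ = fz

    Factorised : ℕ
    Factorised = ΣF N (λ a → ΣF N (λ b → ⟦ ℓc 0 a ∧ (ℓc 1 b ∧ not (κc 0 1 a b)) ⟧ * (PC seqC p b a * PC sD q b a)))

    count-factorised : P-DP-cover G H ≡ Factorised
    count-factorised = trans (countCover someColour) Factor.count

    module _ (a : Fin N) (ha : ℓc 0 a ≡ true) where
      open Paths.Inv M hM a
      evenC : ∀ j → p ≡ double j → EvenInv seqC p j
      evenC j e = subst (λ t → EvenInv seqC t j) (sym e) (even-inv j seqC (subst (Hyp seqC) e (hypC a ha)))
      oddC : ∀ j → p ≡ suc (double j) → OddInv seqC p j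
      oddC j e = subst (λ t → OddInv seqC t j) (sym e) (odd-inv j seqC (subst (Hyp seqC) e (hypC a ha)))
      evenD : ∀ j → q ≡ double j → EvenInv sD q j
      evenD j e = subst (λ t → EvenInv sD t j) (sym e) (even-inv j sD (subst (Hyp sD) e (hypD a ha)))
      oddD : ∀ j → q ≡ suc (double j) → OddInv sD q j
      oddD j e = subst (λ t → OddInv sD t j) (sym e) (odd-inv j sD (subst (Hyp sD) e (hypD a ha)))

    free : Fin N → Fin N → Bool
    free a b = ℓc 1 b ∧ not (hAdj H a b)

    X : Fin N → Fin N → ℕ
    X a b = PC seqC p b a * PC sD q b a

    free-in-list : ∀ a b → free a b ≡ true → ℓc 1 b ≡ true
    free-in-list a b e = proj₁ (∧-true e)

    from-inner : ∀ V c → (∀ a → ℓc 0 a ≡ true → V ≤ ΣF N (λ b → ⟦ free a b ⟧ * X a b) + c) →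
                 suc M * V ≤ P-DP-cover G H + suc M * c
    from-inner V c inner = subst (λ z → suc M * V ≤ z + suc M * c) (sym count-factorised)
      (outer-sum N (ℓc 0) free X V c M (list-size 0 (proj₁ (edge-bound Edges.e01))) inner)

    lower-odd-odd : ∀ jC jD → p ≡ suc (double jC) → q ≡ suc (double jD) →
                    suc M * (M * (oddBound M jC * oddBound M jD)) ≤ P-DP-cover G H
    lower-odd-odd jC jD ep eq = ≤-trans (from-inner _ 0 (λ a ha → ≤-trans
        (sum-odd-odd N (free a) (ℓc 1) (λ b → PC seqC p b a) (λ b → PC sD q b a) _ _ M (free-in-list a) (free-at-1 a ha)
                     (proj₁ (oddC a ha jC ep)) (proj₁ (oddD a ha jD eq)))
        (m≤m+n _ 0)))
      (≤-reflexive (trans (cong (P-DP-cover G H +_) (*-zeroʳ (suc M))) (+-identityʳ _)))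

    lower-even-even : ∀ jC jD → p ≡ double jC → q ≡ double jD →
                      suc M * (M * (evenBound M jC * evenBound M jD)) ≤ P-DP-cover G H + suc M * (evenBound M jC + evenBound M jD)
    lower-even-even jC jD ep eq = from-inner _ _ (λ a ha →
      sum-even-even N (free a) (ℓc 1) (λ b → PC seqC p b a) (λ b → PC sD q b a) _ _ M (free-in-list a) (free-at-1 a ha)
                    (proj₁ (evenC a ha jC ep)) (proj₁ (proj₂ (evenC a ha jC ep)))
                    (proj₁ (evenD a ha jD eq)) (proj₁ (proj₂ (evenD a ha jD eq))))

    lower-odd-even : ∀ jC jD → p ≡ suc (double jC) → q ≡ double jD →
                     suc M * (M * (oddBound M jC * evenBound M jD)) ≤ P-DP-cover G H + suc M * oddBound M jC
    lower-odd-even jC jD ep eq = from-inner _ _ (λ a ha →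
      sum-odd-even N (free a) (ℓc 1) (λ b → PC seqC p b a) (λ b → PC sD q b a) _ _ M (free-in-list a) (free-at-1 a ha)
                   (proj₁ (oddC a ha jC ep))
                   (proj₁ (evenD a ha jD eq)) (proj₁ (proj₂ (evenD a ha jD eq))))

-- Proper colourings of a path with m colours: ω t i z is the number of
-- proper colourings of a path with t inner vertices whose first vertex has
-- colour i and whose last vertex has colour z.
module ProperPaths where

  open import Data.Nat using (ℕ; zero; suc; _+_; _*_; _≤_)
  open import Data.Nat.Properties
  open import Data.Nat.Tactic.RingSolver using (solve-∀)
  open import Data.Bool using (true; not)
  open import Data.Fin using (Fin)
  open import Relation.Binary.PropositionalEquality
  open Sums
  open Booleans
  open Walks using (double; evenBound; oddBound; oddBound+1)

  module Counts (m : ℕ) where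
    module Paths = Walks.InCover m (λ _ _ → true) (λ _ _ → eqF)

    ω : ℕ → Fin m → Fin m → ℕ
    ω t i z = Paths.PC (λ j → j) t i z

    ω-seq : ∀ seq t i z → Paths.PC seq t i z ≡ ω t i z
    ω-seq seq zero i z = trans (Paths.PC-zero seq i z) (sym (Paths.PC-zero (λ j → j) i z))
    ω-seq seq (suc t) i z = trans (Paths.PC-suc seq t i z)
       (trans (ΣF-cong m (λ y → cong (⟦ not (eqF i y) ⟧ *_) (trans (ω-seq (λ j → seq (suc j)) t y z) (sym (ω-seq (λ j → suc j) t y z)))))
         (sym (Paths.PC-suc (λ j → j) t i z)))

    ω-suc : ∀ t i z → ω (suc t) i z ≡ ΣF m (λ y → ⟦ not (eqF i y) ⟧ * ω t y z)
    ω-suc t i z = trans (Paths.PC-suc (λ j → j) t i z) (ΣF-cong m (λ y → cong (⟦ not (eqF i y) ⟧ *_) (ω-seq (λ j → suc j) t y z)))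

    ω-zero : ∀ i z → ω 0 i z ≡ ⟦ not (eqF i z) ⟧
    ω-zero i z = Paths.PC-zero (λ j → j) i z

    ω-rec : ∀ t i z → ω (suc t) i z + ω t i z ≡ ΣF m (λ y → ω t y z)
    ω-rec t i z = trans (cong (_+ ω t i z) (trans (ω-suc t i z) (ΣF-cong m (λ y → cong (λ b → ⟦ not b ⟧ * ω t y z) (eqF-comm i y)))))
                  (trans (+-comm _ (ω t i z)) (sym (ΣF-split m i (λ y → ω t y z))))

    Σ-eqF : ∀ (z : Fin m) → ΣF m (λ y → ⟦ eqF y z ⟧) ≡ 1
    Σ-eqF z = trans (ΣF-cong m (λ y → sym (*-identityʳ _))) (ΣF-delta m z (λ _ → 1))

  module Closed (M : ℕ) (hM : 1 ≤ M) where
    open Counts (suc M) public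

    ω-even : ∀ j i z → ω (double j) i z + ⟦ eqF i z ⟧ ≡ evenBound M j
    ω-odd : ∀ j i z → ω (suc (double j)) i z ≡ oddBound M j + ⟦ eqF i z ⟧
    ω-even zero i z = trans (cong (_+ ⟦ eqF i z ⟧) (ω-zero i z)) (⟦not⟧ (eqF i z))
    ω-even (suc j) i z = +-cancelʳ-≡ (oddBound M j) _ _ (begin
        ω (suc (suc (double j))) i z + ⟦ eqF i z ⟧ + oddBound M j ≡⟨ reassoc (ω (suc (suc (double j))) i z) ⟦ eqF i z ⟧ (oddBound M j) ⟩
        ω (suc (suc (double j))) i z + (oddBound M j + ⟦ eqF i z ⟧) ≡⟨ cong (ω (suc (suc (double j))) i z +_) (sym (ω-odd j i z)) ⟩
        ω (suc (suc (double j))) i z + ω (suc (double j)) i z ≡⟨ ω-rec (suc (double j)) i z ⟩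
        ΣF (suc M) (λ y → ω (suc (double j)) y z) ≡⟨ ΣF-cong (suc M) (λ y → ω-odd j y z) ⟩
        ΣF (suc M) (λ y → oddBound M j + ⟦ eqF y z ⟧) ≡⟨ ΣF-+ (suc M) (λ y → oddBound M j) (λ y → ⟦ eqF y z ⟧) ⟩
        ΣF (suc M) (λ y → oddBound M j) + ΣF (suc M) (λ y → ⟦ eqF y z ⟧) ≡⟨ cong₂ _+_ (ΣF-const (suc M) (oddBound M j)) (Σ-eqF z) ⟩
        suc M * oddBound M j + 1 ≡⟨ peel-one M (oddBound M j) ⟩
        M * oddBound M j + 1 + oddBound M j ∎)
      where
      open ≡-Reasoning
      reassoc : ∀ a b c → a + b + c ≡ a + (c + b)
      reassoc = solve-∀
      peel-one : ∀ M e → suc M * e + 1 ≡ M * e + 1 + e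
      peel-one = solve-∀
    ω-odd j i z = +-cancelʳ-≡ (ω (double j) i z + ⟦ eqF i z ⟧) _ _ (begin
        ω (suc (double j)) i z + (ω (double j) i z + ⟦ eqF i z ⟧) ≡⟨ sym (+-assoc (ω (suc (double j)) i z) (ω (double j) i z) ⟦ eqF i z ⟧) ⟩
        ω (suc (double j)) i z + ω (double j) i z + ⟦ eqF i z ⟧ ≡⟨ cong (_+ ⟦ eqF i z ⟧) (ω-rec (double j) i z) ⟩
        ΣF (suc M) (λ y → ω (double j) y z) + ⟦ eqF i z ⟧ ≡⟨ cong (_+ ⟦ eqF i z ⟧) (+-cancelʳ-≡ 1 _ _ sumeq) ⟩
        oddBound M j + evenBound M j + ⟦ eqF i z ⟧ ≡⟨ swap-last (oddBound M j) (evenBound M j) ⟦ eqF i z ⟧ ⟩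
        oddBound M j + ⟦ eqF i z ⟧ + evenBound M j ≡⟨ cong (oddBound M j + ⟦ eqF i z ⟧ +_) (sym (ω-even j i z)) ⟩
        oddBound M j + ⟦ eqF i z ⟧ + (ω (double j) i z + ⟦ eqF i z ⟧) ∎)
      where
      open ≡-Reasoning
      swap-last : ∀ a b c → a + b + c ≡ a + c + b
      swap-last = solve-∀
      sumeq : ΣF (suc M) (λ y → ω (double j) y z) + 1 ≡ oddBound M j + evenBound M j + 1
      sumeq = begin
        ΣF (suc M) (λ y → ω (double j) y z) + 1 ≡⟨ cong (ΣF (suc M) (λ y → ω (double j) y z) +_) (sym (Σ-eqF z)) ⟩
        ΣF (suc M) (λ y → ω (double j) y z) + ΣF (suc M) (λ y → ⟦ eqF y z ⟧) ≡⟨ sym (ΣF-+ (suc M) (λ y → ω (double j) y z) (λ y → ⟦ eqF y z ⟧)) ⟩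
        ΣF (suc M) (λ y → ω (double j) y z + ⟦ eqF y z ⟧) ≡⟨ ΣF-cong (suc M) (λ y → ω-even j y z) ⟩
        ΣF (suc M) (λ y → evenBound M j) ≡⟨ ΣF-const (suc M) (evenBound M j) ⟩
        suc M * evenBound M j ≡⟨ suc-* M (evenBound M j) ⟩
        M * evenBound M j + evenBound M j ≡⟨ cong (_+ evenBound M j) (oddBound+1 M hM j) ⟩
        oddBound M j + 1 + evenBound M j ≡⟨ swap-last (oddBound M j) 1 (evenBound M j) ⟩
        oddBound M j + evenBound M j + 1 ∎
        where
        suc-* : ∀ M o → suc M * o ≡ M * o + o
        suc-* = solve-∀


module Chromatic where

  open import Data.Nat using (ℕ; suc; _*_)
  open import Data.Bool using (true; _∧_; not)
  open import Data.List using (List; []; _∷_; allFin)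
  open import Data.Bool.ListAction using (all)
  open import Relation.Binary.PropositionalEquality
  open import Defs
  open Sums
  open Booleans
  open Factorisation using (seqC)
  open ProperPaths

  -- A proper colouring is a list colouring with every colour available.
  allTrue : ∀ {A : Set} (xs : List A) → all (λ _ → true) xs ≡ true
  allTrue [] = refl
  allTrue (x ∷ xs) = allTrue xs

  module Formula (p q m : ℕ) where
    G : Graph
    G = cycleSum (suc (suc p)) (suc (suc q))

    module Factor = Factorisation.Colourings p q m (λ _ _ → true) (λ _ _ → eqF) (λ a b x y → eqF-comm x y)
    open Counts m

    P-formula : P G m ≡ ΣF m (λ a → ΣF m (λ b → ⟦ not (eqF a b) ⟧ * (ω p b a * ω q b a)))
    P-formula = trans (len-filter (isProperᵇ G) (allVecs (allFin m) (n G)))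
      (trans (ΣV-cong m (n G) (λ c → cong ⟦_⟧ (cong (_∧ isProperᵇ G c) (sym (allTrue (allFin (n G)))))))
      (trans Factor.count (ΣF-cong m (λ a → ΣF-cong m (λ b →
         cong (⟦ not (eqF a b) ⟧ *_) (cong₂ _*_ (ω-seq seqC p b a) (ω-seq Factor.sD q b a)))))))


-- Start from the identity cover of G
-- (vertex u × colour i) and twist the two edges at 0 leaving the paths:
-- the colour i at 0 is matched with σC i at the end of the C-path and with
-- σD i at the end of the D-path.  Then each path count is an ω, so (⋆)
-- becomes an explicit double sum over colours (count-twisted).
module TwistedCover where

  open import Data.Nat using (ℕ; zero; suc; _*_; _≡ᵇ_; _≤_; _<_; z≤n; s≤s; _<?_)
  open import Data.Nat.Properties
  open import Data.Bool using (Bool; true; false; _∧_; _∨_; not; if_then_else_)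
  open import Data.Fin using (Fin; toℕ; fromℕ<; combine; remQuot) renaming (zero to fz)
  open import Data.Fin.Properties using (toℕ-fromℕ<; toℕ<n; remQuot-combine; combine-remQuot)
  open import Data.Fin.Subset using (Subset; ∣_∣) renaming (_∈_ to _∈ˢ_)
  open import Data.Vec using (tabulate)
  open import Data.Vec.Properties using (lookup∘tabulate)
  open import Data.Product using (_,_; proj₁; proj₂)
  open import Data.Sum using (_⊎_; inj₁; inj₂)
  open import Data.Empty using (⊥-elim)
  open import Relation.Nullary using (¬_; yes; no)
  open import Relation.Binary.PropositionalEquality hiding (resp)
  open import Defs
  open Sums
  open Booleans
  module Edges = CycleSum
  open Factorisation using (seqC)
  open CoverColourings
  open Subsets
  open ProperPaths

  module Twisted (p q M' : ℕ) (hp : 1 ≤ p) (hq : 1 ≤ q) (σC σD : Fin (suc M') → Fin (suc M'))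
            (injC : ∀ i j → σC i ≡ σC j → i ≡ j) (injD : ∀ i j → σD i ≡ σD j → i ≡ j) where

    -- H has the vertices combine u i (vertex u of G, colour i), N = n G · m of them.
    m : ℕ
    m = suc M'

    G : Graph
    G = cycleSum (suc (suc p)) (suc (suc q))

    nV : ℕ
    nV = n G

    N : ℕ
    N = nV * m

    vert : Fin N → Fin nV
    vert x = proj₁ (remQuot {nV} m x)

    col : Fin N → Fin m
    col x = proj₂ (remQuot {nV} m x)

    vert-combine : ∀ u i → vert (combine u i) ≡ u
    vert-combine u i = cong proj₁ (remQuot-combine {nV} {m} u i)

    col-combine : ∀ u i → col (combine u i) ≡ i
    col-combine u i = cong proj₂ (remQuot-combine {nV} {m} u i)

    combine-vert-col : ∀ x → combine (vert x) (col x) ≡ x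
    combine-vert-col x = combine-remQuot {nV} m x

    -- The last vertices of the C-path and of the D-path (neighbours of 0).
    P0 Q0 : ℕ
    P0 = suc p
    Q0 = Edges.seqD p q q

    twist : ℕ → ℕ → Fin m → Fin m
    twist a b i = if (a ≡ᵇ 0) ∧ (b ≡ᵇ P0) then σC i else (if (a ≡ᵇ 0) ∧ (b ≡ᵇ Q0) then σD i else i)

    twist-inj : ∀ a b i j → twist a b i ≡ twist a b j → i ≡ j
    twist-inj a b i j e with (a ≡ᵇ 0) ∧ (b ≡ᵇ P0)
    ... | true = injC i j e
    ... | false with (a ≡ᵇ 0) ∧ (b ≡ᵇ Q0)
    ... | true = injD i j e
    ... | false = e

    twist-id : ∀ a b i → ¬ a ≡ 0 → twist a b i ≡ i
    twist-id a b i ne rewrite ≡ᵇ-false a 0 ne = refl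

    twistMatch : ℕ → ℕ → Fin m → Fin m → Bool
    twistMatch a b i j = eqF (twist a b i) (twist b a j)

    twistAdj : Fin N → Fin N → Bool
    twistAdj x y = (eqF (vert x) (vert y) ∧ not (eqF (col x) (col y))) ∨ (adj G (vert x) (vert y) ∧ twistMatch (toℕ (vert x)) (toℕ (vert y)) (col x) (col y))

    twistAdj-sym : ∀ x y → twistAdj x y ≡ twistAdj y x
    twistAdj-sym x y = cong₂ _∨_ (cong₂ _∧_ (eqF-comm (vert x) (vert y)) (cong not (eqF-comm (col x) (col y))))
                           (cong₂ _∧_ (Edges.E-sym p q (toℕ (vert x)) (toℕ (vert y))) (eqF-comm (twist (toℕ (vert x)) (toℕ (vert y)) (col x)) _))

    twistAdj-irr : ∀ x → twistAdj x x ≡ false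
    twistAdj-irr x rewrite eqF-refl (vert x) | eqF-refl (col x) = refl

    Lt : Fin nV → Subset N
    Lt u = tabulate (λ x → eqF (vert x) u)

    mem-Lt : ∀ x u → memᵇ x (Lt u) ≡ eqF (vert x) u
    mem-Lt x u = trans (mem-lookup x (Lt u)) (lookup∘tabulate _ x)

    vert-Lt : ∀ {x u} → x ∈ˢ Lt u → vert x ≡ u
    vert-Lt {x} {u} m' = eqF-sound _ _ (trans (sym (mem-Lt x u)) (fromIn m'))

    in-Lt : ∀ x → x ∈ˢ Lt (vert x)
    in-Lt x = toIn (trans (mem-Lt x (vert x)) (eqF-refl (vert x)))

    vert-col-inj : ∀ x y → vert x ≡ vert y → col x ≡ col y → x ≡ y
    vert-col-inj x y ev ec = trans (sym (combine-vert-col x)) (trans (cong₂ combine ev ec) (combine-vert-col y))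

    adj-vv : ∀ u → adj G u u ≡ false
    adj-vv u = Edges.E-irr p q (toℕ u)

    twistedCover : Cover G N
    twistedCover = record
      { hAdj = twistAdj
      ; hSym = twistAdj-sym
      ; hIrr = twistAdj-irr
      ; L = Lt
      ; cov = λ x → vert x , in-Lt x
      ; disj = λ x u v mu mv → trans (sym (vert-Lt mu)) (vert-Lt mv)
      ; cliq = clique
      ; resp = respects-G
      ; match = matching }
      where
      clique : ∀ u x y → x ∈ˢ Lt u → y ∈ˢ Lt u → ¬ x ≡ y → twistAdj x y ≡ true
      clique u x y mx my ne = true-∨ˡ _ (true-∧ (subst (λ z → eqF (vert x) z ≡ true) (trans (vert-Lt mx) (sym (vert-Lt my))) (eqF-refl (vert x)))
                                       (not-false (eqF-false (col x) (col y) (λ ec → ne (vert-col-inj x y (trans (vert-Lt mx) (sym (vert-Lt my))) ec)))))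
      respects-G : ∀ u v x y → x ∈ˢ Lt u → y ∈ˢ Lt v → twistAdj x y ≡ true → u ≡ v ⊎ adj G u v ≡ true
      respects-G u v x y mx my h with ∨-true {eqF (vert x) (vert y) ∧ not (eqF (col x) (col y))} h
      ... | inj₁ h1 = inj₁ (trans (sym (vert-Lt mx)) (trans (eqF-sound _ _ (proj₁ (∧-true h1))) (vert-Lt my)))
      ... | inj₂ h2 = inj₂ (subst₂ (λ a b → adj G a b ≡ true) (vert-Lt mx) (vert-Lt my) (proj₁ (∧-true h2)))
      matching : ∀ u v → adj G u v ≡ true → ∀ x y z → x ∈ˢ Lt u → y ∈ˢ Lt v → z ∈ˢ Lt v
                → twistAdj x y ≡ true → twistAdj x z ≡ true → y ≡ z
      matching u v auv x y z mx my mz hxy hxz = vert-col-inj y z (trans (vert-Lt my) (sym (vert-Lt mz))) (twist-inj (toℕ v) (toℕ u) _ _ (trans (twisted-colour y my hxy) (sym (twisted-colour z mz hxz))))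
        where
        neq : ¬ u ≡ v
        neq e = false≢true (trans (sym (adj-vv u)) (subst (λ w → adj G u w ≡ true) (sym e) auv))
        twisted-colour : ∀ w → w ∈ˢ Lt v → twistAdj x w ≡ true → twist (toℕ v) (toℕ u) (col w) ≡ twist (toℕ u) (toℕ v) (col x)
        twisted-colour w mw h with ∨-true {eqF (vert x) (vert w) ∧ not (eqF (col x) (col w))} h
        ... | inj₁ h1 = ⊥-elim (neq (trans (sym (vert-Lt mx)) (trans (eqF-sound _ _ (proj₁ (∧-true h1))) (vert-Lt mw))))
        ... | inj₂ h2 = sym (eqF-sound _ _ (subst₂ (λ s t → twistMatch (toℕ s) (toℕ t) (col x) (col w) ≡ true) (vert-Lt mx) (vert-Lt mw) (proj₂ (∧-true {adj G (vert x) (vert w)} h2))))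

    Σ-block : ∀ (u : Fin nV) (F : Fin N → ℕ) → ΣF N (λ x → ⟦ eqF (vert x) u ⟧ * F x) ≡ ΣF m (λ i → F (combine u i))
    Σ-block u F = begin
      ΣF N (λ x → ⟦ eqF (vert x) u ⟧ * F x) ≡⟨ ΣF-comb nV m _ ⟩
      ΣF nV (λ w → ΣF m (λ i → ⟦ eqF (vert (combine w i)) u ⟧ * F (combine w i))) ≡⟨ ΣF-cong nV (λ w → ΣF-cong m (λ i → cong (λ z → ⟦ eqF z u ⟧ * F (combine w i)) (vert-combine w i))) ⟩
      ΣF nV (λ w → ΣF m (λ i → ⟦ eqF w u ⟧ * F (combine w i))) ≡⟨ ΣF-cong nV (λ w → ΣF-*ˡ m ⟦ eqF w u ⟧ (λ i → F (combine w i))) ⟩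
      ΣF nV (λ w → ⟦ eqF w u ⟧ * ΣF m (λ i → F (combine w i))) ≡⟨ ΣF-delta nV u _ ⟩
      ΣF m (λ i → F (combine u i)) ∎
      where open ≡-Reasoning

    twisted-fold : IsFold m twistedCover
    twisted-fold u = begin
      ∣ Lt u ∣ ≡⟨ card (Lt u) ⟩
      ΣF N (λ x → ⟦ memᵇ x (Lt u) ⟧) ≡⟨ ΣF-cong N (λ x → trans (cong ⟦_⟧ (mem-Lt x u)) (sym (*-identityʳ _))) ⟩
      ΣF N (λ x → ⟦ eqF (vert x) u ⟧ * 1) ≡⟨ Σ-block u (λ _ → 1) ⟩
      ΣF m (λ _ → 1) ≡⟨ trans (ΣF-const m 1) (*-identityʳ m) ⟩
      m ∎
      where open ≡-Reasoning

    open Cov G N twistedCover using (ℓc; κc; countCover)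

    ℓc-char : ∀ j x → ℓc j x ≡ (toℕ (vert x) ≡ᵇ j)
    ℓc-char j x with j <? nV
    ... | yes lt = trans (mem-Lt x (fromℕ< lt)) (cong (toℕ (vert x) ≡ᵇ_) (toℕ-fromℕ< lt))
    ... | no ¬lt = sym (≡ᵇ-false _ _ (λ e → ¬lt (subst (_< nV) e (toℕ<n (vert x)))))

    Σ-blockℕ : ∀ j (lt : j < nV) (F : Fin N → ℕ) → ΣF N (λ x → ⟦ ℓc j x ⟧ * F x) ≡ ΣF m (λ i → F (combine (fromℕ< lt) i))
    Σ-blockℕ j lt F = trans (ΣF-cong N (λ x → cong (λ z → ⟦ z ⟧ * F x)
                        (trans (ℓc-char j x) (cong (toℕ (vert x) ≡ᵇ_) (sym (toℕ-fromℕ< lt)))))) (Σ-block (fromℕ< lt) F)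

    twistAdj-edge : ∀ x y → eqF (vert x) (vert y) ≡ false → adj G (vert x) (vert y) ≡ true → twistAdj x y ≡ twistMatch (toℕ (vert x)) (toℕ (vert y)) (col x) (col y)
    twistAdj-edge x y e1 e2 = cong₂ (λ s t → (s ∧ not (eqF (col x) (col y))) ∨ (t ∧ twistMatch (toℕ (vert x)) (toℕ (vert y)) (col x) (col y))) e1 e2

    twistAdj-Ed : ∀ x y a b → toℕ (vert x) ≡ a → toℕ (vert y) ≡ b → Edges.Ed p q a b → twistAdj x y ≡ twistMatch a b (col x) (col y)
    twistAdj-Ed x y a b ea eb ed = trans (twistAdj-edge x y e1 e2) (cong₂ (λ s t → twistMatch s t (col x) (col y)) ea eb)
      where
      e1 : eqF (vert x) (vert y) ≡ false
      e1 = trans (cong₂ _≡ᵇ_ ea eb) (≡ᵇ-false a b (Edges.Ed-ne p q ed))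
      e2 : adj G (vert x) (vert y) ≡ true
      e2 = trans (cong₂ (Edges.E p q) ea eb) (proj₁ (Edges.Ed→E p q ed))

    module Factor = Factorisation.Colourings p q N ℓc κc (λ a b x y → twistAdj-sym x y)
    open Factor using (PC; sD; lt-nG)
    open Counts m using (ω; ω-suc; ω-zero)

    path-count : ∀ seq t (τ : Fin m → Fin m) →
      (∀ j → j ≤ t → seq j < nV) → (∀ j → j ≤ t → ¬ seq j ≡ 0) → (∀ j → j < t → Edges.Ed p q (seq j) (seq (suc j))) →
      Edges.Ed p q (seq t) 0 → (∀ i → twist 0 (seq t) i ≡ τ i) →
      ∀ x a → toℕ (vert x) ≡ seq 0 → toℕ (vert a) ≡ 0 → PC seq t x a ≡ ω t (col x) (τ (col a))
    path-count seq zero τ hlt hnz hed hend hτ x a ex ea =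
      trans (Walks.InCover.PC-zero N ℓc κc seq x a)
        (trans (cong (λ b → ⟦ not b ⟧) (trans (twistAdj-Ed x a (seq 0) 0 ex ea hend)
                   (cong₂ eqF (twist-id (seq 0) 0 (col x) (hnz 0 z≤n)) (hτ (col a)))))
               (sym (ω-zero (col x) (τ (col a)))))
    path-count seq (suc t) τ hlt hnz hed hend hτ x a ex ea = begin
      PC seq (suc t) x a ≡⟨ Walks.InCover.PC-suc N ℓc κc seq t x a ⟩
      ΣF N (λ y → ⟦ ℓc (seq 1) y ∧ not (twistAdj x y) ⟧ * PC s' t y a) ≡⟨ ΣF-cong N (λ y → trans (cong (_* PC s' t y a) (⟦∧⟧ (ℓc (seq 1) y) _)) (*-assoc ⟦ ℓc (seq 1) y ⟧ _ _)) ⟩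
      ΣF N (λ y → ⟦ ℓc (seq 1) y ⟧ * (⟦ not (twistAdj x y) ⟧ * PC s' t y a)) ≡⟨ Σ-blockℕ (seq 1) lt1 (λ y → ⟦ not (twistAdj x y) ⟧ * PC s' t y a) ⟩
      ΣF m (λ i → ⟦ not (twistAdj x (atNext i)) ⟧ * PC s' t (atNext i) a) ≡⟨ ΣF-cong m (λ i → cong₂ (λ b w → ⟦ not b ⟧ * w) (twistAdj-step i) (IH i)) ⟩
      ΣF m (λ i → ⟦ not (eqF (col x) i) ⟧ * ω t i (τ (col a))) ≡⟨ sym (ω-suc t (col x) (τ (col a))) ⟩
      ω (suc t) (col x) (τ (col a)) ∎
      where
      open ≡-Reasoning
      s' : ℕ → ℕ
      s' j = seq (suc j)
      lt1 : seq 1 < nV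
      lt1 = hlt 1 (s≤s z≤n)
      atNext : Fin m → Fin N
      atNext i = combine (fromℕ< lt1) i
      vert-next : ∀ i → toℕ (vert (atNext i)) ≡ seq 1
      vert-next i = trans (cong toℕ (vert-combine (fromℕ< lt1) i)) (toℕ-fromℕ< lt1)
      twistAdj-step : ∀ i → twistAdj x (atNext i) ≡ eqF (col x) i
      twistAdj-step i = trans (twistAdj-Ed x (atNext i) (seq 0) (seq 1) ex (vert-next i) (hed 0 (s≤s z≤n)))
                     (cong₂ eqF (twist-id (seq 0) (seq 1) (col x) (hnz 0 z≤n)) (trans (twist-id (seq 1) (seq 0) (col (atNext i)) (hnz 1 (s≤s z≤n))) (col-combine _ i)))
      IH : ∀ i → PC s' t (atNext i) a ≡ ω t i (τ (col a))
      IH i = trans (path-count s' t τ (λ j le → hlt (suc j) (s≤s le)) (λ j le → hnz (suc j) (s≤s le)) (λ j lt → hed (suc j) (s≤s lt)) hend hτ (atNext i) a (vert-next i) ea)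
                   (cong (λ c → ω t c (τ (col a))) (col-combine _ i))

    lt0 : 0 < nV
    lt0 = lt-nG (s≤s z≤n)
    lt1' : 1 < nV
    lt1' = lt-nG (s≤s (s≤s z≤n))

    at0 at1 : Fin m → Fin N
    at0 i = combine (fromℕ< lt0) i
    at1 i = combine (fromℕ< lt1') i

    v0 : ∀ i → toℕ (vert (at0 i)) ≡ 0
    v0 i = trans (cong toℕ (vert-combine (fromℕ< lt0) i)) (toℕ-fromℕ< lt0)
    v1 : ∀ i → toℕ (vert (at1 i)) ≡ 1
    v1 i = trans (cong toℕ (vert-combine (fromℕ< lt1') i)) (toℕ-fromℕ< lt1')

    sD-nz : ∀ j → ¬ sD j ≡ 0
    sD-nz zero ()
    sD-nz (suc j) ()

    sD≢P0 : ∀ j → 1 ≤ j → ¬ sD j ≡ P0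
    sD≢P0 (suc j) _ e = <-irrefl (sym (suc-injective e)) (s≤s (m≤m+n p j))

    one≢P0 : ¬ 1 ≡ P0
    one≢P0 e with () ← subst (1 ≤_) (sym (suc-injective e)) hp

    one≢sD : ∀ k → 1 ≤ k → ¬ 1 ≡ sD k
    one≢sD (suc k) _ ()

    twist-01 : ∀ i → twist 0 1 i ≡ i
    twist-01 i rewrite ≡ᵇ-false 1 P0 one≢P0 | ≡ᵇ-false 1 Q0 (one≢sD q hq) = refl

    twist-C : ∀ i → twist 0 (suc p) i ≡ σC i
    twist-C i rewrite ≡ᵇ-refl p = refl

    twist-D : ∀ i → twist 0 Q0 i ≡ σD i
    twist-D i rewrite ≡ᵇ-false Q0 P0 (sD≢P0 q hq) | ≡ᵇ-refl Q0 = refl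

    sD<nV : ∀ j → j ≤ q → sD j < nV
    sD<nV j le with m≤n⇒m<n∨m≡n le
    ... | inj₁ lt = lt-nG (proj₁ (Edges.Ed-bd p q (Edges.eD j lt)))
    ... | inj₂ refl = lt-nG (proj₁ (Edges.Ed-bd p q Edges.eD0))

    count-C : ∀ i k → PC seqC p (at1 k) (at0 i) ≡ ω p k (σC i)
    count-C i k = trans (path-count seqC p σC (λ j le → lt-nG (s≤s (s≤s (≤-trans le (m≤m+n p q))))) (λ j _ ()) (λ j lt → Edges.eC j lt) Edges.eC0 twist-C
                             (at1 k) (at0 i) (v1 k) (v0 i))
                      (cong₂ (λ c d → ω p c (σC d)) (col-combine _ k) (col-combine _ i))

    count-D : ∀ i k → PC sD q (at1 k) (at0 i) ≡ ω q k (σD i)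
    count-D i k = trans (path-count sD q σD sD<nV (λ j _ → sD-nz j) (λ j lt → Edges.eD j lt) Edges.eD0 twist-D
                             (at1 k) (at0 i) (v1 k) (v0 i))
                      (cong₂ (λ c d → ω q c (σD d)) (col-combine _ k) (col-combine _ i))

    twistAdj-01 : ∀ i k → twistAdj (at0 i) (at1 k) ≡ eqF i k
    twistAdj-01 i k = trans (twistAdj-Ed (at0 i) (at1 k) 0 1 (v0 i) (v1 k) Edges.e01)
                     (cong₂ eqF (trans (twist-01 (col (at0 i))) (col-combine _ i)) (trans (twist-id 1 0 (col (at1 k)) (λ ())) (col-combine _ k)))

    count-twisted : P-DP-cover G twistedCover ≡ ΣF m (λ i → ΣF m (λ k → ⟦ not (eqF i k) ⟧ * (ω p k (σC i) * ω q k (σD i))))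
    count-twisted = begin
      P-DP-cover G twistedCover ≡⟨ countCover (at0 fz) ⟩
      ΣV N nV (λ c → ⟦ Cov.validChoice G N twistedCover c ⟧) ≡⟨ Factor.count ⟩
      ΣF N (λ a → ΣF N (λ b → ⟦ ℓc 0 a ∧ (ℓc 1 b ∧ not (twistAdj a b)) ⟧ * X a b)) ≡⟨ ΣF-cong N (λ a → inner a) ⟩
      ΣF N (λ a → ⟦ ℓc 0 a ⟧ * ΣF N (λ b → ⟦ ℓc 1 b ⟧ * (⟦ not (twistAdj a b) ⟧ * X a b))) ≡⟨ Σ-blockℕ 0 lt0 (λ a → ΣF N (λ b → ⟦ ℓc 1 b ⟧ * (⟦ not (twistAdj a b) ⟧ * X a b))) ⟩
      ΣF m (λ i → ΣF N (λ b → ⟦ ℓc 1 b ⟧ * (⟦ not (twistAdj (at0 i) b) ⟧ * X (at0 i) b))) ≡⟨ ΣF-cong m (λ i → Σ-blockℕ 1 lt1' (λ b → ⟦ not (twistAdj (at0 i) b) ⟧ * X (at0 i) b)) ⟩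
      ΣF m (λ i → ΣF m (λ k → ⟦ not (twistAdj (at0 i) (at1 k)) ⟧ * X (at0 i) (at1 k))) ≡⟨ ΣF-cong m (λ i → ΣF-cong m (λ k →
          cong₂ (λ b w → ⟦ not b ⟧ * w) (twistAdj-01 i k) (cong₂ _*_ (count-C i k) (count-D i k)))) ⟩
      ΣF m (λ i → ΣF m (λ k → ⟦ not (eqF i k) ⟧ * (ω p k (σC i) * ω q k (σD i)))) ∎
      where
      open ≡-Reasoning
      X : Fin N → Fin N → ℕ
      X a b = PC seqC p b a * PC sD q b a
      inner : ∀ a → ΣF N (λ b → ⟦ ℓc 0 a ∧ (ℓc 1 b ∧ not (twistAdj a b)) ⟧ * X a b) ≡ ⟦ ℓc 0 a ⟧ * ΣF N (λ b → ⟦ ℓc 1 b ⟧ * (⟦ not (twistAdj a b) ⟧ * X a b))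
      inner a = trans (ΣF-cong N (λ b → trans (cong (_* X a b) (trans (⟦∧⟧ (ℓc 0 a) _) (cong (⟦ ℓc 0 a ⟧ *_) (⟦∧⟧ (ℓc 1 b) _))))
                       (trans (*-assoc ⟦ ℓc 0 a ⟧ _ _) (cong (⟦ ℓc 0 a ⟧ *_) (*-assoc ⟦ ℓc 1 b ⟧ _ _)))))
                      (ΣF-*ˡ N ⟦ ℓc 0 a ⟧ _)


-- With suitable
-- twists every row i has the same value, which is the lower bound.
module TwistedSums where

  open import Data.Nat using (ℕ; suc; _+_; _*_)
  open import Data.Nat.Properties
  open import Data.Nat.Tactic.RingSolver using (solve-∀)
  open import Data.Bool using (Bool; true; false; _∧_; not)
  open import Data.Fin using (Fin)
  open import Data.Empty using (⊥-elim)
  open import Relation.Nullary using (¬_)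
  open import Relation.Binary.PropositionalEquality
  open Sums
  open Booleans

  Σ-others : ∀ M (i : Fin (suc M)) → ΣF (suc M) (λ k → ⟦ not (eqF i k) ⟧) ≡ M
  Σ-others M i = +-cancelˡ-≡ 1 _ _ (begin
    1 + ΣF (suc M) (λ k → ⟦ not (eqF i k) ⟧)
      ≡⟨ cong (1 +_) (ΣF-cong (suc M) (λ k → trans (cong (λ b → ⟦ not b ⟧) (eqF-comm i k)) (sym (*-identityʳ _)))) ⟩
    1 + ΣF (suc M) (λ k → ⟦ not (eqF k i) ⟧ * 1) ≡⟨ sym (ΣF-split (suc M) i (λ _ → 1)) ⟩
    ΣF (suc M) (λ _ → 1) ≡⟨ ΣF-const (suc M) 1 ⟩
    suc M * 1 ≡⟨ *-identityʳ (suc M) ⟩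
    1 + M ∎)
    where open ≡-Reasoning

  Σ-others-point : ∀ M (i c : Fin (suc M)) → ¬ c ≡ i → ΣF (suc M) (λ k → ⟦ not (eqF i k) ⟧ * ⟦ eqF k c ⟧) ≡ 1
  Σ-others-point M i c ne = trans (ΣF-cong (suc M) (λ k → *-comm ⟦ not (eqF i k) ⟧ ⟦ eqF k c ⟧)) (trans (ΣF-delta (suc M) c (λ k → ⟦ not (eqF i k) ⟧))
                     (cong (λ b → ⟦ not b ⟧) (eqF-false i c (λ e → ne (sym e)))))

  row-even-even-pointwise : ∀ A B x y (e0 ec ed : Bool) → x + ⟦ ec ⟧ ≡ A → y + ⟦ ed ⟧ ≡ B → (ec ∧ ed) ≡ false →
         ⟦ e0 ⟧ * (x * y) + (B * (⟦ e0 ⟧ * ⟦ ec ⟧) + A * (⟦ e0 ⟧ * ⟦ ed ⟧)) ≡ (A * B) * ⟦ e0 ⟧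
  row-even-even-pointwise .(x + ⟦ ec ⟧) .(y + ⟦ ed ⟧) x y false ec ed refl refl h = ring-identity x y ⟦ ec ⟧ ⟦ ed ⟧
    where ring-identity : ∀ x y a b → 0 + ((y + b) * 0 + (x + a) * 0) ≡ ((x + a) * (y + b)) * 0
          ring-identity = solve-∀
  row-even-even-pointwise .(x + ⟦ false ⟧) .(y + ⟦ false ⟧) x y true false false refl refl h = ring-identity x y
    where ring-identity : ∀ x y → (x * y + 0) + ((y + 0) * 0 + (x + 0) * 0) ≡ ((x + 0) * (y + 0)) * 1
          ring-identity = solve-∀
  row-even-even-pointwise .(x + ⟦ true ⟧) .(y + ⟦ false ⟧) x y true true false refl refl h = ring-identity x y
    where ring-identity : ∀ x y → (x * y + 0) + ((y + 0) * 1 + (x + 1) * 0) ≡ ((x + 1) * (y + 0)) * 1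
          ring-identity = solve-∀
  row-even-even-pointwise .(x + ⟦ false ⟧) .(y + ⟦ true ⟧) x y true false true refl refl h = ring-identity x y
    where ring-identity : ∀ x y → (x * y + 0) + ((y + 1) * 0 + (x + 0) * 1) ≡ ((x + 0) * (y + 1)) * 1
          ring-identity = solve-∀
  row-even-even-pointwise _ _ x y true true true refl refl ()

  module _ (M : ℕ) where
    m = suc M

    row-even-even : ∀ (x y : Fin m → ℕ) A B (i c d : Fin m) → ¬ c ≡ i → ¬ d ≡ i → ¬ c ≡ d →
           (∀ k → x k + ⟦ eqF k c ⟧ ≡ A) → (∀ k → y k + ⟦ eqF k d ⟧ ≡ B) →
           ΣF m (λ k → ⟦ not (eqF i k) ⟧ * (x k * y k)) + (A + B) ≡ M * (A * B)
    row-even-even x y A B i c d ci di cd hx hy = begin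
      S + (A + B) ≡⟨ cong (S +_) (+-comm A B) ⟩
      S + (B + A) ≡⟨ cong (λ z → S + (z + A)) (sym (trans (cong (B *_) (Σ-others-point M i c ci)) (*-identityʳ B))) ⟩
      S + (B * ΣF m (λ k → ⟦ not (eqF i k) ⟧ * ⟦ eqF k c ⟧) + A) ≡⟨ cong (λ z → S + (B * ΣF m (λ k → ⟦ not (eqF i k) ⟧ * ⟦ eqF k c ⟧) + z)) (sym (trans (cong (A *_) (Σ-others-point M i d di)) (*-identityʳ A))) ⟩
      S + (B * ΣF m (λ k → ⟦ not (eqF i k) ⟧ * ⟦ eqF k c ⟧) + A * ΣF m (λ k → ⟦ not (eqF i k) ⟧ * ⟦ eqF k d ⟧))
          ≡⟨ cong (S +_) (sym (cong₂ _+_ (ΣF-*ˡ m B (λ k → ⟦ not (eqF i k) ⟧ * ⟦ eqF k c ⟧)) (ΣF-*ˡ m A (λ k → ⟦ not (eqF i k) ⟧ * ⟦ eqF k d ⟧)))) ⟩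
      S + (ΣF m (λ k → B * (⟦ not (eqF i k) ⟧ * ⟦ eqF k c ⟧)) + ΣF m (λ k → A * (⟦ not (eqF i k) ⟧ * ⟦ eqF k d ⟧))) ≡⟨ cong (S +_) (sym (ΣF-+ m (λ k → B * (⟦ not (eqF i k) ⟧ * ⟦ eqF k c ⟧)) (λ k → A * (⟦ not (eqF i k) ⟧ * ⟦ eqF k d ⟧)))) ⟩
      S + ΣF m (λ k → B * (⟦ not (eqF i k) ⟧ * ⟦ eqF k c ⟧) + A * (⟦ not (eqF i k) ⟧ * ⟦ eqF k d ⟧)) ≡⟨ sym (ΣF-+ m (λ k → ⟦ not (eqF i k) ⟧ * (x k * y k)) (λ k → B * (⟦ not (eqF i k) ⟧ * ⟦ eqF k c ⟧) + A * (⟦ not (eqF i k) ⟧ * ⟦ eqF k d ⟧))) ⟩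
      ΣF m (λ k → ⟦ not (eqF i k) ⟧ * (x k * y k) + (B * (⟦ not (eqF i k) ⟧ * ⟦ eqF k c ⟧) + A * (⟦ not (eqF i k) ⟧ * ⟦ eqF k d ⟧)))
          ≡⟨ ΣF-cong m (λ k → row-even-even-pointwise A B (x k) (y k) (not (eqF i k)) (eqF k c) (eqF k d) (hx k) (hy k) (cd' k)) ⟩
      ΣF m (λ k → (A * B) * ⟦ not (eqF i k) ⟧) ≡⟨ ΣF-*ˡ m (A * B) (λ k → ⟦ not (eqF i k) ⟧) ⟩
      (A * B) * ΣF m (λ k → ⟦ not (eqF i k) ⟧) ≡⟨ cong ((A * B) *_) (Σ-others M i) ⟩
      (A * B) * M ≡⟨ *-comm (A * B) M ⟩
      M * (A * B) ∎
      where
      open ≡-Reasoning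
      S = ΣF m (λ k → ⟦ not (eqF i k) ⟧ * (x k * y k))
      cd' : ∀ k → (eqF k c ∧ eqF k d) ≡ false
      cd' k with eqF k c in e1 | eqF k d in e2
      ... | true | true = ⊥-elim (cd (trans (sym (eqF-sound k c e1)) (eqF-sound k d e2)))
      ... | true | false = refl
      ... | false | _ = refl

    row-odd-even : ∀ (x y : Fin m → ℕ) A B (i d : Fin m) → ¬ d ≡ i →
            (∀ k → ¬ k ≡ i → x k ≡ A) → (∀ k → y k + ⟦ eqF k d ⟧ ≡ B) →
            ΣF m (λ k → ⟦ not (eqF i k) ⟧ * (x k * y k)) + A ≡ M * (A * B)
    row-odd-even x y A B i d di hx hy = begin
      S + A ≡⟨ cong (S +_) (sym (trans (cong (A *_) (Σ-others-point M i d di)) (*-identityʳ A))) ⟩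
      S + A * ΣF m (λ k → ⟦ not (eqF i k) ⟧ * ⟦ eqF k d ⟧) ≡⟨ cong (S +_) (sym (ΣF-*ˡ m A (λ k → ⟦ not (eqF i k) ⟧ * ⟦ eqF k d ⟧))) ⟩
      S + ΣF m (λ k → A * (⟦ not (eqF i k) ⟧ * ⟦ eqF k d ⟧)) ≡⟨ sym (ΣF-+ m (λ k → ⟦ not (eqF i k) ⟧ * (x k * y k)) (λ k → A * (⟦ not (eqF i k) ⟧ * ⟦ eqF k d ⟧))) ⟩
      ΣF m (λ k → ⟦ not (eqF i k) ⟧ * (x k * y k) + A * (⟦ not (eqF i k) ⟧ * ⟦ eqF k d ⟧)) ≡⟨ ΣF-cong m pw ⟩
      ΣF m (λ k → (A * B) * ⟦ not (eqF i k) ⟧) ≡⟨ ΣF-*ˡ m (A * B) (λ k → ⟦ not (eqF i k) ⟧) ⟩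
      (A * B) * ΣF m (λ k → ⟦ not (eqF i k) ⟧) ≡⟨ cong ((A * B) *_) (Σ-others M i) ⟩
      (A * B) * M ≡⟨ *-comm (A * B) M ⟩
      M * (A * B) ∎
      where
      open ≡-Reasoning
      S = ΣF m (λ k → ⟦ not (eqF i k) ⟧ * (x k * y k))
      pw : ∀ k → ⟦ not (eqF i k) ⟧ * (x k * y k) + A * (⟦ not (eqF i k) ⟧ * ⟦ eqF k d ⟧) ≡ (A * B) * ⟦ not (eqF i k) ⟧
      pw k with eqF i k in e
      ... | true = trans (*-zeroʳ A) (sym (*-zeroʳ (A * B)))
      ... | false = trans (cong (λ z → 1 * (z * y k) + A * (1 * ⟦ eqF k d ⟧)) (hx k ne))
                    (trans (cong₂ _+_ (+-identityʳ (A * y k)) (cong (A *_) (+-identityʳ _))) (trans (sym (*-distribˡ-+ A (y k) _)) (trans (cong (A *_) (hy k)) (sym (*-identityʳ (A * B))))))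
        where
        ne : ¬ k ≡ i
        ne ki = false≢true (trans (sym e) (trans (cong (eqF i) ki) (eqF-refl i)))

    row-odd-odd : ∀ (x y : Fin m → ℕ) A B (i : Fin m) →
          (∀ k → ¬ k ≡ i → x k ≡ A) → (∀ k → ¬ k ≡ i → y k ≡ B) →
          ΣF m (λ k → ⟦ not (eqF i k) ⟧ * (x k * y k)) ≡ M * (A * B)
    row-odd-odd x y A B i hx hy = trans (ΣF-cong m pw) (trans (ΣF-*ˡ m (A * B) (λ k → ⟦ not (eqF i k) ⟧)) (trans (cong ((A * B) *_) (Σ-others M i)) (*-comm (A * B) M)))
      where
      pw : ∀ k → ⟦ not (eqF i k) ⟧ * (x k * y k) ≡ (A * B) * ⟦ not (eqF i k) ⟧
      pw k with eqF i k in e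
      ... | true = sym (*-zeroʳ (A * B))
      ... | false = trans (+-identityʳ _) (trans (cong₂ _*_ (hx k ne) (hy k ne)) (sym (*-identityʳ (A * B))))
        where
        ne : ¬ k ≡ i
        ne ki = false≢true (trans (sym e) (trans (cong (eqF i) ki) (eqF-refl i)))


-- The cyclic shift i ↦ i + 1 (mod M + 1) on Fin (suc M): injective, without
-- fixed points when M ≥ 1, and without fixed points of its square when
-- M ≥ 2.  These are the twists used for even cycles.
module Rotation where

  open import Data.Nat using (ℕ; zero; suc; _≤_; _<_; z≤n; s≤s; _<?_)
  open import Data.Nat.Properties
  open import Data.Fin using (Fin; toℕ; fromℕ<) renaming (zero to fz)
  open import Data.Fin.Properties using (toℕ-fromℕ<; toℕ<n; toℕ-injective)
  open import Data.Sum using (_⊎_; inj₁; inj₂)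
  open import Data.Empty using (⊥-elim)
  open import Relation.Nullary using (¬_; yes; no)
  open import Relation.Binary.PropositionalEquality

  module R (M : ℕ) where
    rot : Fin (suc M) → Fin (suc M)
    rot i with suc (toℕ i) <? suc M
    ... | yes lt = fromℕ< lt
    ... | no _ = fz

    rot-yes : ∀ i → toℕ i < M → toℕ (rot i) ≡ suc (toℕ i)
    rot-yes i lt with suc (toℕ i) <? suc M
    ... | yes lt' = toℕ-fromℕ< lt'
    ... | no ¬lt = ⊥-elim (¬lt (s≤s lt))

    rot-no : ∀ i → toℕ i ≡ M → toℕ (rot i) ≡ 0
    rot-no i e with suc (toℕ i) <? suc M
    ... | yes lt' = ⊥-elim (<-irrefl e (≤-pred lt'))
    ... | no _ = refl

    last? : ∀ (i : Fin (suc M)) → (toℕ i < M) ⊎ (toℕ i ≡ M)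
    last? i with toℕ i <? M
    ... | yes lt = inj₁ lt
    ... | no ¬lt = inj₂ (≤-antisym (≤-pred (toℕ<n i)) (≮⇒≥ ¬lt))

    rot-inj : ∀ i j → rot i ≡ rot j → i ≡ j
    rot-inj i j e with last? i | last? j
    ... | inj₁ li | inj₁ lj = toℕ-injective (suc-injective (trans (sym (rot-yes i li)) (trans (cong toℕ e) (rot-yes j lj))))
    ... | inj₁ li | inj₂ ej with () ← trans (sym (rot-yes i li)) (trans (cong toℕ e) (rot-no j ej))
    ... | inj₂ ei | inj₁ lj with () ← trans (sym (rot-no i ei)) (trans (cong toℕ e) (rot-yes j lj))
    ... | inj₂ ei | inj₂ ej = toℕ-injective (trans ei (sym ej))

    rot-ne : 1 ≤ M → ∀ i → ¬ rot i ≡ i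
    rot-ne hM i e with last? i
    ... | inj₁ li = <-irrefl (trans (sym (cong toℕ e)) (rot-yes i li)) (n<1+n (toℕ i))
    ... | inj₂ ei = <-irrefl (trans (sym (rot-no i ei)) (trans (cong toℕ e) ei)) hM

    rot2-ne : 2 ≤ M → ∀ i → ¬ rot (rot i) ≡ i
    rot2-ne hM i e with last? i
    ... | inj₂ ei with last? (rot i)
    ...   | inj₁ l2 = <-irrefl (sym (trans (sym ei) (trans (sym (cong toℕ e)) (trans (rot-yes (rot i) l2) (cong suc (rot-no i ei)))))) (≤-trans (s≤s (s≤s z≤n)) hM)
    ...   | inj₂ e2 = <-irrefl (trans (sym (rot-no i ei)) e2) (≤-trans (s≤s z≤n) hM)
    rot2-ne hM i e | inj₁ li with last? (rot i)
    ...   | inj₁ l2 = <-irrefl (trans (sym (cong toℕ e)) (trans (rot-yes (rot i) l2) (cong suc (rot-yes i li)))) (≤-trans (n<1+n (toℕ i)) (n≤1+n (suc (toℕ i))))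
    ...   | inj₂ e2 = <-irrefl (trans (sym (rot-no (rot i) e2)) (cong toℕ e)) (pos (toℕ i) M (trans (sym (rot-yes i li)) e2) hM)
      where
      pos : ∀ a M → suc a ≡ M → 2 ≤ M → 0 < a
      pos zero .1 refl (s≤s ())
      pos (suc a) M _ _ = s≤s z≤n

module ClosedForms where

  open import Data.Nat using (ℕ; zero; suc; _+_; _*_; _∸_; _^_; _≤_)
  open import Data.Nat.Properties
  import Data.Nat.Tactic.RingSolver as NS
  open import Data.Integer using (ℤ; +_; _-_) renaming (_*_ to _*ℤ_; _+_ to _+ℤ_; _^_ to _^ℤ_)
  import Data.Integer.Properties as ZP
  import Data.Integer.Tactic.RingSolver as ZS
  open import Relation.Binary.PropositionalEquality
  open Walks using (double; evenBound; oddBound; oddBound+1)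

  double≡ : ∀ j → double j ≡ 2 * j
  double≡ zero = refl
  double≡ (suc j) = trans (cong (λ z → suc (suc z)) (double≡ j)) (two-more j)
    where two-more : ∀ j → suc (suc (2 * j)) ≡ 2 * suc j
          two-more = NS.solve-∀

  pos-^ : ∀ a e → + (a ^ e) ≡ (+ a) ^ℤ e
  pos-^ a zero = refl
  pos-^ a (suc e) = trans (ZP.pos-* a (a ^ e)) (cong ((+ a) *ℤ_) (pos-^ a e))

  ∸-ℤ : ∀ a b → b ≤ a → + (a ∸ b) ≡ + a - + b
  ∸-ℤ a b le = sym (trans (ZP.[+m]-[+n]≡m⊖n a b) (ZP.⊖-≥ le))

  suc-ℤ : ∀ M → + (suc M) ≡ + M +ℤ + 1
  suc-ℤ M = trans (cong +_ (+-comm 1 M)) (ZP.pos-+ M 1)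

  module _ (M : ℕ) (hM : 1 ≤ M) where
    evenBound-closedℕ : ∀ j → suc M * evenBound M j ≡ M ^ suc (double j) + 1
    oddBound-closedℕ : ∀ j → suc M * oddBound M j + 1 ≡ M ^ suc (suc (double j))
    evenBound-closedℕ zero = base M
      where base : ∀ M → suc M * 1 ≡ M * 1 + 1
            base = NS.solve-∀
    evenBound-closedℕ (suc j) = trans (rearrange M (oddBound M j)) (cong (λ z → M * z + 1) (oddBound-closedℕ j))
      where rearrange : ∀ M e → suc M * (M * e + 1) ≡ M * (suc M * e + 1) + 1
            rearrange = NS.solve-∀
    oddBound-closedℕ j = +-cancelʳ-≡ M _ _ (begin
      suc M * oddBound M j + 1 + M ≡⟨ regroup₁ M (oddBound M j) ⟩
      suc M * (oddBound M j + 1) ≡⟨ cong (suc M *_) (sym (oddBound+1 M hM j)) ⟩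
      suc M * (M * evenBound M j) ≡⟨ regroup₂ M (evenBound M j) ⟩
      M * (suc M * evenBound M j) ≡⟨ cong (M *_) (evenBound-closedℕ j) ⟩
      M * (M ^ suc (double j) + 1) ≡⟨ regroup₃ M (M ^ suc (double j)) ⟩
      M * M ^ suc (double j) + M ∎)
      where
      open ≡-Reasoning
      regroup₁ : ∀ M e → suc M * e + 1 + M ≡ suc M * (e + 1)
      regroup₁ = NS.solve-∀
      regroup₂ : ∀ M o → suc M * (M * o) ≡ M * (suc M * o)
      regroup₂ = NS.solve-∀
      regroup₃ : ∀ M x → M * (x + 1) ≡ M * x + M
      regroup₃ = NS.solve-∀

    evenBound-closed : ∀ j → + (suc M) *ℤ + (evenBound M j) ≡ (+ M) ^ℤ (2 * j + 1) +ℤ + 1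
    evenBound-closed j = begin
      + (suc M) *ℤ + (evenBound M j) ≡⟨ sym (ZP.pos-* (suc M) (evenBound M j)) ⟩
      + (suc M * evenBound M j) ≡⟨ cong +_ (evenBound-closedℕ j) ⟩
      + (M ^ suc (double j) + 1) ≡⟨ ZP.pos-+ (M ^ suc (double j)) 1 ⟩
      + (M ^ suc (double j)) +ℤ + 1 ≡⟨ cong (_+ℤ + 1) (pos-^ M (suc (double j))) ⟩
      (+ M) ^ℤ suc (double j) +ℤ + 1 ≡⟨ cong (λ e → (+ M) ^ℤ e +ℤ + 1) (trans (cong suc (double≡ j)) (+-comm 1 (2 * j))) ⟩
      (+ M) ^ℤ (2 * j + 1) +ℤ + 1 ∎
      where open ≡-Reasoning

    oddBound-closed : ∀ j → + (suc M) *ℤ + (oddBound M j) +ℤ + 1 ≡ (+ M) ^ℤ (2 * j + 2)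
    oddBound-closed j = begin
      + (suc M) *ℤ + (oddBound M j) +ℤ + 1 ≡⟨ cong (_+ℤ + 1) (sym (ZP.pos-* (suc M) (oddBound M j))) ⟩
      + (suc M * oddBound M j) +ℤ + 1 ≡⟨ sym (ZP.pos-+ (suc M * oddBound M j) 1) ⟩
      + (suc M * oddBound M j + 1) ≡⟨ cong +_ (oddBound-closedℕ j) ⟩
      + (M ^ suc (suc (double j))) ≡⟨ pos-^ M (suc (suc (double j))) ⟩
      (+ M) ^ℤ suc (suc (double j)) ≡⟨ cong ((+ M) ^ℤ_) (trans (cong (λ z → suc (suc z)) (double≡ j)) (+-comm 2 (2 * j))) ⟩
      (+ M) ^ℤ (2 * j + 2) ∎
      where open ≡-Reasoning


  value-even-even : ∀ (M A B : ℕ) (α β : ℤ) → + (suc M) *ℤ + A ≡ α +ℤ + 1 → + (suc M) *ℤ + B ≡ β +ℤ + 1 →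
        + (suc M) *ℤ (+ (suc M * (M * (A * B))) - + (suc M * (A + B))) ≡ + M *ℤ (α *ℤ β) - β - α - + (suc M) - + 1
  value-even-even M A B α β hA hB = begin
    + (suc M) *ℤ (+ (suc M * (M * (A * B))) - + (suc M * (A + B)))
       ≡⟨ cong₂ (λ u v → + (suc M) *ℤ (u - v)) (trans (ZP.pos-* (suc M) _) (cong (+ (suc M) *ℤ_) (trans (ZP.pos-* M _) (cong (+ M *ℤ_) (ZP.pos-* A B)))))
                                                 (trans (ZP.pos-* (suc M) _) (cong (+ (suc M) *ℤ_) (ZP.pos-+ A B))) ⟩
    m' *ℤ (m' *ℤ (μ *ℤ (a *ℤ b)) - m' *ℤ (a +ℤ b)) ≡⟨ L1 m' μ a b ⟩
    μ *ℤ (m' *ℤ a) *ℤ (m' *ℤ b) - m' *ℤ (m' *ℤ a +ℤ m' *ℤ b) ≡⟨ cong₂ (λ u v → μ *ℤ u *ℤ v - m' *ℤ (u +ℤ v)) hA hB ⟩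
    μ *ℤ (α +ℤ + 1) *ℤ (β +ℤ + 1) - m' *ℤ ((α +ℤ + 1) +ℤ (β +ℤ + 1)) ≡⟨ cong (λ u → μ *ℤ (α +ℤ + 1) *ℤ (β +ℤ + 1) - u *ℤ ((α +ℤ + 1) +ℤ (β +ℤ + 1))) (suc-ℤ M) ⟩
    μ *ℤ (α +ℤ + 1) *ℤ (β +ℤ + 1) - (μ +ℤ + 1) *ℤ ((α +ℤ + 1) +ℤ (β +ℤ + 1)) ≡⟨ L2 μ α β ⟩
    μ *ℤ (α *ℤ β) - β - α - (μ +ℤ + 1) - + 1 ≡⟨ cong (λ u → μ *ℤ (α *ℤ β) - β - α - u - + 1) (sym (suc-ℤ M)) ⟩
    μ *ℤ (α *ℤ β) - β - α - + (suc M) - + 1 ∎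
    where
    open ≡-Reasoning
    m' = + (suc M)
    μ = + M
    a = + A
    b = + B
    L1 : ∀ m' μ a b → m' *ℤ (m' *ℤ (μ *ℤ (a *ℤ b)) - m' *ℤ (a +ℤ b)) ≡ μ *ℤ (m' *ℤ a) *ℤ (m' *ℤ b) - m' *ℤ (m' *ℤ a +ℤ m' *ℤ b)
    L1 = ZS.solve-∀
    L2 : ∀ μ α β → μ *ℤ (α +ℤ + 1) *ℤ (β +ℤ + 1) - (μ +ℤ + 1) *ℤ ((α +ℤ + 1) +ℤ (β +ℤ + 1)) ≡ μ *ℤ (α *ℤ β) - β - α - (μ +ℤ + 1) - + 1
    L2 = ZS.solve-∀

  value-odd-even : ∀ (M A B : ℕ) (γ β : ℤ) → + (suc M) *ℤ + A +ℤ + 1 ≡ γ → + (suc M) *ℤ + B ≡ β +ℤ + 1 →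
        + (suc M) *ℤ (+ (suc M * (M * (A * B))) - + (suc M * A)) ≡ γ *ℤ (+ M *ℤ β) - γ - + M *ℤ β +ℤ + 1
  value-odd-even M A B γ β hA hB = begin
    + (suc M) *ℤ (+ (suc M * (M * (A * B))) - + (suc M * A))
       ≡⟨ cong₂ (λ u v → + (suc M) *ℤ (u - v)) (trans (ZP.pos-* (suc M) _) (cong (+ (suc M) *ℤ_) (trans (ZP.pos-* M _) (cong (+ M *ℤ_) (ZP.pos-* A B)))))
                                                 (ZP.pos-* (suc M) A) ⟩
    m' *ℤ (m' *ℤ (μ *ℤ (a *ℤ b)) - m' *ℤ a) ≡⟨ L1 m' μ a b ⟩
    μ *ℤ (m' *ℤ a +ℤ + 1 - + 1) *ℤ (m' *ℤ b) - m' *ℤ (m' *ℤ a +ℤ + 1 - + 1) ≡⟨ cong₂ (λ u v → μ *ℤ (u - + 1) *ℤ v - m' *ℤ (u - + 1)) hA hB ⟩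
    μ *ℤ (γ - + 1) *ℤ (β +ℤ + 1) - m' *ℤ (γ - + 1) ≡⟨ cong (λ u → μ *ℤ (γ - + 1) *ℤ (β +ℤ + 1) - u *ℤ (γ - + 1)) (suc-ℤ M) ⟩
    μ *ℤ (γ - + 1) *ℤ (β +ℤ + 1) - (μ +ℤ + 1) *ℤ (γ - + 1) ≡⟨ L2 μ γ β ⟩
    γ *ℤ (μ *ℤ β) - γ - μ *ℤ β +ℤ + 1 ∎
    where
    open ≡-Reasoning
    m' = + (suc M)
    μ = + M
    a = + A
    b = + B
    L1 : ∀ m' μ a b → m' *ℤ (m' *ℤ (μ *ℤ (a *ℤ b)) - m' *ℤ a) ≡ μ *ℤ (m' *ℤ a +ℤ + 1 - + 1) *ℤ (m' *ℤ b) - m' *ℤ (m' *ℤ a +ℤ + 1 - + 1)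
    L1 = ZS.solve-∀
    L2 : ∀ μ γ β → μ *ℤ (γ - + 1) *ℤ (β +ℤ + 1) - (μ +ℤ + 1) *ℤ (γ - + 1) ≡ γ *ℤ (μ *ℤ β) - γ - μ *ℤ β +ℤ + 1
    L2 = ZS.solve-∀

  pow-split : ∀ (x : ℤ) a b c → a + b ≡ c → x ^ℤ c ≡ x ^ℤ a *ℤ x ^ℤ b
  pow-split x a b c refl = ZP.^-distribˡ-+-* x a b

  closed-even-even : ∀ M → 1 ≤ M → ∀ k l → let A = evenBound M k ; B = evenBound M l in
    suc M * (A + B) ≤ suc M * (M * (A * B)) →
    + (suc M) *ℤ + (suc M * (M * (A * B)) ∸ suc M * (A + B))
      ≡ (+ M) ^ℤ (2 * k + 2 * l + 3) - (+ M) ^ℤ (2 * l + 1) - (+ M) ^ℤ (2 * k + 1) - + (suc M) - + 1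
  closed-even-even M hM k l le = begin
    + (suc M) *ℤ + (X ∸ Y) ≡⟨ cong (+ (suc M) *ℤ_) (∸-ℤ X Y le) ⟩
    + (suc M) *ℤ (+ X - + Y) ≡⟨ value-even-even M A B α β (evenBound-closed M hM k) (evenBound-closed M hM l) ⟩
    + M *ℤ (α *ℤ β) - β - α - + (suc M) - + 1
      ≡⟨ cong (λ z → z - β - α - + (suc M) - + 1) (sym (trans (cong ((+ M) ^ℤ_) (sym (exponent k l)))
                                                              (cong (+ M *ℤ_) (pow-split (+ M) (2 * k + 1) (2 * l + 1) _ refl)))) ⟩
    (+ M) ^ℤ (2 * k + 2 * l + 3) - β - α - + (suc M) - + 1 ∎
    where
    open ≡-Reasoning
    A B X Y : ℕ
    A = evenBound M k
    B = evenBound M l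
    X = suc M * (M * (A * B))
    Y = suc M * (A + B)
    α β : ℤ
    α = (+ M) ^ℤ (2 * k + 1)
    β = (+ M) ^ℤ (2 * l + 1)
    exponent : ∀ k l → suc (2 * k + 1 + (2 * l + 1)) ≡ 2 * k + 2 * l + 3
    exponent = NS.solve-∀

  closed-odd-even : ∀ M → 1 ≤ M → ∀ k l → let A = oddBound M k ; B = evenBound M l in
    suc M * A ≤ suc M * (M * (A * B)) →
    + (suc M) *ℤ + (suc M * (M * (A * B)) ∸ suc M * A)
      ≡ (+ M) ^ℤ (2 * suc k + 2 * l + 2) - (+ M) ^ℤ (2 * suc k) - (+ M) ^ℤ (2 * l + 2) +ℤ + 1
  closed-odd-even M hM k l le = begin
    + (suc M) *ℤ + (X ∸ Y) ≡⟨ cong (+ (suc M) *ℤ_) (∸-ℤ X Y le) ⟩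
    + (suc M) *ℤ (+ X - + Y) ≡⟨ value-odd-even M A B γ β (oddBound-closed M hM k) (evenBound-closed M hM l) ⟩
    γ *ℤ (+ M *ℤ β) - γ - + M *ℤ β +ℤ + 1
      ≡⟨ cong₂ (λ u v → u - γ - v +ℤ + 1) (sym (trans (pow-split (+ M) (2 * k + 2) (2 * l + 2) _ (sum k l)) (cong (γ *ℤ_) (sym μβ)))) μβ ⟩
    (+ M) ^ℤ (2 * suc k + 2 * l + 2) - γ - (+ M) ^ℤ (2 * l + 2) +ℤ + 1
      ≡⟨ cong (λ u → (+ M) ^ℤ (2 * suc k + 2 * l + 2) - (+ M) ^ℤ u - (+ M) ^ℤ (2 * l + 2) +ℤ + 1) (twice-suc k) ⟩
    (+ M) ^ℤ (2 * suc k + 2 * l + 2) - (+ M) ^ℤ (2 * suc k) - (+ M) ^ℤ (2 * l + 2) +ℤ + 1 ∎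
    where
    open ≡-Reasoning
    A B X Y : ℕ
    A = oddBound M k
    B = evenBound M l
    X = suc M * (M * (A * B))
    Y = suc M * A
    γ β : ℤ
    γ = (+ M) ^ℤ (2 * k + 2)
    β = (+ M) ^ℤ (2 * l + 1)
    μβ : + M *ℤ β ≡ (+ M) ^ℤ (2 * l + 2)
    μβ = cong ((+ M) ^ℤ_) (trans (+-comm 1 (2 * l + 1)) (+-assoc (2 * l) 1 1))
    sum : ∀ k l → 2 * k + 2 + (2 * l + 2) ≡ 2 * suc k + 2 * l + 2
    sum = NS.solve-∀
    twice-suc : ∀ k → 2 * k + 2 ≡ 2 * suc k
    twice-suc = NS.solve-∀

module Cases where

  open import Data.Nat using (ℕ; zero; suc; _+_; _*_; _∸_; _≤_; z≤n; s≤s)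
  open import Data.Nat.Properties
  import Data.Nat.Tactic.RingSolver as NS
  open import Data.Bool using (not)
  open import Data.Fin using (Fin)
  open import Data.Vec using ([])
  open import Data.Product using (Σ; _×_; _,_)
  open import Relation.Nullary using (¬_)
  open import Relation.Binary.PropositionalEquality hiding (resp)
  open import Data.Integer using (+_; _-_) renaming (_*_ to _*ℤ_; _+_ to _+ℤ_; _^_ to _^ℤ_)
  open import Defs
  open Sums
  open Booleans
  open Walks using (double; evenBound; oddBound)
  open ProperPaths
  open Chromatic
  open TwistedSums
  open Rotation
  open ClosedForms

  emptyCover : (G : Graph) → Cover G 0
  emptyCover G = record
    { hAdj = λ ()
    ; hSym = λ ()
    ; hIrr = λ ()
    ; L = λ _ → []
    ; cov = λ ()
    ; disj = λ ()
    ; cliq = λ u ()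
    ; resp = λ u v ()
    ; match = λ u v a () }

  attained : ∀ G m X Y → (∀ N (H : Cover G N) → IsFold m H → X ≤ P-DP-cover G H + Y) →
             ∀ N (H : Cover G N) → IsFold m H → P-DP-cover G H + Y ≡ X → IsP-DP G m (X ∸ Y)
  attained G m X Y low N H fold e =
    (λ N' H' fold' → m≤n+o⇒m∸n≤o X Y (subst (X ≤_) (+-comm _ Y) (low N' H' fold'))) ,
    N , H , fold , sym (trans (cong (_∸ Y) (sym e)) (m+n∸n≡m (P-DP-cover G H) Y))

  rows-constant : ∀ M (S : Fin (suc M) → ℕ) c V → (∀ i → S i + c ≡ V) → ΣF (suc M) S + suc M * c ≡ suc M * V
  rows-constant M S c V rows = begin
    ΣF (suc M) S + suc M * c ≡⟨ cong (λ z → ΣF (suc M) S + z) (sym (ΣF-const (suc M) c)) ⟩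
    ΣF (suc M) S + ΣF (suc M) (λ _ → c) ≡⟨ sym (ΣF-+ (suc M) S (λ _ → c)) ⟩
    ΣF (suc M) (λ i → S i + c) ≡⟨ ΣF-cong (suc M) rows ⟩
    ΣF (suc M) (λ _ → V) ≡⟨ ΣF-const (suc M) V ⟩
    suc M * V ∎
    where open ≡-Reasoning

  double≥1 : ∀ k → 1 ≤ k → 1 ≤ double k
  double≥1 (suc k) _ = s≤s z≤n

  -- Case (i): C = C_{2jC+3}, D = C_{2jD+3}.  Every cover has at least P(G,m)
  -- colourings and the identity cover has exactly P(G,m).
  module OddOdd (jC jD : ℕ) where
    p q : ℕ
    p = suc (double jC)
    q = suc (double jD)
    G : Graph
    G = cycleSum (suc (suc p)) (suc (suc q))

    P-closed : ∀ M → 1 ≤ M → P G (suc M) ≡ suc M * (M * (oddBound M jC * oddBound M jD))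
    P-closed M hM = trans (Formula.P-formula p q (suc M))
      (trans (ΣF-cong (suc M) (λ i → row-odd-odd M (λ k → ω p k i) (λ k → ω q k i) (oddBound M jC) (oddBound M jD) i (off-diagonal jC) (off-diagonal jD)))
        (ΣF-const (suc M) _))
      where
      open Closed M hM
      off-diagonal : ∀ j {i} k → ¬ k ≡ i → ω (suc (double j)) k i ≡ oddBound M j
      off-diagonal j {i} k ne = trans (ω-odd j k i) (trans (cong (λ b → oddBound M j + ⟦ b ⟧) (eqF-false k i ne)) (+-identityʳ _))

    P≤P-DP : ∀ m N (H : Cover G N) → IsFold m H → P G m ≤ P-DP-cover G H
    P≤P-DP zero N H f = z≤n
    P≤P-DP (suc zero) N H f = subst (_≤ P-DP-cover G H) (sym (Formula.P-formula p q 1)) z≤n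
    P≤P-DP (suc (suc M)) N H f = subst (_≤ P-DP-cover G H) (sym (P-closed (suc M) (s≤s z≤n)))
       (LowerBound.Bound.lower-odd-odd p q (suc M) (s≤s z≤n) N H f jC jD refl refl)

    identity-attains : ∀ m → Σ ℕ (λ N → Σ (Cover G N) (λ H → IsFold m H × P-DP-cover G H ≡ P G m))
    identity-attains zero = 0 , emptyCover G , (λ _ → refl) , refl
    identity-attains (suc M) = N , twistedCover , twisted-fold , trans count-twisted (sym (Formula.P-formula p q (suc M)))
      where open TwistedCover.Twisted p q M (s≤s z≤n) (s≤s z≤n) (λ i → i) (λ i → i) (λ _ _ e → e) (λ _ _ e → e)

    P-DP≡P : ∀ m → IsP-DP G m (P G m)
    P-DP≡P m = P≤P-DP m , identity-attains m

  -- Case (ii): C = C_{2k+2}, D = C_{2l+2}, m = M + 1 ≥ 3.  The twists rot and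
  -- rot² make every row of count-twisted equal.
  module EvenEven (k l M : ℕ) (hk : 1 ≤ k) (hl : 1 ≤ l) (hM : 2 ≤ M) where
    p q : ℕ
    p = double k
    q = double l
    G : Graph
    G = cycleSum (suc (suc p)) (suc (suc q))
    hM1 : 1 ≤ M
    hM1 = ≤-trans (s≤s z≤n) hM
    A B X Y : ℕ
    A = evenBound M k
    B = evenBound M l
    X = suc M * (M * (A * B))
    Y = suc M * (A + B)

    rot = R.rot M
    module T = TwistedCover.Twisted p q M (double≥1 k hk) (double≥1 l hl) rot (λ i → rot (rot i))
                 (R.rot-inj M) (λ i j e → R.rot-inj M i j (R.rot-inj M _ _ e))
    open Closed M hM1

    count-attained : P-DP-cover G T.twistedCover + Y ≡ X
    count-attained = trans (cong (_+ Y) T.count-twisted) (rows-constant M (λ i → ΣF (suc M) (λ k' → ⟦ not (eqF i k') ⟧ * (ω p k' (rot i) * ω q k' (rot (rot i))))) (A + B) _ (λ i →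
      row-even-even M (λ k' → ω p k' (rot i)) (λ k' → ω q k' (rot (rot i))) A B i (rot i) (rot (rot i))
        (R.rot-ne M hM1 i) (R.rot2-ne M hM i) (λ e → R.rot-ne M hM1 (rot i) (sym e))
        (λ k' → ω-even k k' (rot i)) (λ k' → ω-even l k' (rot (rot i)))))

    P-DP-value : IsP-DP G (suc M) (X ∸ Y)
    P-DP-value = attained G (suc M) X Y (λ N H f → LowerBound.Bound.lower-even-even p q M hM1 N H f k l refl refl)
                          T.N T.twistedCover T.twisted-fold count-attained

    P-DP-closed : + (suc M) *ℤ + (X ∸ Y) ≡ (+ M) ^ℤ (2 * k + 2 * l + 3) - (+ M) ^ℤ (2 * l + 1) - (+ M) ^ℤ (2 * k + 1) - + (suc M) - + 1
    P-DP-closed = closed-even-even M hM1 k l (subst (Y ≤_) count-attained (m≤n+m Y (P-DP-cover G T.twistedCover)))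

  -- Case (iii): C = C_{2k'+3}, D = C_{2l+2}, m = M + 1 ≥ 2.  Only the even
  -- path is twisted, by rot.
  module OddEven (k' l M : ℕ) (hl : 1 ≤ l) (hM : 1 ≤ M) where
    p q : ℕ
    p = suc (double k')
    q = double l
    G : Graph
    G = cycleSum (suc (suc p)) (suc (suc q))
    A B X Y : ℕ
    A = oddBound M k'
    B = evenBound M l
    X = suc M * (M * (A * B))
    Y = suc M * A

    rot = R.rot M
    module T = TwistedCover.Twisted p q M (s≤s z≤n) (double≥1 l hl) (λ i → i) rot (λ _ _ e → e) (R.rot-inj M)
    open Closed M hM

    count-attained : P-DP-cover G T.twistedCover + Y ≡ X
    count-attained = trans (cong (_+ Y) T.count-twisted) (rows-constant M (λ i → ΣF (suc M) (λ k'' → ⟦ not (eqF i k'') ⟧ * (ω p k'' i * ω q k'' (rot i)))) A _ (λ i →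
      row-odd-even M (λ k'' → ω p k'' i) (λ k'' → ω q k'' (rot i)) A B i (rot i) (R.rot-ne M hM i)
        (λ k'' ne → trans (ω-odd k' k'' i) (trans (cong (λ b → oddBound M k' + ⟦ b ⟧) (eqF-false k'' i ne)) (+-identityʳ _)))
        (λ k'' → ω-even l k'' (rot i))))

    P-DP-value : IsP-DP G (suc M) (X ∸ Y)
    P-DP-value = attained G (suc M) X Y (λ N H f → LowerBound.Bound.lower-odd-even p q M hM N H f k' l refl refl)
                          T.N T.twistedCover T.twisted-fold count-attained

    P-DP-closed : + (suc M) *ℤ + (X ∸ Y) ≡ (+ M) ^ℤ (2 * suc k' + 2 * l + 2) - (+ M) ^ℤ (2 * suc k') - (+ M) ^ℤ (2 * l + 2) +ℤ + 1
    P-DP-closed = closed-odd-even M hM k' l (subst (Y ≤_) count-attained (m≤n+m Y (P-DP-cover G T.twistedCover)))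

  odd-length : ∀ j → 2 * suc j + 1 ≡ suc (suc (suc (double j)))
  odd-length j = trans (arith j) (cong (λ z → suc (suc (suc z))) (sym (double≡ j)))
    where arith : ∀ j → 2 * suc j + 1 ≡ suc (suc (suc (2 * j)))
          arith = NS.solve-∀

  even-length : ∀ j → 2 * j + 2 ≡ suc (suc (double j))
  even-length j = trans (+-comm (2 * j) 2) (cong (λ z → suc (suc z)) (sym (double≡ j)))

  case-odd-odd : ∀ (k l m : ℕ) → 1 ≤ k → k ≤ l →
    IsP-DP (cycleSum (2 * k + 1) (2 * l + 1)) m (P (cycleSum (2 * k + 1) (2 * l + 1)) m)
  case-odd-odd (suc k') (suc l') m _ _ =
    subst (λ G → IsP-DP G m (P G m)) (sym (cong₂ cycleSum (odd-length k') (odd-length l'))) (OddOdd.P-DP≡P k' l' m)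

  case-even-even : ∀ (k l m : ℕ) → 1 ≤ k → k ≤ l → 3 ≤ m →
    Σ ℕ λ v → IsP-DP (cycleSum (2 * k + 2) (2 * l + 2)) m v ×
    (+ m) *ℤ (+ v) ≡ (+ (m ∸ 1)) ^ℤ (2 * k + 2 * l + 3) - (+ (m ∸ 1)) ^ℤ (2 * l + 1)
    - (+ (m ∸ 1)) ^ℤ (2 * k + 1) - (+ m) - (+ 1)
  case-even-even k l (suc zero) hk hkl (s≤s ())
  case-even-even k l (suc (suc zero)) hk hkl (s≤s (s≤s ()))
  case-even-even k l (suc (suc (suc M))) hk hkl _ =
    X ∸ Y , subst (λ G → IsP-DP G (suc (suc (suc M))) (X ∸ Y)) (sym (cong₂ cycleSum (even-length k) (even-length l))) P-DP-value , P-DP-closed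
    where open EvenEven k l (suc (suc M)) hk (≤-trans hk hkl) (s≤s (s≤s z≤n))

  case-odd-even : ∀ (k l m : ℕ) → 1 ≤ k → 1 ≤ l → 2 ≤ m →
    Σ ℕ λ v → IsP-DP (cycleSum (2 * k + 1) (2 * l + 2)) m v ×
    (+ m) *ℤ (+ v) ≡ (+ (m ∸ 1)) ^ℤ (2 * k + 2 * l + 2) - (+ (m ∸ 1)) ^ℤ (2 * k)
    - (+ (m ∸ 1)) ^ℤ (2 * l + 2) +ℤ (+ 1)
  case-odd-even (suc k') l (suc zero) _ hl (s≤s ())
  case-odd-even (suc k') l (suc (suc M)) _ hl _ =
    X ∸ Y , subst (λ G → IsP-DP G (suc (suc M)) (X ∸ Y)) (sym (cong₂ cycleSum (odd-length k') (even-length l))) P-DP-value , P-DP-closed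
    where open OddEven k' l (suc M) hl (s≤s z≤n)

open import Defs
open import Data.Nat using (ℕ; suc; _+_; _*_; _∸_; _≤_)
open import Data.Product using (_×_; Σ; _,_)
open import Relation.Binary.PropositionalEquality using (_≡_)
open import Data.Integer using (ℤ; +_; _-_; _^_) renaming (_*_ to _*ℤ_; _+_ to _+ℤ_)
open Cases using (case-odd-odd; case-even-even; case-odd-even)

theorem4p1 : (∀ (k l m : ℕ) → 1 ≤ k → k ≤ l →
    IsP-DP (cycleSum (2 * k + 1) (2 * l + 1)) m
    (P (cycleSum (2 * k + 1) (2 * l + 1)) m))
    × (∀ (k l m : ℕ) → 1 ≤ k → k ≤ l → 3 ≤ m →
    Σ ℕ λ v → IsP-DP (cycleSum (2 * k + 2) (2 * l + 2)) m v ×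
    (+ m) *ℤ (+ v) ≡ (+ (m ∸ 1)) ^ (2 * k + 2 * l + 3) - (+ (m ∸ 1)) ^ (2 * l + 1)
    - (+ (m ∸ 1)) ^ (2 * k + 1) - (+ m) - (+ 1))
    × (∀ (k l m : ℕ) → 1 ≤ k → 1 ≤ l → 2 ≤ m →
    Σ ℕ λ v → IsP-DP (cycleSum (2 * k + 1) (2 * l + 2)) m v ×
    (+ m) *ℤ (+ v) ≡ (+ (m ∸ 1)) ^ (2 * k + 2 * l + 2) - (+ (m ∸ 1)) ^ (2 * k)
    - (+ (m ∸ 1)) ^ (2 * l + 2) +ℤ (+ 1))
theorem4p1 = case-odd-odd , case-even-even , case-odd-even
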